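{- Let $T$ be a set of rooted binary phylogenetic trees, each on a subset of $X$, and let $s$ be a full tree-child sequence for $T$. Then there exists a tree-child network $\mathcal{N}$ on $X$ displaying every tree of $T$, together with a semi-temporal labeling $t$ of $\mathcal{N}$, such that $r(\mathcal{N})\le w_T(s)$ and $d(\mathcal{N},t)\le d(s)$.
   Context: A network on $X$ is a rooted acyclic digraph whose root $\rho$ has in-degree 0 and out-degree $\neq 1$, whose leaves (out-degree 0) are exactly $X$, and whose other vertices are tree vertices (in-degree 1, out-degree $\ge 2$) or reticulations (out-degree 1, in-degree $\ge2$). Arcs into reticulations are hybridization arcs, the others tree arcs. The network is tree-child if every tree vertex has an outgoing tree arc. $r(\mathcal{N})=\sum_{v\ne\rho}(d^-(v)-1)$. A network displays a tree if the tree can be obtained by deleting arcs and vertices and suppressing vertices of in- and out-degree 1. A semi-temporal labeling of a tree-child network with vertex set $V$ is $t:V\to\mathbb{R}^+$ with $t(u)<t(v)$ for every tree arc $(u,v)$ and $t(v)=\min\{t(u):(u,v)\text{ an arc}\}$ for every reticulation $v$; $d(\mathcal{N},t)$ is the number of hybridization arcs $(u,v)$ with $t(u)\ne t(v)$. A tree is a rooted binary phylogenetic tree; for a leaf $x$, $\mathcal{T}\setminus\{x\}$ deletes $x$ and suppresses in/out-degree-1 vertices; $(a,b)\in\mathcal{T}$ means $a,b$ are leaves with a common parent. A generalized cherry picking sequence on $X$ is $s=((x_1,y_1),\dots,(x_r,y_r),(x_{r+1},-),\dots,(x_t,-))$ with all $x_i,y_i\in X$; it is full if $t>r$ and $\{x_1,\dots,x_t\}=X$.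 Applying $s$ to a tree $\mathcal{T}$: $\mathcal{T}^{(0)}=\mathcal{T}$, and for $j=1,\dots,r$, $\mathcal{T}^{(j)}=\mathcal{T}^{(j-1)}\setminus\{x_j\}$ if $(x_j,y_j)\in\mathcal{T}^{(j-1)}$, else $\mathcal{T}^{(j)}=\mathcal{T}^{(j-1)}$; $\mathcal{T}(s)=\mathcal{T}^{(r)}$. A full $s$ is a generalized cherry picking sequence for $T$ if for each $\mathcal{T}\in T$, $\mathcal{T}(s)$ consists of a single leaf belonging to $\{x_{r+1},\dots,x_t\}$. Its weight is $w_T(s)=|s|-|X|$. It is tree-child if $t=r+1$ and $y_j\ne x_i$ for all $1\le i<j\le r$; a full tree-child sequence for $T$ is a tree-child generalized cherry picking sequence for $T$. An element $(x_i,y_i)$ of $s$ is non-temporal if there are $j,k$ with $i<j<k\le t$, $x_j\ne x_i$ and $x_k=x_i$; $d(s)$ is the number of non-temporal elements. -}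

module Defs where

open import Data.Bool using (Bool; true; false; _∧_; _∨_; not; if_then_else_)
open import Data.Nat using (ℕ; zero; suc; _+_; _∸_; _≤_; _<ᵇ_)
open import Data.Fin using (Fin; _<_)
import Data.Fin as Fin
open import Data.List using (List; []; _∷_; _++_; length; filterᵇ; allFin; upTo; map; zip; take; cartesianProduct; lookup)
open import Data.Nat.ListAction using (sum)
open import Data.Bool.ListAction using (any)
open import Data.List.Relation.Unary.All using (All)
open import Data.List.Relation.Unary.Unique.Propositional using (Unique)
open import Data.List.Membership.Propositional using (_∈_)
open import Data.Maybe using (Maybe; just; nothing; fromMaybe)
open import Data.Product using (Σ; ∃; _×_; _,_; proj₁; proj₂)
open import Data.Sum using (_⊎_)
open import Data.Rational using (ℚ; 0ℚ) renaming (_<_ to _<ℚ_; _≤_ to _≤ℚ_)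
import Data.Rational.Properties as ℚP
open import Relation.Binary.PropositionalEquality using (_≡_; _≢_)
open import Relation.Nullary using (¬_; does)

-- Taxa: the leaf set X is represented by Fin n.

_==_ : ∀ {n} → Fin n → Fin n → Bool
a == b = does (a Fin.≟ b)

module _ {m : ℕ} (arc : Fin m → Fin m → Bool) where

  indeg : Fin m → ℕ
  indeg v = length (filterᵇ (λ u → arc u v) (allFin m))

  outdeg : Fin m → ℕ
  outdeg u = length (filterᵇ (λ v → arc u v) (allFin m))

  -- a directed path u ⇝ v with at least one arc; the index is the list of
  -- its internal vertices
  data Path : Fin m → Fin m → List (Fin m) → Set where
    edge : ∀ {u v} → arc u v ≡ true → Path u v []
    cons : ∀ {u w v is} → arc u w ≡ true → Path w v is → Path u v (w ∷ is)

  Acyclic : Set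
  Acyclic = ∀ v is → ¬ Path v v is

record Network (n : ℕ) : Set where
  field
    m      : ℕ
    arc    : Fin m → Fin m → Bool
    root   : Fin m
    leafOf : Fin n → Fin m
    acyclic     : Acyclic arc
    root-indeg  : indeg arc root ≡ 0
    root-outdeg : outdeg arc root ≢ 1
    vertex-kind : ∀ v → v ≢ root →
        (outdeg arc v ≡ 0 × indeg arc v ≡ 1)
      ⊎ (indeg arc v ≡ 1 × 2 ≤ outdeg arc v)
      ⊎ (outdeg arc v ≡ 1 × 2 ≤ indeg arc v)
    leafOf-injective : ∀ x y → leafOf x ≡ leafOf y → x ≡ y
    leafOf-leaf      : ∀ x → outdeg arc (leafOf x) ≡ 0
    leaf-labelled    : ∀ v → outdeg arc v ≡ 0 → ∃ λ x → leafOf x ≡ v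

module _ {n : ℕ} (N : Network n) where
  open Network N

  IsTreeVertex : Fin m → Set
  IsTreeVertex v = v ≢ root × indeg arc v ≡ 1 × 2 ≤ outdeg arc v

  IsReticulation : Fin m → Set
  IsReticulation v = v ≢ root × outdeg arc v ≡ 1 × 2 ≤ indeg arc v

  isReticulationᵇ : Fin m → Bool
  isReticulationᵇ v =
    not (v == root) ∧ (does (outdeg arc v Data.Nat.≟ 1) ∧ (1 <ᵇ indeg arc v))

  -- tree arc = arc whose head is not a reticulation
  IsTreeChild : Set
  IsTreeChild = ∀ v → IsTreeVertex v →
    ∃ λ w → arc v w ≡ true × ¬ IsReticulation w

  reticulationNumber : ℕ
  reticulationNumber =
    sum (map (λ v → if v == root then 0 else indeg arc v ∸ 1) (allFin m))

  IsSemiTemporal : (Fin m → ℚ) → Set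
  IsSemiTemporal t =
      (∀ v → 0ℚ <ℚ t v)
    × (∀ u v → arc u v ≡ true → ¬ IsReticulation v → t u <ℚ t v)
    × (∀ v → IsReticulation v →
         (∀ u → arc u v ≡ true → t v ≤ℚ t u)
         × ∃ λ u → arc u v ≡ true × t u ≡ t v)

  dNet : (Fin m → ℚ) → ℕ
  dNet t = length (filterᵇ
    (λ p → arc (proj₁ p) (proj₂ p) ∧ isReticulationᵇ (proj₂ p)
             ∧ not (does (t (proj₁ p) ℚP.≟ t (proj₂ p))))
    (cartesianProduct (allFin m) (allFin m)))

data BTree (n : ℕ) : Set where
  leaf : Fin n → BTree n
  node : BTree n → BTree n → BTree n

leaves : ∀ {n} → BTree n → List (Fin n)
leaves (leaf x)   = x ∷ []
leaves (node l r) = leaves l ++ leaves r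

IsPhyloTree : ∀ {n} → BTree n → Set
IsPhyloTree t = Unique (leaves t)

isCherry : ∀ {n} → Fin n → Fin n → BTree n → Bool
isCherry a b (leaf _) = false
isCherry a b (node (leaf c) (leaf d)) = (a == c ∧ b == d) ∨ (a == d ∧ b == c)
isCherry a b (node l r) = isCherry a b l ∨ isCherry a b r

-- delete leaf x and suppress the resulting in/out-degree-1 vertex
-- (nothing = the tree became empty)
deleteLeaf : ∀ {n} → Fin n → BTree n → Maybe (BTree n)
deleteLeaf x (leaf y) = if x == y then nothing else just (leaf y)
deleteLeaf x (node l r) with deleteLeaf x l | deleteLeaf x r
... | nothing | nothing = nothing
... | nothing | just r' = just r'
... | just l' | nothing = just l'
... | just l' | just r' = just (node l' r')

-- one step of applying a sequence: T \ {x} if (x,y) ∈ T, else T.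
-- (if (x,y) ∈ T then T has ≥ 2 leaves, so deleteLeaf never returns nothing)
pickStep : ∀ {n} → Fin n × Fin n → BTree n → BTree n
pickStep (x , y) t = if isCherry x y t then fromMaybe t (deleteLeaf x t) else t

applyPairs : ∀ {n} → List (Fin n × Fin n) → BTree n → BTree n
applyPairs []       t = t
applyPairs (p ∷ ps) t = applyPairs ps (pickStep p t)

-- Generalized cherry picking sequences
-- s = ((x₁,y₁),…,(x_r,y_r),(x_{r+1},−),…,(x_t,−))

record GenSeq (n : ℕ) : Set where
  constructor mkSeq
  field
    pairs  : List (Fin n × Fin n)
    finals : List (Fin n)

module _ {n : ℕ} (s : GenSeq n) where
  open GenSeq s

  xs : List (Fin n)
  xs = map proj₁ pairs ++ finals

  seqLength : ℕ
  seqLength = length pairs + length finals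

  IsFull : Set
  IsFull = (1 ≤ length finals) × (∀ (x : Fin n) → x ∈ xs)

  IsSeqFor : List (BTree n) → Set
  IsSeqFor T = IsFull × All (λ t → ∃ λ z → applyPairs pairs t ≡ leaf z × z ∈ finals) T

  weight : ℕ
  weight = seqLength ∸ n

  IsTreeChildSeq : Set
  IsTreeChildSeq = length finals ≡ 1
    × (∀ (i j : Fin (length pairs)) → i < j →
         proj₂ (lookup pairs j) ≢ proj₁ (lookup pairs i))

  IsFullTreeChildSeqFor : List (BTree n) → Set
  IsFullTreeChildSeqFor T = IsSeqFor T × IsTreeChildSeq

  -- positions (0-based) paired with x_i
  private
    ixs : List (ℕ × Fin n)
    ixs = zip (upTo seqLength) xs

  isNonTemporal : ℕ × Fin n → Bool
  isNonTemporal (i , xi) = any (λ jx → any (λ kx →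
      (i <ᵇ proj₁ jx) ∧ (proj₁ jx <ᵇ proj₁ kx)
      ∧ not (proj₂ jx == xi) ∧ (proj₂ kx == xi)) ixs) ixs

  dSeq : ℕ
  dSeq = length (filterᵇ isNonTemporal (take (length pairs) ixs))

-- Display: a subdivision of the tree is a subgraph of the network,
-- leaves mapped to equally-labelled leaves.
-- Emb t v vs : t embeds with its root at v, using the vertex list vs
-- (images of tree vertices and internal vertices of the arc-paths).

module _ {n : ℕ} (N : Network n) where
  open Network N

  data Emb : BTree n → Fin m → List (Fin m) → Set where
    leafE : ∀ x → Emb (leaf x) (leafOf x) (leafOf x ∷ [])
    nodeE : ∀ {l r u a b vsl vsr isl isr} →
      Emb l a vsl → Emb r b vsr →
      Path arc u a isl → Path arc u b isr →
      Emb (node l r) u (u ∷ isl ++ isr ++ vsl ++ vsr)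

  Displays : BTree n → Set
  Displays t = ∃ λ v → ∃ λ vs → Emb t v vs × Unique vs

{-# OPTIONS --safe #-}
-- The network is built by reading s from its end. Starting from the single leaf x_t, a pair
-- (x , y) whose x occurs later in s either changes none of the trees (it is (x , x), or it
-- repeats (x , y) within the run of x that follows), or it subdivides the pendant arcs of y and
-- of x by new vertices p and q and adds the hybridization arc p → q. If x does not occur later,
-- x becomes a new leaf below a new vertex p on the pendant arc of y (of x_t if y = x). A tree
-- that the remaining suffix reduces to x_t stays displayed: if (x , y) is one of its cherries,
-- it is the previous tree with that cherry grafted at y, which embeds below p; otherwise its old
-- embedding survives the subdivisions. Each pair adds at most one reticulation or one leaf, so
-- r(N) ≤ |s| - |X|. All vertices created during a maximal run of pairs with the same x get the
-- same label, the number of runs following it, and leaves get a label above all of these; a new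
-- hybridization arc then has distinct end labels only if its pair is non-temporal, so
-- d(N,t) ≤ d(s).
module Submission where

open import Data.Bool using (Bool; true; false; _∧_; _∨_; not; if_then_else_)
open import Data.Bool.Properties using (T-≡)
open import Data.Bool.ListAction using (any)
open import Data.Empty using (⊥; ⊥-elim)
open import Data.Fin using (Fin)
import Data.Fin as Fin
import Data.Integer as ℤ
import Data.Integer.Properties as ℤP
open import Data.List using (List; []; _∷_; _++_; length; filterᵇ; allFin; map; tabulate; zip; take; upTo; applyUpTo; lookup; cartesianProduct)
open import Data.List.Properties using (length-++; map-tabulate; map-++; ++-assoc; length-map; length-tabulate; ++-identityʳ; ∷-injective; filter-++)
open import Data.List.Membership.Propositional using (_∈_; _∉_)
open import Data.List.Relation.Binary.Subset.Propositional using (_⊆_)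
open import Data.List.Membership.Propositional.Properties using (∈-filter⁺; ∈-filter⁻; ∈-∃++; ∈-allFin; ∈-++⁻; ∈-++⁺ˡ; ∈-++⁺ʳ; ∈-map⁻; ∈-map⁺)
open import Data.List.Relation.Binary.Disjoint.Propositional using (Disjoint)
open import Data.List.Relation.Unary.All using (All; []; _∷_)
open import Data.List.Relation.Unary.All.Properties using (¬Any⇒All¬)
open import Data.List.Relation.Unary.AllPairs using ([]; _∷_)
open import Data.List.Relation.Unary.Any using (here; there)
import Data.List.Relation.Unary.Any as Any
open import Data.List.Relation.Unary.Any.Properties using (lookup-index)
open import Data.List.Relation.Unary.Unique.Propositional using (Unique)
open import Data.List.Relation.Unary.Unique.Propositional.Properties using (map⁺; allFin⁺; cartesianProduct⁺; filter⁺; Unique[x∷xs]⇒x∉xs) renaming (++⁺ to Unique-++⁺)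
open import Data.Maybe using (Maybe; just; nothing)
open import Data.Nat using (ℕ; zero; suc; _+_; _∸_; _≤_; _<_; z≤n; s≤s; _<ᵇ_)
import Data.Nat as ℕ
open import Data.Nat.Coprimality using (1-coprimeTo)
import Data.Nat.Coprimality as Coprime
open import Data.Nat.ListAction using (sum)
open import Data.Nat.Properties using (≤-refl; ≤-trans; ≤-antisym; +-mono-≤; +-monoʳ-≤; m≤m+n; +-suc; +-comm; n≤1+n; m≤n+m; <-irrefl; ≤-reflexive; n≮n; ≤∧≢⇒<; ≤-<-trans; <-trans; n<1+n; +-assoc; <ᵇ⇒<; m+n≤o⇒m≤o∸n; +-monoʳ-<; module ≤-Reasoning)
open import Data.Product using (Σ; ∃; _×_; _,_; proj₁; proj₂)
import Data.Product as Product
open import Data.Rational using (ℚ; mkℚ; 0ℚ; *<*; *≤*)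
import Data.Rational as ℚ
import Data.Rational.Properties as ℚP
open import Data.Sum using (_⊎_; inj₁; inj₂; [_,_]′)
open import Data.Unit using (⊤; tt)
open import Function using (_∘_; id; case_of_)
open import Function.Bundles using (Equivalence; mk⇔)
open import Relation.Binary.PropositionalEquality using (_≡_; _≢_; refl; sym; trans; cong; cong₂; subst; subst₂)
open import Relation.Nullary using (¬_; does; yes; no)
open import Relation.Nullary.Decidable using (T?; dec-true; dec-false; does-⇔)

open import Defs

∧-true⁻ˡ : ∀ {a b} → a ∧ b ≡ true → a ≡ true
∧-true⁻ˡ {true} _ = refl

∧-true⁻ʳ : ∀ {a b} → a ∧ b ≡ true → b ≡ true
∧-true⁻ʳ {true} p = p

∧-true⁺ : ∀ {a b} → a ≡ true → b ≡ true → a ∧ b ≡ true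
∧-true⁺ refl refl = refl

not-true⁻ : ∀ {a} → not a ≡ true → a ≡ false
not-true⁻ {false} _ = refl

not-true⁺ : ∀ {a} → a ≡ false → not a ≡ true
not-true⁺ refl = refl

∨-true⁻ : ∀ {a b} → a ∨ b ≡ true → a ≡ true ⊎ b ≡ true
∨-true⁻ {true} _ = inj₁ refl
∨-true⁻ {false} p = inj₂ p

∨-true⁺ˡ : ∀ {a b} → a ≡ true → a ∨ b ≡ true
∨-true⁺ˡ refl = refl

∨-true⁺ʳ : ∀ {a b} → b ≡ true → a ∨ b ≡ true
∨-true⁺ʳ {true} _ = refl
∨-true⁺ʳ {false} p = p

∨-true-elim : ∀ {a b} {C : Set} → a ∨ b ≡ true → (a ≡ true → C) → (b ≡ true → C) → C
∨-true-elim p f g = [ f , g ]′ (∨-true⁻ p)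

true≢false : true ≢ false
true≢false ()

module _ {n : ℕ} where

  ==-refl : (a : Fin n) → (a == a) ≡ true
  ==-refl a = dec-true (a Fin.≟ a) refl

  ≡⇒== : {a b : Fin n} → a ≡ b → (a == b) ≡ true
  ≡⇒== {a} {b} = dec-true (a Fin.≟ b)

  ≢⇒== : {a b : Fin n} → a ≢ b → (a == b) ≡ false
  ≢⇒== {a} {b} = dec-false (a Fin.≟ b)

  ==⇒≡ : {a b : Fin n} → (a == b) ≡ true → a ≡ b
  ==⇒≡ {a} {b} e with a Fin.≟ b
  ... | yes p = p

  ==⇒≢ : {a b : Fin n} → (a == b) ≡ false → a ≢ b
  ==⇒≢ {a} {b} e with a Fin.≟ b
  ... | no p = p

  ==-sym : (a b : Fin n) → (a == b) ≡ (b == a)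
  ==-sym a b = does-⇔ (mk⇔ sym sym) (a Fin.≟ b) (b Fin.≟ a)

module _ {A : Set} where

  Unique-∷⁺ : ∀ {x : A} {xs} → x ∉ xs → Unique xs → Unique (x ∷ xs)
  Unique-∷⁺ x∉xs u = ¬Any⇒All¬ _ x∉xs ∷ u

  Unique-∷⁻ : ∀ {x : A} {xs} → Unique (x ∷ xs) → x ∉ xs × Unique xs
  Unique-∷⁻ u@(_ ∷ u′) = Unique[x∷xs]⇒x∉xs u , u′

  Unique-++⁻ : ∀ (xs : List A) {ys} → Unique (xs ++ ys) → Unique xs × Unique ys × Disjoint xs ys
  Unique-++⁻ [] u = [] , u , (λ { (() , _) })
  Unique-++⁻ (x ∷ xs) {ys} u with Unique-∷⁻ u
  ... | x∉ , u′ with Unique-++⁻ xs u′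
  ... | uxs , uys , disj = Unique-∷⁺ (x∉ ∘ ∈-++⁺ˡ) uxs , uys , disj′
    where
    disj′ : Disjoint (x ∷ xs) ys
    disj′ (here refl , m) = x∉ (∈-++⁺ʳ xs m)
    disj′ (there m₁ , m₂) = disj (m₁ , m₂)

  Unique-[-] : (a : A) → Unique (a ∷ [])
  Unique-[-] a = [] ∷ []

  ∈-remove : ∀ {x z : A} ys₁ {ys₂} → z ∈ ys₁ ++ x ∷ ys₂ → z ≢ x → z ∈ ys₁ ++ ys₂
  ∈-remove [] (here e) ne = ⊥-elim (ne e)
  ∈-remove [] (there m) ne = m
  ∈-remove (y ∷ ys₁) (here e) ne = here e
  ∈-remove (y ∷ ys₁) (there m) ne = there (∈-remove ys₁ m ne)

  Unique-⊆⇒length≤ : ∀ {xs ys : List A} → Unique xs → xs ⊆ ys → length xs ≤ length ys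
  Unique-⊆⇒length≤ {[]} _ _ = z≤n
  Unique-⊆⇒length≤ {x ∷ xs} {ys} u sub with Unique-∷⁻ u | ∈-∃++ (sub (here refl))
  ... | x∉ , u′ | ys₁ , ys₂ , refl = begin
    suc (length xs)                  ≤⟨ s≤s (Unique-⊆⇒length≤ u′ sub′) ⟩
    suc (length (ys₁ ++ ys₂))        ≡⟨ cong suc (length-++ ys₁) ⟩
    suc (length ys₁ + length ys₂)    ≡⟨ sym (+-suc (length ys₁) (length ys₂)) ⟩
    length ys₁ + suc (length ys₂)    ≡⟨ sym (length-++ ys₁) ⟩
    length (ys₁ ++ x ∷ ys₂)          ∎
    where
    open ≤-Reasoning
    sub′ : xs ⊆ ys₁ ++ ys₂
    sub′ m = ∈-remove ys₁ (sub (there m)) (λ { refl → x∉ m })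

  Unique-⊆⊇⇒length≡ : ∀ {xs ys : List A} → Unique xs → Unique ys → xs ⊆ ys → ys ⊆ xs → length xs ≡ length ys
  Unique-⊆⊇⇒length≡ u₁ u₂ s₁ s₂ = ≤-antisym (Unique-⊆⇒length≤ u₁ s₁) (Unique-⊆⇒length≤ u₂ s₂)

  Disjoint-++⁺ʳ : ∀ {xs ys zs : List A} → Disjoint xs ys → Disjoint xs zs → Disjoint xs (ys ++ zs)
  Disjoint-++⁺ʳ {ys = ys} d₁ d₂ (m₁ , m₂) = [ (λ m → d₁ (m₁ , m)) , (λ m → d₂ (m₁ , m)) ]′ (∈-++⁻ ys m₂)

  Unique-++⁴⁻ : ∀ (a b c : List A) {d} → Unique (a ++ b ++ c ++ d) →
    (Unique a × Unique b × Unique c × Unique d) ×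
    (Disjoint a b × Disjoint a c × Disjoint a d × Disjoint b c × Disjoint b d × Disjoint c d)
  Unique-++⁴⁻ a b c u with Unique-++⁻ a u
  ... | ua , u₁ , da with Unique-++⁻ b u₁
  ... | ub , u₂ , db with Unique-++⁻ c u₂
  ... | uc , ud , dc =
    (ua , ub , uc , ud) ,
    (λ (m₁ , m₂) → da (m₁ , ∈-++⁺ˡ m₂)) , (λ (m₁ , m₂) → da (m₁ , ∈-++⁺ʳ b (∈-++⁺ˡ m₂))) ,
    (λ (m₁ , m₂) → da (m₁ , ∈-++⁺ʳ b (∈-++⁺ʳ c m₂))) ,
    (λ (m₁ , m₂) → db (m₁ , ∈-++⁺ˡ m₂)) , (λ (m₁ , m₂) → db (m₁ , ∈-++⁺ʳ c m₂)) , dc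

  Unique-++⁴⁺ : ∀ {a b c d : List A} → Unique a → Unique b → Unique c → Unique d →
    Disjoint a b → Disjoint a c → Disjoint a d → Disjoint b c → Disjoint b d → Disjoint c d →
    Unique (a ++ b ++ c ++ d)
  Unique-++⁴⁺ ua ub uc ud dab dac dad dbc dbd dcd =
    Unique-++⁺ ua (Unique-++⁺ ub (Unique-++⁺ uc ud dcd) (Disjoint-++⁺ʳ dbc dbd))
      (Disjoint-++⁺ʳ dab (Disjoint-++⁺ʳ dac dad))

  ∈-filterᵇ⁻ : ∀ {p : A → Bool} {z} xs → z ∈ filterᵇ p xs → z ∈ xs × p z ≡ true
  ∈-filterᵇ⁻ {p} xs m = Product.map₂ (Equivalence.to T-≡) (∈-filter⁻ (T? ∘ p) {xs = xs} m)

  ∈-filterᵇ⁺ : ∀ {p : A → Bool} {z} xs → z ∈ xs → p z ≡ true → z ∈ filterᵇ p xs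
  ∈-filterᵇ⁺ {p} xs m pz = ∈-filter⁺ (T? ∘ p) {xs = xs} m (Equivalence.from T-≡ pz)

  Unique-filterᵇ : ∀ {p : A → Bool} xs → Unique xs → Unique (filterᵇ p xs)
  Unique-filterᵇ {p} xs = filter⁺ (T? ∘ p) {xs = xs}

module _ {m : ℕ} where
  length-filterᵇ-allFin : (P : Fin m → Bool) (L : List (Fin m)) → Unique L →
    (∀ u → P u ≡ true → u ∈ L) → (∀ u → u ∈ L → P u ≡ true) →
    length (filterᵇ P (allFin m)) ≡ length L
  length-filterᵇ-allFin P L uL h1 h2 =
    Unique-⊆⊇⇒length≡ (Unique-filterᵇ (allFin m) (allFin⁺ m)) uL
      (λ {z} mm → h1 z (proj₂ (∈-filterᵇ⁻ (allFin m) mm)))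
      (λ {z} mm → ∈-filterᵇ⁺ (allFin m) (∈-allFin z) (h2 z mm))

length-filterᵇ≤ : {A : Set} (xs : List A) (P : A → Bool) (L : List A) → Unique xs →
  (∀ u → u ∈ xs → P u ≡ true → u ∈ L) → length (filterᵇ P xs) ≤ length L
length-filterᵇ≤ xs P L u h = Unique-⊆⇒length≤ (Unique-filterᵇ xs u) (λ {z} mm → let a , b = ∈-filterᵇ⁻ xs mm in h z a b)

sumFin : ∀ {m} → (Fin m → ℕ) → ℕ
sumFin {zero} g = 0
sumFin {suc m} g = g Fin.zero + sumFin (g ∘ Fin.suc)

sum-tabulate : ∀ {m} (g : Fin m → ℕ) → sum (tabulate g) ≡ sumFin g
sum-tabulate {zero} g = refl
sum-tabulate {suc m} g = cong (g Fin.zero +_) (sum-tabulate (g ∘ Fin.suc))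

sum-map-allFin : ∀ {m} (g : Fin m → ℕ) → sum (map g (allFin m)) ≡ sumFin g
sum-map-allFin {m} g = trans (cong sum (map-tabulate (λ i → i) g)) (sum-tabulate g)

sumFin-mono-≤ : ∀ {m} {g h : Fin m → ℕ} → (∀ v → g v ≤ h v) → sumFin g ≤ sumFin h
sumFin-mono-≤ {zero} _ = z≤n
sumFin-mono-≤ {suc m} p = +-mono-≤ (p Fin.zero) (sumFin-mono-≤ (p ∘ Fin.suc))

sumFin-cong : ∀ {m} {g h : Fin m → ℕ} → (∀ v → g v ≡ h v) → sumFin g ≡ sumFin h
sumFin-cong {zero} _ = refl
sumFin-cong {suc m} p = cong₂ _+_ (p Fin.zero) (sumFin-cong (p ∘ Fin.suc))

-- Cherries, leaf deletion and grafting

module _ {n : ℕ} where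

  data Cherry (x y : Fin n) : BTree n → Set where
    here-xy : Cherry x y (node (leaf x) (leaf y))
    here-yx : Cherry x y (node (leaf y) (leaf x))
    in-left : ∀ {l r} → Cherry x y l → Cherry x y (node l r)
    in-right : ∀ {l r} → Cherry x y r → Cherry x y (node l r)

  isCherry⇒Cherry : ∀ {x y} T → isCherry x y T ≡ true → Cherry x y T
  isCherry⇒Cherry (leaf _) ()
  isCherry⇒Cherry {x} {y} (node (leaf c) (leaf d)) e with ∨-true⁻ e
  ... | inj₁ p rewrite ==⇒≡ {a = x} (∧-true⁻ˡ p) | ==⇒≡ {a = y} (∧-true⁻ʳ p) = here-xy
  ... | inj₂ p rewrite ==⇒≡ {a = x} (∧-true⁻ˡ p) | ==⇒≡ {a = y} (∧-true⁻ʳ p) = here-yx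
  isCherry⇒Cherry (node (leaf c) (node l r)) e = in-right (isCherry⇒Cherry (node l r) e)
  isCherry⇒Cherry {x} {y} (node (node l r) r2) e = ∨-true-elim {a = isCherry x y (node l r)} e (λ p → in-left (isCherry⇒Cherry (node l r) p)) (λ p → in-right (isCherry⇒Cherry r2 p))

  Cherry⇒isCherry : ∀ {x y T} → Cherry x y T → isCherry x y T ≡ true
  Cherry⇒isCherry {x} {y} here-xy rewrite ==-refl x | ==-refl y = refl
  Cherry⇒isCherry {x} {y} here-yx rewrite ==-refl x | ==-refl y = ∨-true⁺ʳ {a = (x == y) ∧ (y == x)} refl
  Cherry⇒isCherry {T = node (leaf _) (leaf _)} (in-left ())
  Cherry⇒isCherry {T = node (leaf _) (leaf _)} (in-right ())
  Cherry⇒isCherry {T = node (leaf _) (node _ _)} (in-left ())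
  Cherry⇒isCherry {T = node (leaf _) (node l r)} (in-right c) = ∨-true⁺ʳ (Cherry⇒isCherry c)
  Cherry⇒isCherry {T = node (node l r) _} (in-left c) = ∨-true⁺ˡ (Cherry⇒isCherry c)
  Cherry⇒isCherry {T = node (node l r) _} (in-right c) = ∨-true⁺ʳ (Cherry⇒isCherry c)

  Cherry-∈leaves : ∀ {x y T} → Cherry x y T → x ∈ leaves T × y ∈ leaves T
  Cherry-∈leaves here-xy = here refl , there (here refl)
  Cherry-∈leaves here-yx = there (here refl) , here refl
  Cherry-∈leaves {T = node l r} (in-left c) = let a , b = Cherry-∈leaves c in ∈-++⁺ˡ a , ∈-++⁺ˡ b
  Cherry-∈leaves {T = node l r} (in-right c) = let a , b = Cherry-∈leaves c in ∈-++⁺ʳ (leaves l) a , ∈-++⁺ʳ (leaves l) b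

  ∉leaves⇒¬isCherry : ∀ {x y T} → x ∉ leaves T → isCherry x y T ≡ false
  ∉leaves⇒¬isCherry {x} {y} {T} nx with isCherry x y T in eq
  ... | true = ⊥-elim (nx (proj₁ (Cherry-∈leaves (isCherry⇒Cherry T eq))))
  ... | false = refl

  Cherry-≢ : ∀ {x y T} → Cherry x y T → Unique (leaves T) → x ≢ y
  Cherry-≢ here-xy u refl = proj₁ (Unique-∷⁻ u) (here refl)
  Cherry-≢ here-yx u refl = proj₁ (Unique-∷⁻ u) (here refl)
  Cherry-≢ {T = node l r} (in-left c) u = Cherry-≢ c (proj₁ (Unique-++⁻ (leaves l) u))
  Cherry-≢ {T = node l r} (in-right c) u = Cherry-≢ c (proj₁ (proj₂ (Unique-++⁻ (leaves l) u)))

  ¬isCherry-xx : ∀ {x T} → Unique (leaves T) → isCherry x x T ≡ false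
  ¬isCherry-xx {x} {T} u with isCherry x x T in eq
  ... | true = ⊥-elim (Cherry-≢ (isCherry⇒Cherry T eq) u refl)
  ... | false = refl

  Cherry-unique : ∀ {x y y2 T} → Unique (leaves T) → Cherry x y T → Cherry x y2 T → y ≡ y2
  Cherry-unique u here-xy here-xy = refl
  Cherry-unique u here-xy here-yx = ⊥-elim (proj₁ (Unique-∷⁻ u) (here refl))
  Cherry-unique u here-yx here-xy = ⊥-elim (proj₁ (Unique-∷⁻ u) (here refl))
  Cherry-unique u here-yx here-yx = refl
  Cherry-unique u here-xy (in-left ())
  Cherry-unique u here-xy (in-right ())
  Cherry-unique u here-yx (in-left ())
  Cherry-unique u here-yx (in-right ())
  Cherry-unique u (in-left ()) here-xy
  Cherry-unique u (in-right ()) here-xy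
  Cherry-unique u (in-left ()) here-yx
  Cherry-unique u (in-right ()) here-yx
  Cherry-unique {T = node l r} u (in-left a) (in-left b) = Cherry-unique (proj₁ (Unique-++⁻ (leaves l) u)) a b
  Cherry-unique {T = node l r} u (in-right a) (in-right b) = Cherry-unique (proj₁ (proj₂ (Unique-++⁻ (leaves l) u))) a b
  Cherry-unique {T = node l r} u (in-left a) (in-right b) = ⊥-elim (proj₂ (proj₂ (Unique-++⁻ (leaves l) u)) (proj₁ (Cherry-∈leaves a) , proj₁ (Cherry-∈leaves b)))
  Cherry-unique {T = node l r} u (in-right a) (in-left b) = ⊥-elim (proj₂ (proj₂ (Unique-++⁻ (leaves l) u)) (proj₁ (Cherry-∈leaves b) , proj₁ (Cherry-∈leaves a)))

  joinᴹ : Maybe (BTree n) → Maybe (BTree n) → Maybe (BTree n)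
  joinᴹ nothing nothing = nothing
  joinᴹ nothing (just r) = just r
  joinᴹ (just l) nothing = just l
  joinᴹ (just l) (just r) = just (node l r)

  deleteLeaf-node : ∀ x l r → deleteLeaf x (node l r) ≡ joinᴹ (deleteLeaf x l) (deleteLeaf x r)
  deleteLeaf-node x l r with deleteLeaf x l | deleteLeaf x r
  ... | nothing | nothing = refl
  ... | nothing | just _ = refl
  ... | just _ | nothing = refl
  ... | just _ | just _ = refl

  leavesᴹ : Maybe (BTree n) → List (Fin n)
  leavesᴹ nothing = []
  leavesᴹ (just T) = leaves T

  isNot : Fin n → Fin n → Bool
  isNot x z = not (z == x)

  leavesᴹ-joinᴹ : ∀ a b → leavesᴹ (joinᴹ a b) ≡ leavesᴹ a ++ leavesᴹ b
  leavesᴹ-joinᴹ nothing nothing = refl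
  leavesᴹ-joinᴹ nothing (just _) = refl
  leavesᴹ-joinᴹ (just l) nothing = sym (++-identityʳ (leaves l))
  leavesᴹ-joinᴹ (just _) (just _) = refl

  leavesᴹ-deleteLeaf : ∀ x T → leavesᴹ (deleteLeaf x T) ≡ filterᵇ (isNot x) (leaves T)
  leavesᴹ-deleteLeaf x (leaf y) with x == y in e1 | y == x in e2
  ... | true | true = refl
  ... | false | false = refl
  ... | true | false = ⊥-elim (true≢false (trans (sym e1) (trans (==-sym x y) e2)))
  ... | false | true = ⊥-elim (true≢false (trans (sym e2) (trans (==-sym y x) e1)))
  leavesᴹ-deleteLeaf x (node l r) rewrite deleteLeaf-node x l r | leavesᴹ-joinᴹ (deleteLeaf x l) (deleteLeaf x r)
    | leavesᴹ-deleteLeaf x l | leavesᴹ-deleteLeaf x r = sym (filter-++ (T? ∘ isNot x) (leaves l) (leaves r))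

  deleteLeaf-leaves : ∀ {x T T₂} → deleteLeaf x T ≡ just T₂ → leaves T₂ ≡ filterᵇ (isNot x) (leaves T)
  deleteLeaf-leaves {x} {T} e = trans (cong leavesᴹ (sym e)) (leavesᴹ-deleteLeaf x T)

  deleteLeaf-∈⁻ : ∀ {x T T₂ z} → deleteLeaf x T ≡ just T₂ → z ∈ leaves T₂ → z ∈ leaves T × z ≢ x
  deleteLeaf-∈⁻ {x} {T} {T₂} {z} e m with ∈-filterᵇ⁻ (leaves T) (subst (z ∈_) (deleteLeaf-leaves {x} {T} {T₂} e) m)
  ... | a , b = a , ==⇒≢ (not-true⁻ b)

  deleteLeaf-∈⁺ : ∀ {x T T₂ z} → deleteLeaf x T ≡ just T₂ → z ∈ leaves T → z ≢ x → z ∈ leaves T₂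
  deleteLeaf-∈⁺ {x} {T} {T₂} {z} e m ne = subst (z ∈_) (sym (deleteLeaf-leaves {x} {T} {T₂} e)) (∈-filterᵇ⁺ (leaves T) m (not-true⁺ (≢⇒== ne)))

  deleteLeaf-Unique : ∀ {x T T₂} → deleteLeaf x T ≡ just T₂ → Unique (leaves T) → Unique (leaves T₂)
  deleteLeaf-Unique {x} {T} {T₂} e u = subst Unique (sym (deleteLeaf-leaves {x} {T} {T₂} e)) (Unique-filterᵇ (leaves T) u)

  deleteLeaf-∉ : ∀ {x} T → x ∉ leaves T → deleteLeaf x T ≡ just T
  deleteLeaf-∉ {x} (leaf y) nx with x == y in eq
  ... | true = ⊥-elim (nx (here (==⇒≡ eq)))
  ... | false = refl
  deleteLeaf-∉ {x} (node l r) nx rewrite deleteLeaf-node x l r | deleteLeaf-∉ l (λ m → nx (∈-++⁺ˡ m))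
    | deleteLeaf-∉ r (λ m → nx (∈-++⁺ʳ (leaves l) m)) = refl

  graft : (Fin n → BTree n) → BTree n → BTree n
  graft G (leaf z) = G z
  graft G (node l r) = node (graft G l) (graft G r)

  graftAt : Fin n → BTree n → Fin n → BTree n
  graftAt y g z = if z == y then g else leaf z

  graftAt-self : ∀ {y g} → graftAt y g y ≡ g
  graftAt-self {y} rewrite ==-refl y = refl

  graft-∉ : ∀ {y g} T → y ∉ leaves T → graft (graftAt y g) T ≡ T
  graft-∉ {y} (leaf z) ny with z == y in eq
  ... | true = ⊥-elim (ny (here (sym (==⇒≡ eq))))
  ... | false = refl
  graft-∉ {y} (node l r) ny = cong₂ node (graft-∉ l (λ m → ny (∈-++⁺ˡ m))) (graft-∉ r (λ m → ny (∈-++⁺ʳ (leaves l) m)))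

  graft-leaf : ∀ (T : BTree n) → graft leaf T ≡ T
  graft-leaf (leaf z) = refl
  graft-leaf (node l r) = cong₂ node (graft-leaf l) (graft-leaf r)

  IsCherryTree : Fin n → Fin n → BTree n → Set
  IsCherryTree x y g = (g ≡ node (leaf x) (leaf y)) ⊎ (g ≡ node (leaf y) (leaf x))

  Cherry⇒graft : ∀ {x y T} → Cherry x y T → Unique (leaves T) →
    ∃ λ T₂ → ∃ λ g → deleteLeaf x T ≡ just T₂ × T ≡ graft (graftAt y g) T₂ × IsCherryTree x y g
  Cherry⇒graft {x} {y} here-xy u = leaf y , node (leaf x) (leaf y) , e , sym graftAt-self , inj₁ refl
    where
    ne : x ≢ y
    ne = Cherry-≢ here-xy u
    e : deleteLeaf x (node (leaf x) (leaf y)) ≡ just (leaf y)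
    e rewrite ==-refl x | ≢⇒== ne = refl
  Cherry⇒graft {x} {y} here-yx u = leaf y , node (leaf y) (leaf x) , e , sym graftAt-self , inj₂ refl
    where
    ne : x ≢ y
    ne = Cherry-≢ here-yx u
    e : deleteLeaf x (node (leaf y) (leaf x)) ≡ just (leaf y)
    e rewrite ==-refl x | ≢⇒== ne = refl
  Cherry⇒graft {x} {y} {node l r} (in-left c) u with Unique-++⁻ (leaves l) u
  ... | ul , ur , d with Cherry⇒graft c ul
  ... | T₂ , g , e , eq , gg = node T₂ r , g , e2 , cong₂ node eq (sym (graft-∉ r ny)) , gg
    where
    ny : y ∉ leaves r
    ny m = d (proj₂ (Cherry-∈leaves c) , m)
    nx : x ∉ leaves r
    nx m = d (proj₁ (Cherry-∈leaves c) , m)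
    e2 : deleteLeaf x (node l r) ≡ just (node T₂ r)
    e2 rewrite deleteLeaf-node x l r | e | deleteLeaf-∉ r nx = refl
  Cherry⇒graft {x} {y} {node l r} (in-right c) u with Unique-++⁻ (leaves l) u
  ... | ul , ur , d with Cherry⇒graft c ur
  ... | T₂ , g , e , eq , gg = node l T₂ , g , e2 , cong₂ node (sym (graft-∉ l ny)) eq , gg
    where
    ny : y ∉ leaves l
    ny m = d (m , proj₂ (Cherry-∈leaves c))
    nx : x ∉ leaves l
    nx m = d (m , proj₁ (Cherry-∈leaves c))
    e2 : deleteLeaf x (node l r) ≡ just (node l T₂)
    e2 rewrite deleteLeaf-node x l r | e | deleteLeaf-∉ l nx = refl

  pickStep-¬cherry : ∀ x y T → isCherry x y T ≡ false → pickStep {n} (x , y) T ≡ T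
  pickStep-¬cherry x y T e rewrite e = refl

  pickStep-cherry : ∀ x y T {T₂} → isCherry x y T ≡ true → deleteLeaf x T ≡ just T₂ → pickStep {n} (x , y) T ≡ T₂
  pickStep-cherry x y T e d rewrite e | d = refl

  pickStep-∈ : ∀ {x y T z} → z ∈ leaves T → z ≢ x → z ∈ leaves (pickStep {n} (x , y) T)
  pickStep-∈ {x} {y} {T} m ne with isCherry x y T
  ... | false = m
  ... | true with deleteLeaf x T in e
  ... | nothing = m
  ... | just T₂ = deleteLeaf-∈⁺ {x} {T} {T₂} e m ne

  leaves-nonempty : ∀ (T : BTree n) → ∃ λ z → z ∈ leaves T
  leaves-nonempty (leaf z) = z , here refl
  leaves-nonempty (node l r) = let z , m = leaves-nonempty l in z , ∈-++⁺ˡ m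

  ≡leaf : ∀ {a} T → Unique (leaves T) → (∀ {z} → z ∈ leaves T → z ≡ a) → T ≡ leaf a
  ≡leaf (leaf z) u h = cong leaf (h (here refl))
  ≡leaf {a} (node l r) u h with leaves-nonempty l | leaves-nonempty r
  ... | z1 , m1 | z2 , m2 = ⊥-elim (proj₂ (proj₂ (Unique-++⁻ (leaves l) u))
        (m1 , subst (_∈ leaves r) (trans (h (∈-++⁺ʳ (leaves l) m2)) (sym (h (∈-++⁺ˡ m1)))) m2))

  inLeadingRun : Fin n → Fin n → List (Fin n × Fin n) → Bool
  inLeadingRun x y [] = false
  inLeadingRun x y ((a , b) ∷ ps) = (a == x) ∧ ((b == y) ∨ inLeadingRun x y ps)

  applyPairs-leadingRun : ∀ {x y T T₂} ps → Cherry x y T → Unique (leaves T) → deleteLeaf x T ≡ just T₂ →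
    inLeadingRun x y ps ≡ true → applyPairs ps T ≡ applyPairs ps T₂
  applyPairs-leadingRun [] c u d ()
  applyPairs-leadingRun {x} {y} {T} {T₂} ((a , b) ∷ ps) c u d e with ==⇒≡ {a = a} (∧-true⁻ˡ e)
  ... | refl with b == y in eb
  applyPairs-leadingRun {x} {y} {T} {T₂} ((a , b) ∷ ps) c u d e | refl | true with ==⇒≡ {a = b} {b = y} eb
  ... | refl = cong (applyPairs ps) (trans (pickStep-cherry a y T (Cherry⇒isCherry c) d) (sym (pickStep-¬cherry a y T₂ nc2)))
    where
    nc2 : isCherry a y T₂ ≡ false
    nc2 = ∉leaves⇒¬isCherry {T = T₂} (λ m → proj₂ (deleteLeaf-∈⁻ {T = T} {T₂ = T₂} d m) refl)
  applyPairs-leadingRun {x} {y} {T} {T₂} ((a , b) ∷ ps) c u d e | refl | false = trans (cong (applyPairs ps) (pickStep-¬cherry a b T nc1))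
                 (trans (applyPairs-leadingRun ps c u d (∧-true⁻ʳ e)) (cong (applyPairs ps) (sym (pickStep-¬cherry a b T₂ nc2))))
    where
    nc1 : isCherry a b T ≡ false
    nc1 with isCherry a b T in q
    ... | true = ⊥-elim (==⇒≢ eb (sym (Cherry-unique u c (isCherry⇒Cherry T q))))
    ... | false = refl
    nc2 : isCherry a b T₂ ≡ false
    nc2 = ∉leaves⇒¬isCherry {T = T₂} (λ m → proj₂ (deleteLeaf-∈⁻ {T = T} {T₂ = T₂} d m) refl)

-- Suffixes of a cherry picking sequence

data At {A : Set} : List A → ℕ → A → Set where
  at-zero : ∀ {a L} → At (a ∷ L) 0 a
  at-suc : ∀ {a b L k} → At L k a → At (b ∷ L) (suc k) a

At-++ : ∀ {A : Set} (pre : List A) {L k a} → At L k a → At (pre ++ L) (length pre + k) a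
At-++ [] p = p
At-++ (_ ∷ pre) p = at-suc (At-++ pre p)

At-zip : ∀ {A : Set} (f : ℕ → ℕ) (W : List A) {j a} → At W j a → (f j , a) ∈ zip (applyUpTo f (length W)) W
At-zip f (a ∷ W) at-zero = here refl
At-zip f (b ∷ W) (at-suc p) = there (At-zip (λ k → f (suc k)) W p)

any-true⁺ : ∀ {A : Set} (g : A → Bool) (L : List A) {e} → e ∈ L → g e ≡ true → any g L ≡ true
any-true⁺ g (a ∷ L) (here refl) ge rewrite ge = refl
any-true⁺ g (a ∷ L) (there m) ge = ∨-true⁺ʳ {a = g a} (any-true⁺ g L m ge)

<⇒<ᵇ≡true : ∀ {a b} → a < b → (a <ᵇ b) ≡ true
<⇒<ᵇ≡true {zero} {suc b} _ = refl
<⇒<ᵇ≡true {suc a} {suc b} (s≤s p) = <⇒<ᵇ≡true {a} {b} p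

+-mono-<ʳ : ∀ c {a b} → a < b → c + a < c + b
+-mono-<ʳ zero p = p
+-mono-<ʳ (suc c) p = s≤s (+-mono-<ʳ c p)

module _ {n : ℕ} where
  Pairs : Set
  Pairs = List (Fin n × Fin n)

  xsOf : Fin n → List (Fin n × Fin n) → List (Fin n)
  xsOf xt [] = xt ∷ []
  xsOf xt ((x , _) ∷ ps) = x ∷ xsOf xt ps

  leaves⊆xsOf : ∀ xt ps T → applyPairs ps T ≡ leaf xt → ∀ {z} → z ∈ leaves T → z ∈ xsOf xt ps
  leaves⊆xsOf xt [] T e m = subst (λ T₀ → _ ∈ leaves T₀) e m
  leaves⊆xsOf xt ((x , y) ∷ ps) T e {z} m with z == x in eq
  ... | true = here (==⇒≡ eq)
  ... | false = there (leaves⊆xsOf xt ps (pickStep {n} (x , y) T) e (pickStep-∈ {x = x} {y = y} {T = T} m (==⇒≢ eq)))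

  elem : Fin n → List (Fin n) → Bool
  elem x [] = false
  elem x (a ∷ L) = (a == x) ∨ elem x L

  elem⇒∈ : ∀ {x} L → elem x L ≡ true → x ∈ L
  elem⇒∈ {x} (a ∷ L) e = ∨-true-elim {a = a == x} e (λ p → here (sym (==⇒≡ {a = a} {b = x} p))) (λ p → there (elem⇒∈ L p))

  ∈⇒elem : ∀ {x L} → x ∈ L → elem x L ≡ true
  ∈⇒elem {x} {a ∷ L} (here refl) rewrite ==-refl x = refl
  ∈⇒elem {x} {a ∷ L} (there m) = ∨-true⁺ʳ {a = a == x} (∈⇒elem m)

  headX : Fin n → Pairs → Fin n
  headX xt [] = xt
  headX xt ((x , _) ∷ _) = x

  xsOf-head : ∀ (xt : Fin n) ps → ∃ λ L → xsOf xt ps ≡ headX xt ps ∷ L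
  xsOf-head xt [] = [] , refl
  xsOf-head xt ((x , _) ∷ ps) = xsOf xt ps , refl

  xt∈xsOf : ∀ (xt : Fin n) ps → xt ∈ xsOf xt ps
  xt∈xsOf xt [] = here refl
  xt∈xsOf xt (_ ∷ ps) = there (xt∈xsOf xt ps)

  runs : Fin n → Pairs → ℕ
  runs xt [] = 0
  runs xt ((x , _) ∷ ps) = if x == headX xt ps then runs xt ps else suc (runs xt ps)

  runs≤length : ∀ (xt : Fin n) ps → runs xt ps ≤ length ps
  runs≤length xt [] = z≤n
  runs≤length xt ((x , _) ∷ ps) with x == headX xt ps
  ... | true = ≤-trans (runs≤length xt ps) (n≤1+n _)
  ... | false = s≤s (runs≤length xt ps)

  runs-mono : ∀ xt x y ps → runs xt ps ≤ runs xt ((x , y) ∷ ps)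
  runs-mono xt x y ps with x == headX xt ps
  ... | true = ≤-refl
  ... | false = n≤1+n _

  runs-same : ∀ xt x y ps → x ≡ headX xt ps → runs xt ((x , y) ∷ ps) ≡ runs xt ps
  runs-same xt x y ps e rewrite ≡⇒== e = refl

  runs-new : ∀ xt x y ps → x ≢ headX xt ps → runs xt ((x , y) ∷ ps) ≡ suc (runs xt ps)
  runs-new xt x y ps e rewrite ≢⇒== e = refl

  nonTemporal : Fin n → List (Fin n) → Bool
  nonTemporal x [] = false
  nonTemporal x (a ∷ L) = if a == x then nonTemporal x L else elem x L

  dSuffix : Fin n → Pairs → ℕ
  dSuffix xt [] = 0
  dSuffix xt ((x , _) ∷ ps) = (if nonTemporal x (xsOf xt ps) then 1 else 0) + dSuffix xt ps

  temporal⇒head : ∀ {x} L → nonTemporal x L ≡ false → x ∈ L → ∃ λ L2 → L ≡ x ∷ L2 × nonTemporal x L2 ≡ false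
  temporal⇒head {x} (a ∷ L) nt m with a == x in eq
  ... | true with ==⇒≡ {a = a} {b = x} eq
  ... | refl = L , refl , nt
  temporal⇒head {x} (a ∷ L) nt m | false with m
  ... | here e = ⊥-elim (==⇒≢ eq (sym e))
  ... | there m2 = ⊥-elim (true≢false (trans (sym (∈⇒elem m2)) nt))

  ys : Pairs → List (Fin n)
  ys = map proj₂

  TreeChildPairs : Pairs → Set
  TreeChildPairs [] = ⊤
  TreeChildPairs ((x , y) ∷ ps) = (x ∉ ys ps) × TreeChildPairs ps

  SecondsOccur : Fin n → Pairs → Set
  SecondsOccur xt [] = ⊤
  SecondsOccur xt ((x , y) ∷ ps) = (x ≢ y → y ∈ xsOf xt ps) × SecondsOccur xt ps

  distinctXs : Fin n → Pairs → List (Fin n)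
  distinctXs xt [] = xt ∷ []
  distinctXs xt ((x , _) ∷ ps) = if elem x (xsOf xt ps) then distinctXs xt ps else x ∷ distinctXs xt ps

  distinctXs⊆xsOf : ∀ (xt : Fin n) ps {z} → z ∈ distinctXs xt ps → z ∈ xsOf xt ps
  distinctXs⊆xsOf xt [] m = m
  distinctXs⊆xsOf xt ((x , _) ∷ ps) m with elem x (xsOf xt ps)
  ... | true = there (distinctXs⊆xsOf xt ps m)
  ... | false with m
  ... | here e = here e
  ... | there m2 = there (distinctXs⊆xsOf xt ps m2)

  xsOf⊆distinctXs : ∀ (xt : Fin n) ps {z} → z ∈ xsOf xt ps → z ∈ distinctXs xt ps
  xsOf⊆distinctXs xt [] m = m
  xsOf⊆distinctXs xt ((x , _) ∷ ps) m with elem x (xsOf xt ps) in eq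
  xsOf⊆distinctXs xt ((x , _) ∷ ps) (here refl) | true = xsOf⊆distinctXs xt ps (elem⇒∈ _ eq)
  xsOf⊆distinctXs xt ((x , _) ∷ ps) (there m) | true = xsOf⊆distinctXs xt ps m
  xsOf⊆distinctXs xt ((x , _) ∷ ps) (here e) | false = here e
  xsOf⊆distinctXs xt ((x , _) ∷ ps) (there m) | false = there (xsOf⊆distinctXs xt ps m)

  distinctXs-Unique : ∀ (xt : Fin n) ps → Unique (distinctXs xt ps)
  distinctXs-Unique xt [] = Unique-∷⁺ (λ ()) []
  distinctXs-Unique xt ((x , _) ∷ ps) with elem x (xsOf xt ps) in eq
  ... | true = distinctXs-Unique xt ps
  ... | false = Unique-∷⁺ (λ m → true≢false (trans (sym (∈⇒elem (distinctXs⊆xsOf xt ps m))) eq)) (distinctXs-Unique xt ps)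

  treeChildPairs : ∀ (ps : Pairs) → (∀ (i j : Fin (length ps)) → i Fin.< j → proj₂ (lookup ps j) ≢ proj₁ (lookup ps i)) → TreeChildPairs ps
  treeChildPairs [] _ = tt
  treeChildPairs ((x , y) ∷ ps) H = nx , treeChildPairs ps (λ i j lt → H (Fin.suc i) (Fin.suc j) (s≤s lt))
    where
    nx : x ∉ ys ps
    nx m with ∈-map⁻ proj₂ m
    ... | q , qm , eq = H Fin.zero (Fin.suc (Any.index qm)) (s≤s z≤n)
          (trans (cong proj₂ (sym (lookup-index qm))) (sym eq))

  secondsOccur : ∀ xt (pre ps : Pairs) → (∀ z → z ∈ map proj₁ pre ++ xsOf xt ps) →
    (∀ {y} → y ∈ ys ps → y ∉ map proj₁ pre) → TreeChildPairs ps → SecondsOccur xt ps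
  secondsOccur xt pre [] _ _ _ = tt
  secondsOccur xt pre ((x , y) ∷ ps) cov ny (nx , tcp) = yy , secondsOccur xt (pre ++ (x , y) ∷ []) ps cov2 ny2 tcp
    where
    yy : x ≢ y → y ∈ xsOf xt ps
    yy ne with ∈-++⁻ (map proj₁ pre) (cov y)
    ... | inj₁ m = ⊥-elim (ny (here refl) m)
    ... | inj₂ (here e) = ⊥-elim (ne (sym e))
    ... | inj₂ (there m) = m
    eqL : map proj₁ (pre ++ (x , y) ∷ []) ++ xsOf xt ps ≡ map proj₁ pre ++ xsOf xt ((x , y) ∷ ps)
    eqL rewrite map-++ proj₁ pre ((x , y) ∷ []) = ++-assoc (map proj₁ pre) (x ∷ []) (xsOf xt ps)
    cov2 : ∀ z → z ∈ map proj₁ (pre ++ (x , y) ∷ []) ++ xsOf xt ps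
    cov2 z = subst (z ∈_) (sym eqL) (cov z)
    ny2 : ∀ {y2} → y2 ∈ ys ps → y2 ∉ map proj₁ (pre ++ (x , y) ∷ [])
    ny2 {y2} m m2 rewrite map-++ proj₁ pre ((x , y) ∷ []) with ∈-++⁻ (map proj₁ pre) m2
    ... | inj₁ a = ny (there m) a
    ... | inj₂ (here e) = nx (subst (_∈ ys ps) e m)

  xsOf≡ : ∀ xt (ps : Pairs) → map proj₁ ps ++ xt ∷ [] ≡ xsOf xt ps
  xsOf≡ xt [] = refl
  xsOf≡ xt ((x , _) ∷ ps) = cong (x ∷_) (xsOf≡ xt ps)

  xsOf-++ : ∀ xt (pre ps : Pairs) → xsOf xt (pre ++ ps) ≡ map proj₁ pre ++ xsOf xt ps
  xsOf-++ xt [] ps = refl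
  xsOf-++ xt ((x , _) ∷ pre) ps = cong (x ∷_) (xsOf-++ xt pre ps)

  length-xsOf : ∀ xt (ps : Pairs) → length (xsOf xt ps) ≡ suc (length ps)
  length-xsOf xt [] = refl
  length-xsOf xt (_ ∷ ps) = cong suc (length-xsOf xt ps)

  elem⇒At : ∀ {x} L → elem x L ≡ true → ∃ λ k → At L k x
  elem⇒At {x} (a ∷ L) e = ∨-true-elim {a = a == x} e (λ p → 0 , subst (λ z → At (z ∷ L) 0 x) (sym (==⇒≡ {a = a} {b = x} p)) at-zero)
    (λ p → let k , q = elem⇒At L p in suc k , at-suc q)

  nonTemporal⇒At : ∀ {x} L → nonTemporal x L ≡ true → ∃ λ j → ∃ λ k → ∃ λ aj → j < k × At L j aj × aj ≢ x × At L k x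
  nonTemporal⇒At {x} (a ∷ L) e with a == x in eq
  ... | true = let j , k , aj , lt , p1 , ne , p2 = nonTemporal⇒At L e in suc j , suc k , aj , s≤s lt , at-suc p1 , ne , at-suc p2
  ... | false = let k , p = elem⇒At L e in 0 , suc k , a , s≤s z≤n , at-zero , ==⇒≢ eq , at-suc p

-- Transporting embeddings to an extended network

module _ {n m : ℕ} (arc : Fin m → Fin m → Bool) (leafOf : Fin n → Fin m) where
  data Embeds : BTree n → Fin m → List (Fin m) → Set where
    leafE : ∀ x → Embeds (leaf x) (leafOf x) (leafOf x ∷ [])
    nodeE : ∀ {l r u a b vsl vsr isl isr} →
      Embeds l a vsl → Embeds r b vsr →
      Path arc u a isl → Path arc u b isr →
      Embeds (node l r) u (u ∷ isl ++ isr ++ vsl ++ vsr)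

  DisplaysIn : BTree n → Set
  DisplaysIn T = ∃ λ v → ∃ λ vs → Embeds T v vs × Unique vs

HasChild : ∀ {m} → (Fin m → Fin m → Bool) → Fin m → Set
HasChild {m} arc c = ∃ λ w → arc c w ≡ true

Path-source : ∀ {m} {arc : Fin m → Fin m → Bool} {a b is} → Path arc a b is → HasChild arc a
Path-source (edge e) = _ , e
Path-source (cons e _) = _ , e

Path-inner : ∀ {m} {arc : Fin m → Fin m → Bool} {a b is c} → Path arc a b is → c ∈ is → HasChild arc c
Path-inner (cons e p) (here refl) = Path-source p
Path-inner (cons e p) (there mm) = Path-inner p mm

-- An embedding into the old network gives one into the new network if old arcs between
-- internal vertices survive (under f), and the pendant arc into each relevant leaf z is replaced
-- by a path ending at the root of a tree grafted at z. Origin classifies the vertices of the new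
-- embedding by where they come from, which is what makes its uniqueness checkable.
module Transport {n m m2 : ℕ}
  (arc : Fin m → Fin m → Bool) (leafOf : Fin n → Fin m)
  (arc′ : Fin m2 → Fin m2 → Bool) (leafOf′ : Fin n → Fin m2)
  (f : Fin m → Fin m2) (f-injective : ∀ {a b} → f a ≡ f b → a ≡ b)
  (grafted : Fin n → BTree n) (graftRoot : Fin n → Fin m2) (graftVs pathVs : Fin n → List (Fin m2))
  (Relevant : Fin n → Set)
  (arc-inner : ∀ u c → arc u c ≡ true → HasChild arc c → arc′ (f u) (f c) ≡ true)
  (path-to-graft : ∀ z → Relevant z → ∀ u → arc u (leafOf z) ≡ true → Path arc′ (f u) (graftRoot z) (pathVs z))
  (embeds-graft : ∀ z → Relevant z → Embeds arc′ leafOf′ (grafted z) (graftRoot z) (graftVs z))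
  (graft-unique : ∀ z → Relevant z → Unique (pathVs z ++ graftVs z))
  (graft-disjoint : ∀ z z2 → Relevant z → Relevant z2 → z ≢ z2 → Disjoint (pathVs z ++ graftVs z) (pathVs z2 ++ graftVs z2))
  (inner∉graft : ∀ c z → HasChild arc c → Relevant z → f c ∉ pathVs z ++ graftVs z)
  where

  graftedRoot : BTree n → Fin m → Fin m2
  graftedRoot (leaf z) v = graftRoot z
  graftedRoot (node _ _) v = f v

  leafPath : BTree n → List (Fin m2)
  leafPath (leaf z) = pathVs z
  leafPath (node _ _) = []

  leafLabel : BTree n → List (Fin n)
  leafLabel (leaf z) = z ∷ []
  leafLabel (node _ _) = []

  inner : BTree n → List (Fin n)
  inner (leaf z) = []
  inner (node l r) = leaves l ++ leaves r

  Origin : List (Fin m) → List (Fin n) → List (Fin n) → Fin m2 → Set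
  Origin Pv Pe Pg w = (∃ λ c → c ∈ Pv × HasChild arc c × w ≡ f c) ⊎ (∃ λ z → z ∈ Pe × w ∈ pathVs z) ⊎ (∃ λ z → z ∈ Pg × w ∈ graftVs z)

  AllRelevant : List (Fin n) → Set
  AllRelevant L = ∀ {z} → z ∈ L → Relevant z

  widen : ∀ {Pv Pe Pg Qv Qe Qg w} → Pv ⊆ Qv → Pe ⊆ Qe → Pg ⊆ Qg → Origin Pv Pe Pg w → Origin Qv Qe Qg w
  widen a b c (inj₁ (x , m , h , e)) = inj₁ (x , a m , h , e)
  widen a b c (inj₂ (inj₁ (z , m , w))) = inj₂ (inj₁ (z , b m , w))
  widen a b c (inj₂ (inj₂ (z , m , w))) = inj₂ (inj₂ (z , c m , w))

  ext-gvs-disj : ∀ z → Relevant z → Disjoint (pathVs z) (graftVs z)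
  ext-gvs-disj z oz = proj₂ (proj₂ (Unique-++⁻ (pathVs z) (graft-unique z oz)))

  Origin-disjoint : ∀ {P Q Pv Pe Pg Qv Qe Qg} →
    (∀ {w} → w ∈ P → Origin Pv Pe Pg w) → (∀ {w} → w ∈ Q → Origin Qv Qe Qg w) →
    AllRelevant Pe → AllRelevant Pg → AllRelevant Qe → AllRelevant Qg →
    Disjoint Pv Qv → Disjoint Pe Qe → Disjoint Pg Qg → Disjoint P Q
  Origin-disjoint {P} {Q} cP cQ oPe oPg oQe oQg dv de dg {w} (mP , mQ) = go (cP mP) (cQ mQ)
    where
    go : ∀ {w} → Origin _ _ _ w → Origin _ _ _ w → ⊥
    go (inj₁ (c , m1 , h1' , refl)) (inj₁ (c2 , m2 , _ , e)) with f-injective e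
    ... | refl = dv (m1 , m2)
    go (inj₁ (c , m1 , hc , refl)) (inj₂ (inj₁ (z , mz , mw))) = inner∉graft c z hc (oQe mz) (∈-++⁺ˡ mw)
    go (inj₁ (c , m1 , hc , refl)) (inj₂ (inj₂ (z , mz , mw))) = inner∉graft c z hc (oQg mz) (∈-++⁺ʳ (pathVs z) mw)
    go (inj₂ (inj₁ (z , mz , mw))) (inj₁ (c , m1 , hc , refl)) = inner∉graft c z hc (oPe mz) (∈-++⁺ˡ mw)
    go (inj₂ (inj₂ (z , mz , mw))) (inj₁ (c , m1 , hc , refl)) = inner∉graft c z hc (oPg mz) (∈-++⁺ʳ (pathVs z) mw)
    go (inj₂ (inj₁ (z , mz , mw))) (inj₂ (inj₁ (z2 , mz2 , mw2))) with z Fin.≟ z2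
    ... | yes refl = de (mz , mz2)
    ... | no ne = graft-disjoint z z2 (oPe mz) (oQe mz2) ne (∈-++⁺ˡ mw , ∈-++⁺ˡ mw2)
    go (inj₂ (inj₁ (z , mz , mw))) (inj₂ (inj₂ (z2 , mz2 , mw2))) with z Fin.≟ z2
    ... | yes refl = ext-gvs-disj z (oPe mz) (mw , mw2)
    ... | no ne = graft-disjoint z z2 (oPe mz) (oQg mz2) ne (∈-++⁺ˡ mw , ∈-++⁺ʳ (pathVs z2) mw2)
    go (inj₂ (inj₂ (z , mz , mw))) (inj₂ (inj₁ (z2 , mz2 , mw2))) with z Fin.≟ z2
    ... | yes refl = ext-gvs-disj z (oPg mz) (mw2 , mw)
    ... | no ne = graft-disjoint z z2 (oPg mz) (oQe mz2) ne (∈-++⁺ʳ (pathVs z) mw , ∈-++⁺ˡ mw2)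
    go (inj₂ (inj₂ (z , mz , mw))) (inj₂ (inj₂ (z2 , mz2 , mw2))) with z Fin.≟ z2
    ... | yes refl = dg (mz , mz2)
    ... | no ne = graft-disjoint z z2 (oPg mz) (oQg mz2) ne (∈-++⁺ʳ (pathVs z) mw , ∈-++⁺ʳ (pathVs z2) mw2)

  transportPath : ∀ T {a b is vs} → Embeds arc leafOf T b vs → AllRelevant (leaves T) → Path arc a b is →
    Path arc′ (f a) (graftedRoot T b) (map f is ++ leafPath T)
  transportPath (leaf z) (leafE .z) ok (edge e) = path-to-graft z (ok (here refl)) _ e
  transportPath (node l r) (nodeE el er pl pr) ok (edge e) = edge (arc-inner _ _ e (Path-source pl))
  transportPath T emb ok (cons {w = w} e p) = cons (arc-inner _ w e (Path-source p)) (transportPath T emb ok p)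

  Disjoint-[]ˡ : ∀ {A : Set} {xs : List A} → Disjoint [] xs
  Disjoint-[]ˡ (() , _)

  Disjoint-⊆ : ∀ {A : Set} {xs ys xs2 ys2 : List A} → xs2 ⊆ xs → ys2 ⊆ ys → Disjoint xs ys → Disjoint xs2 ys2
  Disjoint-⊆ a b d (m1 , m2) = d (a m1 , b m2)

  leafLabel⊆leaves : ∀ T → (leafLabel T) ⊆ (leaves T)
  leafLabel⊆leaves (leaf z) m = m
  leafLabel⊆leaves (node _ _) ()

  inner⊆leaves : ∀ T → (inner T) ⊆ (leaves T)
  inner⊆leaves (leaf z) ()
  inner⊆leaves (node l r) m = m

  leafLabel-inner-disjoint : ∀ T → Disjoint (leafLabel T) (inner T)
  leafLabel-inner-disjoint (leaf z) (_ , ())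
  leafLabel-inner-disjoint (node _ _) (() , _)

  Origin-path : ∀ T {a b is} → (p : Path arc a b is) → ∀ {w} → w ∈ map f is ++ leafPath T → Origin is (leafLabel T) [] w
  Origin-path T {is = is} p m with ∈-++⁻ (map f is) m
  ... | inj₁ m1 = let c , mc , e = ∈-map⁻ f m1 in inj₁ (c , mc , Path-inner p mc , e)
  Origin-path (leaf z) p m | inj₂ m2 = inj₂ (inj₁ (z , here refl , m2))
  Origin-path (node _ _) p m | inj₂ ()

  Unique-path : ∀ T {a b is} → Path arc a b is → Unique is → AllRelevant (leafLabel T) → Unique (map f is ++ leafPath T)
  Unique-path (leaf z) p u ok = Unique-++⁺ (map⁺ f-injective u) (proj₁ (Unique-++⁻ (pathVs z) (graft-unique z (ok (here refl))))) dj
    where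
    dj : Disjoint (map f _) (pathVs z)
    dj (m1 , m2) with ∈-map⁻ f m1
    dj (m1 , m2) | c , mc , refl = inner∉graft c z (Path-inner p mc) (ok (here refl)) (∈-++⁺ˡ m2)
  Unique-path (node _ _) {is = is} p u ok = subst Unique (sym (++-identityʳ (map f is))) (map⁺ f-injective u)

  Origin-node : ∀ l r {u a b isl isr vsl vsr C D} → Path arc u a isl → Path arc u b isr →
    (∀ {w} → w ∈ C → Origin vsl (inner l) (leaves l) w) → (∀ {w} → w ∈ D → Origin vsr (inner r) (leaves r) w) →
    ∀ {w} → w ∈ (map f isl ++ leafPath l) ++ (map f isr ++ leafPath r) ++ C ++ D →
    Origin (isl ++ isr ++ vsl ++ vsr) (leaves l ++ leaves r) (leaves l ++ leaves r) w
  Origin-node l r {isl = isl} {isr} {vsl} {C = C} pl pr oC oD m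
    with ∈-++⁻ (map f isl ++ leafPath l) m
  ... | inj₁ ma = widen ∈-++⁺ˡ (∈-++⁺ˡ ∘ leafLabel⊆leaves l) (λ ()) (Origin-path l pl ma)
  ... | inj₂ m₂ with ∈-++⁻ (map f isr ++ leafPath r) m₂
  ... | inj₁ mb = widen (∈-++⁺ʳ isl ∘ ∈-++⁺ˡ) (∈-++⁺ʳ (leaves l) ∘ leafLabel⊆leaves r) (λ ()) (Origin-path r pr mb)
  ... | inj₂ m₃ with ∈-++⁻ C m₃
  ... | inj₁ mc = widen (∈-++⁺ʳ isl ∘ ∈-++⁺ʳ isr ∘ ∈-++⁺ˡ) (∈-++⁺ˡ ∘ inner⊆leaves l) ∈-++⁺ˡ (oC mc)
  ... | inj₂ md = widen (∈-++⁺ʳ isl ∘ ∈-++⁺ʳ isr ∘ ∈-++⁺ʳ vsl) (∈-++⁺ʳ (leaves l) ∘ inner⊆leaves r) (∈-++⁺ʳ (leaves l)) (oD md)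

  transport : ∀ T {v vs} → AllRelevant (leaves T) → Unique (leaves T) → Embeds arc leafOf T v vs → Unique vs →
    ∃ λ vs2 → Embeds arc′ leafOf′ (graft grafted T) (graftedRoot T v) vs2 × Unique vs2 × (∀ {w} → w ∈ vs2 → Origin vs (inner T) (leaves T) w)
  transport (leaf z) ok uT (leafE .z) u =
    graftVs z , embeds-graft z (ok (here refl)) , proj₁ (proj₂ (Unique-++⁻ (pathVs z) (graft-unique z (ok (here refl))))) ,
    (λ m → inj₂ (inj₂ (z , here refl , m)))
  transport (node l r) {u} rel uT (nodeE {vsl = vsl} {vsr = vsr} {isl = isl} {isr = isr} el er pl pr) uu
    with Unique-∷⁻ uu | Unique-++⁻ (leaves l) uT
  ... | u∉ , u-rest | uTl , uTr , dT
    with Unique-++⁴⁻ isl isr vsl u-rest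
  ... | (uisl , uisr , uvsl , uvsr) , (d-isl-isr , d-isl-vsl , d-isl-vsr , d-isr-vsl , d-isr-vsr , d-vsl-vsr)
    with transport l (rel ∘ ∈-++⁺ˡ) uTl el uvsl | transport r (rel ∘ ∈-++⁺ʳ (leaves l)) uTr er uvsr
  ... | C , eC , uC , oC | D , eD , uD , oD =
    f u ∷ A ++ B ++ C ++ D , nodeE eC eD (transportPath l el relˡ pl) (transportPath r er relʳ pr) ,
    Unique-∷⁺ fu∉ unique , origin
    where
    relˡ : AllRelevant (leaves l)
    relˡ m = rel (∈-++⁺ˡ m)
    relʳ : AllRelevant (leaves r)
    relʳ m = rel (∈-++⁺ʳ (leaves l) m)
    A B : List (Fin m2)
    A = map f isl ++ leafPath l
    B = map f isr ++ leafPath r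
    oA : ∀ {w} → w ∈ A → Origin isl (leafLabel l) [] w
    oA = Origin-path l pl
    oB : ∀ {w} → w ∈ B → Origin isr (leafLabel r) [] w
    oB = Origin-path r pr
    relLˡ : AllRelevant (leafLabel l)
    relLˡ m = relˡ (leafLabel⊆leaves l m)
    relLʳ : AllRelevant (leafLabel r)
    relLʳ m = relʳ (leafLabel⊆leaves r m)
    relIˡ : AllRelevant (inner l)
    relIˡ m = relˡ (inner⊆leaves l m)
    relIʳ : AllRelevant (inner r)
    relIʳ m = relʳ (inner⊆leaves r m)
    rel[] : AllRelevant []
    rel[] ()
    dLR : ∀ {X Y} → X ⊆ leaves l → Y ⊆ leaves r → Disjoint X Y
    dLR sx sy = Disjoint-⊆ sx sy dT
    unique : Unique (A ++ B ++ C ++ D)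
    unique = Unique-++⁴⁺ (Unique-path l pl uisl relLˡ) (Unique-path r pr uisr relLʳ) uC uD
      (Origin-disjoint oA oB relLˡ rel[] relLʳ rel[] d-isl-isr (dLR (leafLabel⊆leaves l) (leafLabel⊆leaves r)) Disjoint-[]ˡ)
      (Origin-disjoint oA oC relLˡ rel[] relIˡ relˡ d-isl-vsl (leafLabel-inner-disjoint l) Disjoint-[]ˡ)
      (Origin-disjoint oA oD relLˡ rel[] relIʳ relʳ d-isl-vsr (dLR (leafLabel⊆leaves l) (inner⊆leaves r)) Disjoint-[]ˡ)
      (Origin-disjoint oB oC relLʳ rel[] relIˡ relˡ d-isr-vsl (λ (m₁ , m₂) → dT (inner⊆leaves l m₂ , leafLabel⊆leaves r m₁)) Disjoint-[]ˡ)
      (Origin-disjoint oB oD relLʳ rel[] relIʳ relʳ d-isr-vsr (leafLabel-inner-disjoint r) Disjoint-[]ˡ)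
      (Origin-disjoint oC oD relIˡ relˡ relIʳ relʳ d-vsl-vsr (dLR (inner⊆leaves l) (inner⊆leaves r)) dT)
    u-child : HasChild arc u
    u-child = Path-source pl
    origin-rest : ∀ {w} → w ∈ A ++ B ++ C ++ D →
      Origin (isl ++ isr ++ vsl ++ vsr) (leaves l ++ leaves r) (leaves l ++ leaves r) w
    origin-rest = Origin-node l r pl pr oC oD
    origin : ∀ {w} → w ∈ f u ∷ A ++ B ++ C ++ D →
      Origin (u ∷ isl ++ isr ++ vsl ++ vsr) (leaves l ++ leaves r) (leaves l ++ leaves r) w
    origin (here refl) = inj₁ (u , here refl , u-child , refl)
    origin (there m) = widen there id id (origin-rest m)
    fu∉ : f u ∉ A ++ B ++ C ++ D
    fu∉ m with origin-rest m
    ... | inj₁ (c , mc , _ , e) = u∉ (subst (_∈ isl ++ isr ++ vsl ++ vsr) (sym (f-injective e)) mc)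
    ... | inj₂ (inj₁ (z , mz , mw)) = inner∉graft u z u-child (rel mz) (∈-++⁺ˡ mw)
    ... | inj₂ (inj₂ (z , mz , mw)) = inner∉graft u z u-child (rel mz) (∈-++⁺ʳ (pathVs z) mw)

-- Networks realising a suffix

module Realisations {n : ℕ} (xt : Fin n) (top : ℕ) where

  Occurs : Pairs → Fin n → Set
  Occurs ps z = z ∈ xsOf xt ps

  OnlyXt : Pairs → Set
  OnlyXt ps = ∀ {z} → z ∈ xsOf xt ps → z ≡ xt

  TreeChildOf : ∀ {m} → (Fin m → List (Fin m)) → (Fin m → List (Fin m)) → (Fin n → Fin m) → Pairs → Fin m → Set
  TreeChildOf parents children leafOf ps w =
    (length (parents w) ≡ 1 × length (children w) ≡ 2) ⊎ (∃ λ z → z ∈ ys ps × Occurs ps z × leafOf z ≡ w)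

  -- Parent and child lists make the degrees of the network computable; rank certifies
  -- acyclicity. In tree-child, a leaf occurring as a second coordinate qualifies because s is
  -- tree-child, so no reticulation will ever be put above it. The two fields about the label of
  -- parentOf z say when it is the current maximal label runs xt ps: this is what keeps a new
  -- hybridization arc temporal whenever its pair is temporal.
  record Realisation (ps : Pairs) : Set where
    field
      m : ℕ
      arc : Fin m → Fin m → Bool
      root : Fin m
      parents : Fin m → List (Fin m)
      children : Fin m → List (Fin m)
      arc⇒parent : ∀ u v → arc u v ≡ true → u ∈ parents v
      parent⇒arc : ∀ u v → u ∈ parents v → arc u v ≡ true
      arc⇒child : ∀ u v → arc u v ≡ true → v ∈ children u
      child⇒arc : ∀ u v → v ∈ children u → arc u v ≡ true
      parents-unique : ∀ v → Unique (parents v)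
      children-unique : ∀ v → Unique (children v)
      leafOf : Fin n → Fin m
      parentOf : Fin n → Fin m
      leaf-parents : ∀ z → Occurs ps z → parents (leafOf z) ≡ parentOf z ∷ []
      leaf-children : ∀ z → Occurs ps z → children (leafOf z) ≡ []
      leafOf-injective : ∀ z w → Occurs ps z → Occurs ps w → leafOf z ≡ leafOf w → z ≡ w
      leaf-labelled : ∀ v → children v ≡ [] → ∃ λ z → Occurs ps z × leafOf z ≡ v
      root-parents : parents root ≡ []
      root-children : length (children root) ≡ 2
      vertex-kind : ∀ v → v ≢ root →
          (length (children v) ≡ 0 × length (parents v) ≡ 1)
        ⊎ (length (parents v) ≡ 1 × length (children v) ≡ 2)
        ⊎ (length (children v) ≡ 1 × length (parents v) ≡ 2)
      tree-child : ∀ v → length (parents v) ≡ 1 → length (children v) ≡ 2 → ∃ λ w → w ∈ children v ×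
        TreeChildOf parents children leafOf ps w
      time : Fin m → ℕ
      time-leaf : ∀ z → Occurs ps z → time (leafOf z) ≡ top
      time-internal : ∀ v → children v ≢ [] → time v ≤ runs xt ps
      time-tree-arc : ∀ u v → arc u v ≡ true → length (parents v) ≤ 1 → time u < time v
      time-hybrid-arc : ∀ u v → arc u v ≡ true → 2 ≤ length (parents v) → time v ≤ time u
      time-hybrid-attained : ∀ v → 2 ≤ length (parents v) → ∃ λ u → arc u v ≡ true × time u ≡ time v
      parent-at-runs : ∀ z → Occurs ps z → time (parentOf z) ≡ runs xt ps →
        z ≡ headX xt ps ⊎ inLeadingRun (headX xt ps) z ps ≡ true ⊎ headX xt ps ∈ ys ps
      head-parent-at-runs : ∀ z L → xsOf xt ps ≡ z ∷ L → nonTemporal z L ≡ false → (∃ λ w → w ∈ L × w ≢ z) →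
        time (parentOf z) ≡ runs xt ps
      rank : Fin m → ℕ
      rank-arc : ∀ u v → arc u v ≡ true → children v ≢ [] → rank u < rank v
      hybrids : ℕ
      hybrids-sum : sumFin (λ v → length (parents v) ∸ 1) ≡ hybrids
      hybrids-bound : hybrids + length (distinctXs xt ps) ≤ suc (length ps)
      lateArcs : List (Fin m × Fin m)
      lateArcs-complete : ∀ u v → arc u v ≡ true → 2 ≤ length (parents v) → time u ≢ time v → (u , v) ∈ lateArcs
      lateArcs-bound : length lateArcs ≤ dSuffix xt ps
      displays : ∀ T → Unique (leaves T) → applyPairs ps T ≡ leaf xt → DisplaysIn arc leafOf T

  module _ {ps : Pairs} (F : Realisation ps) where
    open Realisation F

    parentOf-arc : ∀ z → Occurs ps z → arc (parentOf z) (leafOf z) ≡ true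
    parentOf-arc z pz = parent⇒arc (parentOf z) (leafOf z) (subst (parentOf z ∈_) (sym (leaf-parents z pz)) (here refl))

    arc-to-leaf : ∀ {z u} → Occurs ps z → arc u (leafOf z) ≡ true → u ≡ parentOf z
    arc-to-leaf {z} {u} pz e with subst (u ∈_) (leaf-parents z pz) (arc⇒parent u (leafOf z) e)
    ... | here q = q

    leaf-no-arc : ∀ {z w} → Occurs ps z → arc (leafOf z) w ≢ true
    leaf-no-arc {z} {w} pz e with subst (w ∈_) (leaf-children z pz) (arc⇒child (leafOf z) w e)
    ... | ()

    root≢leafOf : ∀ {z} → Occurs ps z → root ≢ leafOf z
    root≢leafOf {z} pz e with trans (sym (cong (length ∘ children) e)) root-children
    ... | q rewrite leaf-children z pz = case q of λ ()

    parent-hasChildren : ∀ z → Occurs ps z → children (parentOf z) ≢ []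
    parent-hasChildren z pz e with subst (leafOf z ∈_) e (arc⇒child (parentOf z) (leafOf z) (parentOf-arc z pz))
    ... | ()

    time-parent≤runs : ∀ z → Occurs ps z → time (parentOf z) ≤ runs xt ps
    time-parent≤runs z pz = time-internal (parentOf z) (parent-hasChildren z pz)

    head-parent : ∀ {x} → x ∈ xsOf xt ps → nonTemporal x (xsOf xt ps) ≡ false →
      (∃ λ w → w ∈ xsOf xt ps × w ≢ x) → time (parentOf x) ≡ runs xt ps × x ≡ headX xt ps
    head-parent {x} xp nt (w , wm , wne) with temporal⇒head (xsOf xt ps) nt xp
    ... | L2 , eq , nt2 = head-parent-at-runs x L2 eq nt2 (w , wm2 , wne) , fx
      where
      fx : x ≡ headX xt ps
      fx with xsOf-head xt ps
      ... | vertices-xy , eq3 = proj₁ (∷-injective (trans (sym eq) eq3))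
      wm2 : w ∈ L2
      wm2 with subst (w ∈_) eq wm
      ... | here e = ⊥-elim (wne e)
      ... | there m2 = m2

    parent-at-runs-step : ∀ {x y} → x ∉ ys ps → ∀ z → Occurs ps z →
      time (parentOf z) ≡ runs xt ((x , y) ∷ ps) →
      z ≡ x ⊎ inLeadingRun x z ((x , y) ∷ ps) ≡ true ⊎ x ∈ ys ((x , y) ∷ ps)
    parent-at-runs-step {x} {y} nx z pz e with x Fin.≟ headX xt ps
    ... | no _ = ⊥-elim (n≮n _ (≤-trans (≤-reflexive (sym e)) (time-parent≤runs z pz)))
    ... | yes refl with parent-at-runs z pz e
    ... | inj₁ e2 = inj₁ e2
    ... | inj₂ (inj₁ d) = inj₂ (inj₁ (∧-true⁺ (==-refl x) (∨-true⁺ʳ {a = y == z} d)))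
    ... | inj₂ (inj₂ m) = ⊥-elim (nx m)

  skipPair : ∀ {ps} (F : Realisation ps) x y → x ∈ xsOf xt ps → x ∉ ys ps →
    (∀ T → Unique (leaves T) → applyPairs ((x , y) ∷ ps) T ≡ leaf xt → applyPairs ps T ≡ leaf xt) →
    Realisation ((x , y) ∷ ps)
  skipPair {ps} F x y xp nx reduces = record
    { m = m ; arc = arc ; root = root ; parents = parents ; children = children
    ; arc⇒parent = arc⇒parent ; parent⇒arc = parent⇒arc ; arc⇒child = arc⇒child ; child⇒arc = child⇒arc ; parents-unique = parents-unique ; children-unique = children-unique
    ; leafOf = leafOf ; parentOf = parentOf
    ; leaf-parents = λ z pz → leaf-parents z (occurs-old pz)
    ; leaf-children = λ z pz → leaf-children z (occurs-old pz)
    ; leafOf-injective = λ z w pz pw → leafOf-injective z w (occurs-old pz) (occurs-old pw)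
    ; leaf-labelled = λ v e → let z , pz , q = leaf-labelled v e in z , there pz , q
    ; root-parents = root-parents ; root-children = root-children ; vertex-kind = vertex-kind
    ; tree-child = tree-child′
    ; time = time ; time-leaf = λ z pz → time-leaf z (occurs-old pz)
    ; time-internal = λ v ne → ≤-trans (time-internal v ne) (runs-mono xt x y ps)
    ; time-tree-arc = time-tree-arc ; time-hybrid-arc = time-hybrid-arc ; time-hybrid-attained = time-hybrid-attained
    ; parent-at-runs = λ z pz e → parent-at-runs-step F nx z (occurs-old pz) e
    ; head-parent-at-runs = head-parent-at-runs′
    ; rank = rank ; rank-arc = rank-arc
    ; hybrids = hybrids ; hybrids-sum = hybrids-sum
    ; hybrids-bound = hybrids-bound′
    ; lateArcs = lateArcs ; lateArcs-complete = lateArcs-complete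
    ; lateArcs-bound = ≤-trans lateArcs-bound (m≤n+m (dSuffix xt ps) _)
    ; displays = λ T u e → displays T u (reduces T u e)
    }
    where
    open Realisation F
    occurs-old : ∀ {z} → Occurs ((x , y) ∷ ps) z → Occurs ps z
    occurs-old (here refl) = xp
    occurs-old (there m) = m
    tree-child′ : ∀ v → length (parents v) ≡ 1 → length (children v) ≡ 2 →
      ∃ λ w → w ∈ children v × TreeChildOf parents children leafOf ((x , y) ∷ ps) w
    tree-child′ v a b with tree-child v a b
    ... | w , wm , inj₁ g = w , wm , inj₁ g
    ... | w , wm , inj₂ (z , zy , zp , e) = w , wm , inj₂ (z , there zy , there zp , e)
    head-parent-at-runs′ : ∀ z L → xsOf xt ((x , y) ∷ ps) ≡ z ∷ L → nonTemporal z L ≡ false → (∃ λ w → w ∈ L × w ≢ z) →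
        time (parentOf z) ≡ runs xt ((x , y) ∷ ps)
    head-parent-at-runs′ z L eq nt ex with ∷-injective eq
    ... | refl , refl with head-parent F xp nt ex
    ... | e1 , e2 = trans e1 (sym (runs-same xt x y ps e2))
    distinctXs≡ : distinctXs xt ((x , y) ∷ ps) ≡ distinctXs xt ps
    distinctXs≡ rewrite ∈⇒elem xp = refl
    hybrids-bound′ : hybrids + length (distinctXs xt ((x , y) ∷ ps)) ≤ suc (suc (length ps))
    hybrids-bound′ rewrite distinctXs≡ = ≤-trans hybrids-bound (n≤1+n _)

-- Adding a reticulation

-- In an extended network the old vertex c becomes ss c, and p0 is the new tree vertex on the
-- pendant arc of y; q1 is the new reticulation on the pendant arc of x, or the new leaf x.
pattern p0 = Fin.zero
pattern q1 = Fin.suc Fin.zero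
pattern ss c = Fin.suc (Fin.suc c)

map≡[]⇒[] : ∀ {A C : Set} {g : A → C} (L : List A) → map g L ≡ [] → L ≡ []
map≡[]⇒[] [] _ = refl

module Reticulate {n : ℕ} (xt : Fin n) (top : ℕ) where
  open Realisations xt top

  module Step {ps : Pairs} (F : Realisation ps) (x y : Fin n) (x∈ : x ∈ xsOf xt ps) (y∈ : y ∈ xsOf xt ps)
    (x≢y : x ≢ y) (not-repeated : inLeadingRun x y ps ≡ false) (x∉ys : x ∉ ys ps) (ps<top : suc (length ps) < top) where
    open Realisation F
    ps′ : Pairs
    ps′ = (x , y) ∷ ps
    X Y PX PY : Fin m
    X = leafOf x
    Y = leafOf y
    PX = parentOf x
    PY = parentOf y
    M : ℕ
    M = suc (suc m)

    f : Fin m → Fin M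
    f c = ss c
    f-injective : ∀ {a b} → f a ≡ f b → a ≡ b
    f-injective refl = refl

    X≢Y : X ≢ Y
    X≢Y e = x≢y (leafOf-injective x y x∈ y∈ e)

    data OldVertex (c : Fin m) : Set where
      isY : c ≡ Y → OldVertex c
      isX : c ≡ X → OldVertex c
      oth : c ≢ Y → c ≢ X → OldVertex c

    oldVertex : ∀ c → OldVertex c
    oldVertex c with c Fin.≟ Y | c Fin.≟ X
    ... | yes e | _ = isY e
    ... | no _ | yes e = isX e
    ... | no a | no b = oth a b

    ρ : Fin m → Fin M
    ρ c = if c == Y then p0 else (if c == X then q1 else f c)

    ρ-Y : ρ Y ≡ p0
    ρ-Y rewrite ==-refl Y = refl
    ρ-X : ρ X ≡ q1
    ρ-X rewrite ≢⇒== X≢Y | ==-refl X = refl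
    ρ-old : ∀ {c} → c ≢ Y → c ≢ X → ρ c ≡ f c
    ρ-old a b rewrite ≢⇒== a | ≢⇒== b = refl

    ρ⁻¹ : Fin M → Fin m
    ρ⁻¹ p0 = Y
    ρ⁻¹ q1 = X
    ρ⁻¹ (ss c) = c

    ρ⁻¹∘ρ : ∀ c → ρ⁻¹ (ρ c) ≡ c
    ρ⁻¹∘ρ c with oldVertex c
    ... | isY refl = cong ρ⁻¹ ρ-Y
    ... | isX refl = cong ρ⁻¹ ρ-X
    ... | oth b1 b2 = cong ρ⁻¹ (ρ-old b1 b2)

    ρ-inj : ∀ {a b} → ρ a ≡ ρ b → a ≡ b
    ρ-inj {a} {b} e = trans (sym (ρ⁻¹∘ρ a)) (trans (cong ρ⁻¹ e) (ρ⁻¹∘ρ b))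

    arc′ : Fin M → Fin M → Bool
    arc′ p0 p0 = false
    arc′ p0 q1 = true
    arc′ p0 (ss c) = c == Y
    arc′ q1 p0 = false
    arc′ q1 q1 = false
    arc′ q1 (ss c) = c == X
    arc′ (ss u) p0 = u == PY
    arc′ (ss u) q1 = u == PX
    arc′ (ss u) (ss c) = arc u c ∧ (not (c == Y) ∧ not (c == X))

    parents′ : Fin M → List (Fin M)
    parents′ p0 = f PY ∷ []
    parents′ q1 = f PX ∷ p0 ∷ []
    parents′ (ss c) = if c == Y then p0 ∷ [] else (if c == X then q1 ∷ [] else map f (parents c))

    children′ : Fin M → List (Fin M)
    children′ p0 = q1 ∷ f Y ∷ []
    children′ q1 = f X ∷ []
    children′ (ss u) = map ρ (children u)

    parents′-Y : parents′ (ss Y) ≡ p0 ∷ []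
    parents′-Y rewrite ==-refl Y = refl
    parents′-X : parents′ (ss X) ≡ q1 ∷ []
    parents′-X rewrite ≢⇒== X≢Y | ==-refl X = refl
    parents′-old : ∀ {c} → c ≢ Y → c ≢ X → parents′ (ss c) ≡ map f (parents c)
    parents′-old a b rewrite ≢⇒== a | ≢⇒== b = refl

    arc′-old : ∀ {u c} → c ≢ Y → c ≢ X → arc′ (ss u) (ss c) ≡ arc u c
    arc′-old {u} {c} a b rewrite ≢⇒== a | ≢⇒== b with arc u c
    ... | true = refl
    ... | false = refl

    arc′-old⁻ : ∀ {u c} → arc′ (ss u) (ss c) ≡ true → arc u c ≡ true × c ≢ Y × c ≢ X
    arc′-old⁻ {u} {c} e = ∧-true⁻ˡ e , ==⇒≢ (not-true⁻ (∧-true⁻ˡ (∧-true⁻ʳ {a = arc u c} e))) , ==⇒≢ (not-true⁻ (∧-true⁻ʳ (∧-true⁻ʳ {a = arc u c} e)))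

    arc⇒parent′ : ∀ u v → arc′ u v ≡ true → u ∈ parents′ v
    arc⇒parent′ p0 q1 _ = there (here refl)
    arc⇒parent′ p0 (ss c) e with ==⇒≡ {a = c} {b = Y} e
    ... | refl = subst (p0 ∈_) (sym parents′-Y) (here refl)
    arc⇒parent′ q1 (ss c) e with ==⇒≡ {a = c} {b = X} e
    ... | refl = subst (q1 ∈_) (sym parents′-X) (here refl)
    arc⇒parent′ (ss u) p0 e with ==⇒≡ {a = u} {b = PY} e
    ... | refl = here refl
    arc⇒parent′ (ss u) q1 e with ==⇒≡ {a = u} {b = PX} e
    ... | refl = here refl
    arc⇒parent′ (ss u) (ss c) e with arc′-old⁻ {u} {c} e
    ... | a , b1 , b2 = subst (f u ∈_) (sym (parents′-old b1 b2)) (∈-map⁺ f (arc⇒parent u c a))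

    parent⇒arc′ : ∀ u v → u ∈ parents′ v → arc′ u v ≡ true
    parent⇒arc′ u p0 (here refl) = ==-refl PY
    parent⇒arc′ u q1 (here refl) = ==-refl PX
    parent⇒arc′ u q1 (there (here refl)) = refl
    parent⇒arc′ u (ss c) mm with oldVertex c
    ... | isY refl with subst (u ∈_) parents′-Y mm
    ... | here refl = ==-refl Y
    parent⇒arc′ u (ss c) mm | isX refl with subst (u ∈_) parents′-X mm
    ... | here refl = ==-refl X
    parent⇒arc′ u (ss c) mm | oth b1 b2 with ∈-map⁻ f (subst (u ∈_) (parents′-old b1 b2) mm)
    ... | u0 , m0 , refl = trans (arc′-old b1 b2) (parent⇒arc u0 c m0)

    arc⇒child′ : ∀ u v → arc′ u v ≡ true → v ∈ children′ u
    arc⇒child′ p0 q1 _ = here refl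
    arc⇒child′ p0 (ss c) e with ==⇒≡ {a = c} {b = Y} e
    ... | refl = there (here refl)
    arc⇒child′ q1 (ss c) e with ==⇒≡ {a = c} {b = X} e
    ... | refl = here refl
    arc⇒child′ (ss u) p0 e with ==⇒≡ {a = u} {b = PY} e
    ... | refl = subst (_∈ map ρ (children PY)) ρ-Y (∈-map⁺ ρ (arc⇒child PY Y (parentOf-arc F y y∈)))
    arc⇒child′ (ss u) q1 e with ==⇒≡ {a = u} {b = PX} e
    ... | refl = subst (_∈ map ρ (children PX)) ρ-X (∈-map⁺ ρ (arc⇒child PX X (parentOf-arc F x x∈)))
    arc⇒child′ (ss u) (ss c) e with arc′-old⁻ {u} {c} e
    ... | a , b1 , b2 = subst (_∈ map ρ (children u)) (ρ-old b1 b2) (∈-map⁺ ρ (arc⇒child u c a))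

    child⇒arc′ : ∀ u v → v ∈ children′ u → arc′ u v ≡ true
    child⇒arc′ p0 v (here refl) = refl
    child⇒arc′ p0 v (there (here refl)) = ==-refl Y
    child⇒arc′ q1 v (here refl) = ==-refl X
    child⇒arc′ (ss u) v mm with ∈-map⁻ ρ mm
    ... | c , mc , refl with oldVertex c
    ... | isY refl rewrite ρ-Y | arc-to-leaf F y∈ (child⇒arc u Y mc) = ==-refl PY
    ... | isX refl rewrite ρ-X | arc-to-leaf F x∈ (child⇒arc u X mc) = ==-refl PX
    ... | oth b1 b2 rewrite ρ-old b1 b2 = trans (arc′-old b1 b2) (child⇒arc u c mc)

    parents-unique′ : ∀ v → Unique (parents′ v)
    parents-unique′ p0 = Unique-[-] _
    parents-unique′ q1 = Unique-∷⁺ (λ { (here ()) ; (there ()) }) (Unique-[-] _)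
    parents-unique′ (ss c) with oldVertex c
    ... | isY refl rewrite parents′-Y = Unique-[-] _
    ... | isX refl rewrite parents′-X = Unique-[-] _
    ... | oth b1 b2 rewrite parents′-old b1 b2 = map⁺ f-injective (parents-unique c)

    children-unique′ : ∀ v → Unique (children′ v)
    children-unique′ p0 = Unique-∷⁺ (λ { (here ()) ; (there ()) }) (Unique-[-] _)
    children-unique′ q1 = Unique-[-] _
    children-unique′ (ss u) = map⁺ ρ-inj (children-unique u)

    leafOf′ : Fin n → Fin M
    leafOf′ z = f (leafOf z)

    parentOf′ : Fin n → Fin M
    parentOf′ z = if z == y then p0 else (if z == x then q1 else f (parentOf z))

    parentOf′-y : parentOf′ y ≡ p0
    parentOf′-y rewrite ==-refl y = refl
    parentOf′-x : parentOf′ x ≡ q1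
    parentOf′-x rewrite ≢⇒== x≢y | ==-refl x = refl
    parentOf′-old : ∀ {z} → z ≢ y → z ≢ x → parentOf′ z ≡ f (parentOf z)
    parentOf′-old a b rewrite ≢⇒== a | ≢⇒== b = refl

    occurs-old : ∀ {z} → Occurs ps′ z → Occurs ps z
    occurs-old (here refl) = x∈
    occurs-old (there mm) = mm

    data LeafCase (z : Fin n) : Set where
      zY : z ≡ y → LeafCase z
      zX : z ≡ x → LeafCase z
      zO : z ≢ y → z ≢ x → LeafCase z

    leafCase : ∀ z → LeafCase z
    leafCase z with z Fin.≟ y | z Fin.≟ x
    ... | yes e | _ = zY e
    ... | no _ | yes e = zX e
    ... | no a | no b = zO a b

    lfY : ∀ {z} → Occurs ps z → z ≢ y → leafOf z ≢ Y
    lfY pz ne e = ne (leafOf-injective _ y pz y∈ e)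
    lfX : ∀ {z} → Occurs ps z → z ≢ x → leafOf z ≢ X
    lfX pz ne e = ne (leafOf-injective _ x pz x∈ e)

    leaf-parents′ : ∀ z → Occurs ps′ z → parents′ (leafOf′ z) ≡ parentOf′ z ∷ []
    leaf-parents′ z pz with leafCase z
    ... | zY refl rewrite parents′-Y | parentOf′-y = refl
    ... | zX refl rewrite parents′-X | parentOf′-x = refl
    ... | zO a b rewrite parents′-old (lfY (occurs-old pz) a) (lfX (occurs-old pz) b) | leaf-parents z (occurs-old pz) | parentOf′-old a b = refl

    leaf-children′ : ∀ z → Occurs ps′ z → children′ (leafOf′ z) ≡ []
    leaf-children′ z pz rewrite leaf-children z (occurs-old pz) = refl

    leaf-labelled′ : ∀ v → children′ v ≡ [] → ∃ λ z → Occurs ps′ z × leafOf′ z ≡ v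
    leaf-labelled′ p0 ()
    leaf-labelled′ q1 ()
    leaf-labelled′ (ss c) e with leaf-labelled c (map≡[]⇒[] (children c) e)
    ... | z , pz , q = z , there pz , cong f q

    length-parents′ : ∀ c → length (parents′ (ss c)) ≡ length (parents c)
    length-parents′ c with oldVertex c
    ... | isY refl rewrite parents′-Y | leaf-parents y y∈ = refl
    ... | isX refl rewrite parents′-X | leaf-parents x x∈ = refl
    ... | oth b1 b2 rewrite parents′-old b1 b2 = length-map f (parents c)

    length-children′ : ∀ c → length (children′ (ss c)) ≡ length (children c)
    length-children′ c = length-map ρ (children c)

    root-parents′ : parents′ (ss root) ≡ []
    root-parents′ rewrite parents′-old (root≢leafOf F y∈) (root≢leafOf F x∈) | root-parents = refl

    root-children′ : length (children′ (ss root)) ≡ 2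
    root-children′ = trans (length-children′ root) root-children

    vertex-kind′ : ∀ v → v ≢ ss root →
          (length (children′ v) ≡ 0 × length (parents′ v) ≡ 1)
        ⊎ (length (parents′ v) ≡ 1 × length (children′ v) ≡ 2)
        ⊎ (length (children′ v) ≡ 1 × length (parents′ v) ≡ 2)
    vertex-kind′ p0 _ = inj₂ (inj₁ (refl , refl))
    vertex-kind′ q1 _ = inj₂ (inj₂ (refl , refl))
    vertex-kind′ (ss c) ne rewrite length-parents′ c | length-children′ c = vertex-kind c (λ e → ne (cong f e))

    tree-child′ : ∀ v → length (parents′ v) ≡ 1 → length (children′ v) ≡ 2 → ∃ λ w → w ∈ children′ v ×
        TreeChildOf parents′ children′ leafOf′ ps′ w
    tree-child′ p0 _ _ = f Y , there (here refl) , inj₂ (y , here refl , there y∈ , refl)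
    tree-child′ q1 () _
    tree-child′ (ss c) a b with tree-child c (trans (sym (length-parents′ c)) a) (trans (sym (length-children′ c)) b)
    ... | w , wm , tree-child-w with oldVertex w
    ... | isY refl = p0 , subst (_∈ map ρ (children c)) ρ-Y (∈-map⁺ ρ wm) , inj₁ (refl , refl)
    ... | isX refl = ⊥-elim (¬X-tree-child tree-child-w)
      where
      ¬X-tree-child : ¬ TreeChildOf parents children leafOf ps X
      ¬X-tree-child (inj₁ (_ , o)) rewrite leaf-children x x∈ = case o of λ ()
      ¬X-tree-child (inj₂ (z , zy , zp , e)) = x∉ys (subst (_∈ ys ps) (leafOf-injective z x zp x∈ e) zy)
    ... | oth b1 b2 = f w , subst (_∈ map ρ (children c)) (ρ-old b1 b2) (∈-map⁺ ρ wm) , tree-child-old tree-child-w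
      where
      tree-child-old : TreeChildOf parents children leafOf ps w → TreeChildOf parents′ children′ leafOf′ ps′ (f w)
      tree-child-old (inj₁ (i1 , o2)) = inj₁ (trans (length-parents′ w) i1 , trans (length-children′ w) o2)
      tree-child-old (inj₂ (z , zy , zp , e)) = inj₂ (z , there zy , there zp , cong f e)

    time′ : Fin M → ℕ
    time′ p0 = runs xt ps′
    time′ q1 = time PX
    time′ (ss c) = time c

    runs<top : runs xt ps′ < top
    runs<top = ≤-<-trans (runs≤length xt ps′) ps<top

    time-PX≤runs : time PX ≤ runs xt ps′
    time-PX≤runs = ≤-trans (time-parent≤runs F x x∈) (runs-mono xt x y ps)

    children′-old≢[] : ∀ c → children′ (ss c) ≢ [] → children c ≢ []
    children′-old≢[] c ne e rewrite e = ne refl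

    time-internal′ : ∀ v → children′ v ≢ [] → time′ v ≤ runs xt ps′
    time-internal′ p0 _ = ≤-refl
    time-internal′ q1 _ = time-PX≤runs
    time-internal′ (ss c) ne = ≤-trans (time-internal c (children′-old≢[] c ne)) (runs-mono xt x y ps)

    -- The invariant parent-at-runs rules out that PY already carries the label of the new p0.
    time-PY<runs : time PY < runs xt ps′
    time-PY<runs with x Fin.≟ headX xt ps
    ... | no _ = s≤s (time-parent≤runs F y y∈)
    ... | yes e = ≤∧≢⇒< (time-parent≤runs F y y∈) ne
      where
      ne : time PY ≢ runs xt ps
      ne q with parent-at-runs y y∈ q
      ... | inj₁ e2 = x≢y (trans e (sym e2))
      ... | inj₂ (inj₁ d) rewrite sym e = true≢false (trans (sym d) not-repeated)
      ... | inj₂ (inj₂ m2) rewrite sym e = x∉ys m2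

    time-tree-arc′ : ∀ u v → arc′ u v ≡ true → length (parents′ v) ≤ 1 → time′ u < time′ v
    time-tree-arc′ p0 q1 _ le = ⊥-elim (n≮n 1 le)
    time-tree-arc′ p0 (ss c) e le with ==⇒≡ {a = c} {b = Y} e
    ... | refl rewrite time-leaf y y∈ = runs<top
    time-tree-arc′ q1 (ss c) e le with ==⇒≡ {a = c} {b = X} e
    ... | refl rewrite time-leaf x x∈ = ≤-<-trans time-PX≤runs runs<top
    time-tree-arc′ (ss u) p0 e le with ==⇒≡ {a = u} {b = PY} e
    ... | refl = time-PY<runs
    time-tree-arc′ (ss u) q1 e le = ⊥-elim (n≮n 1 le)
    time-tree-arc′ (ss u) (ss c) e le with arc′-old⁻ {u} {c} e
    ... | a , b1 , b2 = time-tree-arc u c a (subst (_≤ 1) (length-parents′ c) le)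

    time-hybrid-arc′ : ∀ u v → arc′ u v ≡ true → 2 ≤ length (parents′ v) → time′ v ≤ time′ u
    time-hybrid-arc′ u p0 e (s≤s ())
    time-hybrid-arc′ p0 q1 e le = time-PX≤runs
    time-hybrid-arc′ (ss u) q1 e le with ==⇒≡ {a = u} {b = PX} e
    ... | refl = ≤-refl
    time-hybrid-arc′ p0 (ss c) e le with ==⇒≡ {a = c} {b = Y} e
    ... | refl rewrite length-parents′ Y | leaf-parents y y∈ = ⊥-elim (n≮n 1 le)
    time-hybrid-arc′ q1 (ss c) e le with ==⇒≡ {a = c} {b = X} e
    ... | refl rewrite length-parents′ X | leaf-parents x x∈ = ⊥-elim (n≮n 1 le)
    time-hybrid-arc′ (ss u) (ss c) e le with arc′-old⁻ {u} {c} e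
    ... | a , b1 , b2 = time-hybrid-arc u c a (subst (2 ≤_) (length-parents′ c) le)

    time-hybrid-attained′ : ∀ v → 2 ≤ length (parents′ v) → ∃ λ u → arc′ u v ≡ true × time′ u ≡ time′ v
    time-hybrid-attained′ p0 (s≤s ())
    time-hybrid-attained′ q1 _ = ss PX , ==-refl PX , refl
    time-hybrid-attained′ (ss c) le with oldVertex c
    ... | isY refl rewrite length-parents′ Y | leaf-parents y y∈ = ⊥-elim (n≮n 1 le)
    ... | isX refl rewrite length-parents′ X | leaf-parents x x∈ = ⊥-elim (n≮n 1 le)
    ... | oth b1 b2 with time-hybrid-attained c (subst (2 ≤_) (length-parents′ c) le)
    ... | u0 , e , q = ss u0 , trans (arc′-old b1 b2) e , q

    parent-at-runs′ : ∀ z → Occurs ps′ z → time′ (parentOf′ z) ≡ runs xt ps′ →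
        z ≡ x ⊎ inLeadingRun x z ps′ ≡ true ⊎ x ∈ ys ps′
    parent-at-runs′ z pz e with leafCase z
    ... | zY refl = inj₂ (inj₁ (∧-true⁺ (==-refl x) (∨-true⁺ˡ (==-refl y))))
    ... | zX refl = inj₁ refl
    ... | zO a b rewrite parentOf′-old a b = parent-at-runs-step F x∉ys z (occurs-old pz) e

    other-leaf : ∃ λ w → w ∈ xsOf xt ps × w ≢ x
    other-leaf = y , y∈ , (λ e → x≢y (sym e))

    head-parent-at-runs′ : ∀ z L → xsOf xt ps′ ≡ z ∷ L → nonTemporal z L ≡ false → (∃ λ w → w ∈ L × w ≢ z) →
        time′ (parentOf′ z) ≡ runs xt ps′
    head-parent-at-runs′ z L eq nt ex with ∷-injective eq
    ... | refl , refl with head-parent F x∈ nt ex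
    ... | e1 , e2 rewrite parentOf′-x = trans e1 (sym (runs-same xt x y ps e2))

    rank′ : Fin M → ℕ
    rank′ p0 = suc (rank PY)
    rank′ q1 = suc (suc (rank PY + rank PX))
    rank′ (ss c) = rank c

    rank-arc′ : ∀ u v → arc′ u v ≡ true → children′ v ≢ [] → rank′ u < rank′ v
    rank-arc′ p0 q1 _ _ = s≤s (s≤s (m≤m+n _ _))
    rank-arc′ p0 (ss c) e ne with ==⇒≡ {a = c} {b = Y} e
    ... | refl = ⊥-elim (children′-old≢[] Y ne (leaf-children y y∈))
    rank-arc′ q1 (ss c) e ne with ==⇒≡ {a = c} {b = X} e
    ... | refl = ⊥-elim (children′-old≢[] X ne (leaf-children x x∈))
    rank-arc′ (ss u) p0 e ne with ==⇒≡ {a = u} {b = PY} e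
    ... | refl = ≤-refl
    rank-arc′ (ss u) q1 e ne with ==⇒≡ {a = u} {b = PX} e
    ... | refl = s≤s (≤-trans (m≤n+m _ _) (n≤1+n _))
    rank-arc′ (ss u) (ss c) e ne with arc′-old⁻ {u} {c} e
    ... | a , _ , _ = rank-arc u c a (children′-old≢[] c ne)

    hybrids-sum′ : sumFin (λ v → length (parents′ v) ∸ 1) ≡ suc hybrids
    hybrids-sum′ = cong suc (trans (sumFin-cong (λ c → cong (_∸ 1) (length-parents′ c))) hybrids-sum)

    hybrids-bound′ : suc hybrids + length (distinctXs xt ps′) ≤ suc (length ps′)
    hybrids-bound′ rewrite ∈⇒elem x∈ = s≤s hybrids-bound

    f×f : Fin m × Fin m → Fin M × Fin M
    f×f (a , b) = f a , f b

    oldLateArcs : List (Fin M × Fin M)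
    oldLateArcs = map f×f lateArcs

    lateArcs′ : List (Fin M × Fin M)
    lateArcs′ = if nonTemporal x (xsOf xt ps) then (p0 , q1) ∷ oldLateArcs else oldLateArcs

    oldLateArcs⊆ : ∀ {e} → e ∈ oldLateArcs → e ∈ lateArcs′
    oldLateArcs⊆ mm with nonTemporal x (xsOf xt ps)
    ... | true = there mm
    ... | false = mm

    lateArcs-bound′ : length lateArcs′ ≤ dSuffix xt ps′
    lateArcs-bound′ with nonTemporal x (xsOf xt ps)
    ... | true = s≤s (subst (_≤ dSuffix xt ps) (sym (length-map f×f lateArcs)) lateArcs-bound)
    ... | false = subst (_≤ dSuffix xt ps) (sym (length-map f×f lateArcs)) lateArcs-bound

    lateArcs-complete′ : ∀ u v → arc′ u v ≡ true → 2 ≤ length (parents′ v) → time′ u ≢ time′ v → (u , v) ∈ lateArcs′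
    lateArcs-complete′ u p0 e (s≤s ())
    lateArcs-complete′ p0 q1 e le ne with nonTemporal x (xsOf xt ps) in eq
    ... | true = here refl
    ... | false with head-parent F x∈ eq other-leaf
    ... | e1 , e2 = ⊥-elim (ne (trans (runs-same xt x y ps e2) (sym e1)))
    lateArcs-complete′ (ss u) q1 e le ne with ==⇒≡ {a = u} {b = PX} e
    ... | refl = ⊥-elim (ne refl)
    lateArcs-complete′ p0 (ss c) e le ne with ==⇒≡ {a = c} {b = Y} e
    ... | refl rewrite length-parents′ Y | leaf-parents y y∈ = ⊥-elim (n≮n 1 le)
    lateArcs-complete′ q1 (ss c) e le ne with ==⇒≡ {a = c} {b = X} e
    ... | refl rewrite length-parents′ X | leaf-parents x x∈ = ⊥-elim (n≮n 1 le)
    lateArcs-complete′ (ss u) (ss c) e le ne with arc′-old⁻ {u} {c} e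
    ... | a , _ , _ = oldLateArcs⊆ (∈-map⁺ f×f (lateArcs-complete u c a (subst (2 ≤_) (length-parents′ c) le) ne))

    arc-inner : ∀ u c → arc u c ≡ true → HasChild arc c → arc′ (f u) (f c) ≡ true
    arc-inner u c e (w , ew) = trans (arc′-old b1 b2) e
      where
      b1 : c ≢ Y
      b1 refl = leaf-no-arc F y∈ ew
      b2 : c ≢ X
      b2 refl = leaf-no-arc F x∈ ew

    arc′-parentOf : ∀ z → Occurs ps z → z ≢ y → z ≢ x → arc′ (f (parentOf z)) (f (leafOf z)) ≡ true
    arc′-parentOf z pz a b = trans (arc′-old (lfY pz a) (lfX pz b)) (parentOf-arc F z pz)

    pathVsN : Fin n → List (Fin M)
    pathVsN z = if z == y then p0 ∷ [] else (if z == x then q1 ∷ [] else [])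
    pathVsN-y : pathVsN y ≡ p0 ∷ []
    pathVsN-y rewrite ==-refl y = refl
    pathVsN-x : pathVsN x ≡ q1 ∷ []
    pathVsN-x rewrite ≢⇒== x≢y | ==-refl x = refl
    pathVsN-old : ∀ {z} → z ≢ y → z ≢ x → pathVsN z ≡ []
    pathVsN-old a b rewrite ≢⇒== a | ≢⇒== b = refl

    graftRootN : Fin n → Fin M
    graftRootN z = f (leafOf z)
    graftVsN : Fin n → List (Fin M)
    graftVsN z = f (leafOf z) ∷ []

    data Owner (w : Fin M) (z : Fin n) : Set where
      oY : w ≡ p0 → z ≡ y → Owner w z
      oX : w ≡ q1 → z ≡ x → Owner w z
      oF : w ≡ f (leafOf z) → Owner w z

    ownerN : ∀ {w} z → w ∈ pathVsN z ++ graftVsN z → Owner w z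
    ownerN {w} z mm with leafCase z
    ... | zY refl rewrite pathVsN-y with mm
    ... | here e = oY e refl
    ... | there (here e) = oF e
    ownerN {w} z mm | zX refl rewrite pathVsN-x with mm
    ... | here e = oX e refl
    ... | there (here e) = oF e
    ownerN {w} z mm | zO a b rewrite pathVsN-old a b with mm
    ... | here e = oF e

    Owner-unique : ∀ {w z z2} → Occurs ps z → Occurs ps z2 → Owner w z → Owner w z2 → z ≡ z2
    Owner-unique pz pz2 (oY _ a) (oY _ b) = trans a (sym b)
    Owner-unique pz pz2 (oX _ a) (oX _ b) = trans a (sym b)
    Owner-unique pz pz2 (oY refl _) (oX () _)
    Owner-unique pz pz2 (oX refl _) (oY () _)
    Owner-unique pz pz2 (oY refl _) (oF ())
    Owner-unique pz pz2 (oX refl _) (oF ())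
    Owner-unique pz pz2 (oF refl) (oY () _)
    Owner-unique pz pz2 (oF refl) (oX () _)
    Owner-unique {z = z} {z2} pz pz2 (oF a) (oF b) = leafOf-injective z z2 pz pz2 (f-injective (trans (sym a) b))

    Owner-inner : ∀ {c z} → Occurs ps z → HasChild arc c → Owner (f c) z → ⊥
    Owner-inner pz ho (oY () _)
    Owner-inner pz ho (oX () _)
    Owner-inner pz (w , ew) (oF e) with f-injective e
    ... | refl = leaf-no-arc F pz ew

    graft-uniqueN : ∀ z → Occurs ps z → Unique (pathVsN z ++ graftVsN z)
    graft-uniqueN z pz with leafCase z
    ... | zY refl rewrite pathVsN-y = Unique-∷⁺ (λ { (here ()) }) (Unique-[-] _)
    ... | zX refl rewrite pathVsN-x = Unique-∷⁺ (λ { (here ()) }) (Unique-[-] _)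
    ... | zO a b rewrite pathVsN-old a b = Unique-[-] _

    path-to-graftN : ∀ z → Occurs ps z → ∀ u → arc u (leafOf z) ≡ true → Path arc′ (f u) (graftRootN z) (pathVsN z)
    path-to-graftN z pz u e with arc-to-leaf F pz e
    ... | refl with leafCase z
    ... | zY refl rewrite pathVsN-y = cons (==-refl PY) (edge (==-refl Y))
    ... | zX refl rewrite pathVsN-x = cons (==-refl PX) (edge (==-refl X))
    ... | zO a b rewrite pathVsN-old a b = edge (arc′-parentOf z pz a b)

    module Unchanged (T : BTree n) (e : applyPairs ps T ≡ leaf xt) where
      InT : Fin n → Set
      InT z = z ∈ leaves T
      occurs : ∀ {z} → InT z → Occurs ps z
      occurs mm = leaves⊆xsOf xt ps T e mm
      path-to-graft : ∀ z → InT z → ∀ u → arc u (leafOf z) ≡ true → Path arc′ (f u) (graftRootN z) (pathVsN z)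
      path-to-graft z oz = path-to-graftN z (occurs oz)
      embeds-graft : ∀ z → InT z → Embeds arc′ leafOf′ (leaf z) (graftRootN z) (graftVsN z)
      embeds-graft z _ = leafE z
      graft-unique : ∀ z → InT z → Unique (pathVsN z ++ graftVsN z)
      graft-unique z oz = graft-uniqueN z (occurs oz)
      graft-disjoint : ∀ z z2 → InT z → InT z2 → z ≢ z2 → Disjoint (pathVsN z ++ graftVsN z) (pathVsN z2 ++ graftVsN z2)
      graft-disjoint z z2 oz oz2 ne (m1 , m2) = ne (Owner-unique (occurs oz) (occurs oz2) (ownerN z m1) (ownerN z2 m2))
      inner∉graft : ∀ c z → HasChild arc c → InT z → f c ∉ pathVsN z ++ graftVsN z
      inner∉graft c z ho oz mm = Owner-inner (occurs oz) ho (ownerN z mm)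
      module Transported = Transport arc leafOf arc′ leafOf′ f f-injective leaf graftRootN graftVsN pathVsN InT arc-inner path-to-graft embeds-graft graft-unique graft-disjoint inner∉graft

    displays-unchanged : ∀ T → Unique (leaves T) → applyPairs ps T ≡ leaf xt → DisplaysIn arc′ leafOf′ T
    displays-unchanged T uT e with displays T uT e
    ... | v , vs , emb , uvs with Unchanged.Transported.transport T e T (λ mm → mm) uT emb uvs
    ... | vs2 , emb2 , u2 , _ = Unchanged.Transported.graftedRoot T e T v , vs2 , subst (λ T0 → Embeds arc′ leafOf′ T0 (Unchanged.Transported.graftedRoot T e T v) vs2) (graft-leaf T) emb2 , u2

    cherryVs : ∀ {g} → IsCherryTree x y g → List (Fin M)
    cherryVs (inj₁ _) = p0 ∷ q1 ∷ f X ∷ f Y ∷ []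
    cherryVs (inj₂ _) = p0 ∷ q1 ∷ f Y ∷ f X ∷ []

    cherry-embeds : ∀ {g} (cherryTree : IsCherryTree x y g) → Embeds arc′ leafOf′ g p0 (cherryVs cherryTree)
    cherry-embeds (inj₁ refl) = nodeE (leafE x) (leafE y) (cons refl (edge (==-refl X))) (edge (==-refl Y))
    cherry-embeds (inj₂ refl) = nodeE (leafE y) (leafE x) (edge (==-refl Y)) (cons refl (edge (==-refl X)))

    data CherryVertex (w : Fin M) : Set where
      g0 : w ≡ p0 → CherryVertex w
      g1 : w ≡ q1 → CherryVertex w
      gX : w ≡ f X → CherryVertex w
      gY : w ≡ f Y → CherryVertex w

    cherryVs-vertex : ∀ {g w} (cherryTree : IsCherryTree x y g) → w ∈ cherryVs cherryTree → CherryVertex w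
    cherryVs-vertex (inj₁ _) (here e) = g0 e
    cherryVs-vertex (inj₁ _) (there (here e)) = g1 e
    cherryVs-vertex (inj₁ _) (there (there (here e))) = gX e
    cherryVs-vertex (inj₁ _) (there (there (there (here e)))) = gY e
    cherryVs-vertex (inj₂ _) (here e) = g0 e
    cherryVs-vertex (inj₂ _) (there (here e)) = g1 e
    cherryVs-vertex (inj₂ _) (there (there (here e))) = gY e
    cherryVs-vertex (inj₂ _) (there (there (there (here e)))) = gX e

    cherryVs-unique′ : ∀ a b → a ≢ b → Unique (p0 ∷ q1 ∷ f a ∷ f b ∷ [])
    cherryVs-unique′ a b ne = Unique-∷⁺ (λ { (here ()) ; (there (here ())) ; (there (there (here ()))) ; (there (there (there ()))) })
      (Unique-∷⁺ (λ { (here ()) ; (there (here ())) ; (there (there ())) })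
        (Unique-∷⁺ (λ { (here e) → ne (f-injective e) ; (there ()) }) (Unique-[-] _)))

    cherryVs-unique : ∀ {g} (cherryTree : IsCherryTree x y g) → Unique (cherryVs cherryTree)
    cherryVs-unique (inj₁ _) = cherryVs-unique′ X Y X≢Y
    cherryVs-unique (inj₂ _) = cherryVs-unique′ Y X (λ e → X≢Y (sym e))

    module Grafted {g : BTree n} (cherryTree : IsCherryTree x y g) (T₂ : BTree n) (e : applyPairs ps T₂ ≡ leaf xt) (x∉T₂ : x ∉ leaves T₂) where
      InT : Fin n → Set
      InT z = z ∈ leaves T₂
      occurs : ∀ {z} → InT z → Occurs ps z
      occurs mm = leaves⊆xsOf xt ps T₂ e mm
      ≢x : ∀ {z} → InT z → z ≢ x
      ≢x mm refl = x∉T₂ mm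

      graftRootC : Fin n → Fin M
      graftRootC z = if z == y then p0 else f (leafOf z)
      graftVsC : Fin n → List (Fin M)
      graftVsC z = if z == y then cherryVs cherryTree else f (leafOf z) ∷ []
      pathVsC : Fin n → List (Fin M)
      pathVsC z = []

      path-to-graft : ∀ z → InT z → ∀ u → arc u (leafOf z) ≡ true → Path arc′ (f u) (graftRootC z) (pathVsC z)
      path-to-graft z oz u e1 with arc-to-leaf F (occurs oz) e1
      ... | refl with z Fin.≟ y
      ... | yes refl = edge (==-refl PY)
      ... | no ne = edge (arc′-parentOf z (occurs oz) ne (≢x oz))

      embeds-graft : ∀ z → InT z → Embeds arc′ leafOf′ (graftAt y g z) (graftRootC z) (graftVsC z)
      embeds-graft z oz with z Fin.≟ y
      ... | yes refl = cherry-embeds cherryTree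
      ... | no ne = leafE z

      graft-unique : ∀ z → InT z → Unique (pathVsC z ++ graftVsC z)
      graft-unique z oz with z Fin.≟ y
      ... | yes refl = cherryVs-unique cherryTree
      ... | no ne = Unique-[-] _

      data OwnerC (w : Fin M) (z : Fin n) : Set where
        oy : z ≡ y → w ∈ cherryVs cherryTree → OwnerC w z
        oo : z ≢ y → w ≡ f (leafOf z) → OwnerC w z

      ownerC : ∀ {w} z → w ∈ graftVsC z → OwnerC w z
      ownerC {w} z mm with z Fin.≟ y
      ... | yes refl = oy refl mm
      ... | no ne with mm
      ... | here e2 = oo ne e2

      leaf∉cherryVs : ∀ {z} → InT z → z ≢ y → f (leafOf z) ∈ cherryVs cherryTree → ⊥
      leaf∉cherryVs {z} oz ne mm with cherryVs-vertex cherryTree mm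
      ... | gX e2 = ≢x oz (leafOf-injective z x (occurs oz) x∈ (f-injective e2))
      ... | gY e2 = ne (leafOf-injective z y (occurs oz) y∈ (f-injective e2))

      OwnerC-unique : ∀ {w z z2} → InT z → InT z2 → OwnerC w z → OwnerC w z2 → z ≡ z2
      OwnerC-unique oz oz2 (oy a _) (oy b _) = trans a (sym b)
      OwnerC-unique oz oz2 (oy a m1) (oo b refl) = ⊥-elim (leaf∉cherryVs oz2 b m1)
      OwnerC-unique oz oz2 (oo a refl) (oy b m2) = ⊥-elim (leaf∉cherryVs oz a m2)
      OwnerC-unique {z = z} {z2} oz oz2 (oo _ a) (oo _ b) = leafOf-injective z z2 (occurs oz) (occurs oz2) (f-injective (trans (sym a) b))

      graft-disjoint : ∀ z z2 → InT z → InT z2 → z ≢ z2 → Disjoint (pathVsC z ++ graftVsC z) (pathVsC z2 ++ graftVsC z2)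
      graft-disjoint z z2 oz oz2 ne (m1 , m2) = ne (OwnerC-unique oz oz2 (ownerC z m1) (ownerC z2 m2))

      inner∉graft : ∀ c z → HasChild arc c → InT z → f c ∉ pathVsC z ++ graftVsC z
      inner∉graft c z (w , ew) oz mm with ownerC z mm
      ... | oo _ e2 with f-injective e2
      ... | refl = leaf-no-arc F (occurs oz) ew
      inner∉graft c z (w , ew) oz mm | oy _ m2 with cherryVs-vertex cherryTree m2
      ... | gX e2 with f-injective e2
      ... | refl = leaf-no-arc F x∈ ew
      inner∉graft c z (w , ew) oz mm | oy _ m2 | gY e2 with f-injective e2
      ... | refl = leaf-no-arc F y∈ ew

      module Transported = Transport arc leafOf arc′ leafOf′ f f-injective (graftAt y g) graftRootC graftVsC pathVsC InT arc-inner path-to-graft embeds-graft graft-unique graft-disjoint inner∉graft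

    displays-graft : ∀ T T₂ {g} (cherryTree : IsCherryTree x y g) → T ≡ graft (graftAt y g) T₂ → Unique (leaves T₂) →
      applyPairs ps T₂ ≡ leaf xt → x ∉ leaves T₂ → DisplaysIn arc′ leafOf′ T
    displays-graft T T₂ cherryTree eqT u2 e2 x∉T₂ with displays T₂ u2 e2
    ... | v , vs , emb , uvs with Grafted.Transported.transport cherryTree T₂ e2 x∉T₂ T₂ (λ mm → mm) u2 emb uvs
    ... | vs2 , emb2 , uu , _ = Grafted.Transported.graftedRoot cherryTree T₂ e2 x∉T₂ T₂ v , vs2 ,
          subst (λ T0 → Embeds arc′ leafOf′ T0 (Grafted.Transported.graftedRoot cherryTree T₂ e2 x∉T₂ T₂ v) vs2) (sym eqT) emb2 , uu

    displays-cherry : ∀ T → Unique (leaves T) → applyPairs ps′ T ≡ leaf xt → isCherry x y T ≡ true → DisplaysIn arc′ leafOf′ T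
    displays-cherry T uT e ch with Cherry⇒graft (isCherry⇒Cherry T ch) uT
    ... | T₂ , g , d , eqT , cherryTree = displays-graft T T₂ cherryTree eqT (deleteLeaf-Unique {x = x} {T = T} {T₂ = T₂} d uT) e2 x∉T₂
      where
      e2 : applyPairs ps T₂ ≡ leaf xt
      e2 = trans (cong (applyPairs ps) (sym (pickStep-cherry x y T ch d))) e
      x∉T₂ : x ∉ leaves T₂
      x∉T₂ mm = proj₂ (deleteLeaf-∈⁻ {x = x} {T = T} {T₂ = T₂} d mm) refl

    displays′ : ∀ T → Unique (leaves T) → applyPairs ps′ T ≡ leaf xt → DisplaysIn arc′ leafOf′ T
    displays′ T uT e = go (isCherry x y T) refl
      where
      go : ∀ b → isCherry x y T ≡ b → DisplaysIn arc′ leafOf′ T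
      go true ch = displays-cherry T uT e ch
      go false ch = displays-unchanged T uT (trans (cong (applyPairs ps) (sym (pickStep-¬cherry x y T ch))) e)

    result : Realisation ps′
    result = record
      { m = M ; arc = arc′ ; root = ss root ; parents = parents′ ; children = children′
      ; arc⇒parent = arc⇒parent′ ; parent⇒arc = parent⇒arc′ ; arc⇒child = arc⇒child′ ; child⇒arc = child⇒arc′ ; parents-unique = parents-unique′ ; children-unique = children-unique′
      ; leafOf = leafOf′ ; parentOf = parentOf′
      ; leaf-parents = leaf-parents′ ; leaf-children = leaf-children′
      ; leafOf-injective = λ z w pz pw e → leafOf-injective z w (occurs-old pz) (occurs-old pw) (f-injective e)
      ; leaf-labelled = leaf-labelled′ ; root-parents = root-parents′ ; root-children = root-children′ ; vertex-kind = vertex-kind′ ; tree-child = tree-child′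
      ; time = time′ ; time-leaf = λ z pz → time-leaf z (occurs-old pz) ; time-internal = time-internal′ ; time-tree-arc = time-tree-arc′ ; time-hybrid-arc = time-hybrid-arc′ ; time-hybrid-attained = time-hybrid-attained′
      ; parent-at-runs = parent-at-runs′ ; head-parent-at-runs = head-parent-at-runs′ ; rank = rank′ ; rank-arc = rank-arc′
      ; hybrids = suc hybrids ; hybrids-sum = hybrids-sum′ ; hybrids-bound = hybrids-bound′
      ; lateArcs = lateArcs′ ; lateArcs-complete = lateArcs-complete′ ; lateArcs-bound = lateArcs-bound′ ; displays = displays′ }

  reticulate : ∀ {ps} (F : Realisation ps) x y → x ∈ xsOf xt ps → y ∈ xsOf xt ps → x ≢ y → inLeadingRun x y ps ≡ false →
    x ∉ ys ps → suc (length ps) < top → Realisation ((x , y) ∷ ps)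
  reticulate F x y x∈ y∈ x≢y not-repeated x∉ys ps<top = Step.result F x y x∈ y∈ x≢y not-repeated x∉ys ps<top

-- Adding a leaf

module AddLeaf {n : ℕ} (xt : Fin n) (top : ℕ) where
  open Realisations xt top

  -- The new leaf x is hung next to y1: y itself, or x_t for a pair (x , x).
  module Step {ps : Pairs} (F : Realisation ps) (x y y1 : Fin n) (x∉ : x ∉ xsOf xt ps) (y∈ : y1 ∈ xsOf xt ps)
    (y-occurs : y ≡ x ⊎ y ≡ y1) (x∉ys : x ∉ ys ps) (ps<top : suc (length ps) < top) where
    open Realisation F
    ps′ : Pairs
    ps′ = (x , y) ∷ ps
    Y PY : Fin m
    Y = leafOf y1
    PY = parentOf y1
    M : ℕ
    M = suc (suc m)

    f : Fin m → Fin M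
    f c = ss c
    f-injective : ∀ {a b} → f a ≡ f b → a ≡ b
    f-injective refl = refl

    x≢y : x ≢ y1
    x≢y refl = x∉ y∈
    y≢x : y1 ≢ x
    y≢x e = x≢y (sym e)

    data OldVertex (c : Fin m) : Set where
      isY : c ≡ Y → OldVertex c
      oth : c ≢ Y → OldVertex c

    oldVertex : ∀ c → OldVertex c
    oldVertex c with c Fin.≟ Y
    ... | yes e = isY e
    ... | no a = oth a

    ρ : Fin m → Fin M
    ρ c = if c == Y then p0 else f c

    ρ-Y : ρ Y ≡ p0
    ρ-Y rewrite ==-refl Y = refl
    ρ-old : ∀ {c} → c ≢ Y → ρ c ≡ f c
    ρ-old a rewrite ≢⇒== a = refl

    ρ⁻¹ : Fin M → Fin m
    ρ⁻¹ (ss c) = c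
    ρ⁻¹ _ = Y

    ρ⁻¹∘ρ : ∀ c → ρ⁻¹ (ρ c) ≡ c
    ρ⁻¹∘ρ c with oldVertex c
    ... | isY refl = cong ρ⁻¹ ρ-Y
    ... | oth b1 = cong ρ⁻¹ (ρ-old b1)

    ρ-inj : ∀ {a b} → ρ a ≡ ρ b → a ≡ b
    ρ-inj {a} {b} e = trans (sym (ρ⁻¹∘ρ a)) (trans (cong ρ⁻¹ e) (ρ⁻¹∘ρ b))

    arc′ : Fin M → Fin M → Bool
    arc′ p0 p0 = false
    arc′ p0 q1 = true
    arc′ p0 (ss c) = c == Y
    arc′ q1 _ = false
    arc′ (ss u) p0 = u == PY
    arc′ (ss u) q1 = false
    arc′ (ss u) (ss c) = arc u c ∧ not (c == Y)

    parents′ : Fin M → List (Fin M)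
    parents′ p0 = f PY ∷ []
    parents′ q1 = p0 ∷ []
    parents′ (ss c) = if c == Y then p0 ∷ [] else map f (parents c)

    children′ : Fin M → List (Fin M)
    children′ p0 = q1 ∷ f Y ∷ []
    children′ q1 = []
    children′ (ss u) = map ρ (children u)

    parents′-Y : parents′ (ss Y) ≡ p0 ∷ []
    parents′-Y rewrite ==-refl Y = refl
    parents′-old : ∀ {c} → c ≢ Y → parents′ (ss c) ≡ map f (parents c)
    parents′-old a rewrite ≢⇒== a = refl

    arc′-old : ∀ {u c} → c ≢ Y → arc′ (ss u) (ss c) ≡ arc u c
    arc′-old {u} {c} a rewrite ≢⇒== a with arc u c
    ... | true = refl
    ... | false = refl

    arc′-old⁻ : ∀ {u c} → arc′ (ss u) (ss c) ≡ true → arc u c ≡ true × c ≢ Y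
    arc′-old⁻ {u} {c} e = ∧-true⁻ˡ e , ==⇒≢ (not-true⁻ (∧-true⁻ʳ {a = arc u c} e))

    arc⇒parent′ : ∀ u v → arc′ u v ≡ true → u ∈ parents′ v
    arc⇒parent′ p0 q1 _ = here refl
    arc⇒parent′ p0 (ss c) e with ==⇒≡ {a = c} {b = Y} e
    ... | refl = subst (p0 ∈_) (sym parents′-Y) (here refl)
    arc⇒parent′ (ss u) p0 e with ==⇒≡ {a = u} {b = PY} e
    ... | refl = here refl
    arc⇒parent′ (ss u) (ss c) e with arc′-old⁻ {u} {c} e
    ... | a , b1 = subst (f u ∈_) (sym (parents′-old b1)) (∈-map⁺ f (arc⇒parent u c a))

    parent⇒arc′ : ∀ u v → u ∈ parents′ v → arc′ u v ≡ true
    parent⇒arc′ u p0 (here refl) = ==-refl PY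
    parent⇒arc′ u q1 (here refl) = refl
    parent⇒arc′ u (ss c) mm with oldVertex c
    ... | isY refl with subst (u ∈_) parents′-Y mm
    ... | here refl = ==-refl Y
    parent⇒arc′ u (ss c) mm | oth b1 with ∈-map⁻ f (subst (u ∈_) (parents′-old b1) mm)
    ... | u0 , m0 , refl = trans (arc′-old b1) (parent⇒arc u0 c m0)

    arc⇒child′ : ∀ u v → arc′ u v ≡ true → v ∈ children′ u
    arc⇒child′ p0 q1 _ = here refl
    arc⇒child′ p0 (ss c) e with ==⇒≡ {a = c} {b = Y} e
    ... | refl = there (here refl)
    arc⇒child′ (ss u) p0 e with ==⇒≡ {a = u} {b = PY} e
    ... | refl = subst (_∈ map ρ (children PY)) ρ-Y (∈-map⁺ ρ (arc⇒child PY Y (parentOf-arc F y1 y∈)))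
    arc⇒child′ (ss u) (ss c) e with arc′-old⁻ {u} {c} e
    ... | a , b1 = subst (_∈ map ρ (children u)) (ρ-old b1) (∈-map⁺ ρ (arc⇒child u c a))

    child⇒arc′ : ∀ u v → v ∈ children′ u → arc′ u v ≡ true
    child⇒arc′ p0 v (here refl) = refl
    child⇒arc′ p0 v (there (here refl)) = ==-refl Y
    child⇒arc′ (ss u) v mm with ∈-map⁻ ρ mm
    ... | c , mc , refl with oldVertex c
    ... | isY refl rewrite ρ-Y | arc-to-leaf F y∈ (child⇒arc u Y mc) = ==-refl PY
    ... | oth b1 rewrite ρ-old b1 = trans (arc′-old b1) (child⇒arc u c mc)

    parents-unique′ : ∀ v → Unique (parents′ v)
    parents-unique′ p0 = Unique-[-] _
    parents-unique′ q1 = Unique-[-] _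
    parents-unique′ (ss c) with oldVertex c
    ... | isY refl rewrite parents′-Y = Unique-[-] _
    ... | oth b1 rewrite parents′-old b1 = map⁺ f-injective (parents-unique c)

    children-unique′ : ∀ v → Unique (children′ v)
    children-unique′ p0 = Unique-∷⁺ (λ { (here ()) ; (there ()) }) (Unique-[-] _)
    children-unique′ q1 = []
    children-unique′ (ss u) = map⁺ ρ-inj (children-unique u)

    leafOf′ : Fin n → Fin M
    leafOf′ z = if z == x then q1 else f (leafOf z)

    leafOf′-x : leafOf′ x ≡ q1
    leafOf′-x rewrite ==-refl x = refl
    leafOf′-old : ∀ {z} → z ≢ x → leafOf′ z ≡ f (leafOf z)
    leafOf′-old a rewrite ≢⇒== a = refl

    parentOf′ : Fin n → Fin M
    parentOf′ z = if z == x then p0 else (if z == y1 then p0 else f (parentOf z))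

    parentOf′-x : parentOf′ x ≡ p0
    parentOf′-x rewrite ==-refl x = refl
    parentOf′-y : parentOf′ y1 ≡ p0
    parentOf′-y rewrite ≢⇒== (λ e → x≢y (sym e)) | ==-refl y1 = refl
    parentOf′-old : ∀ {z} → z ≢ x → z ≢ y1 → parentOf′ z ≡ f (parentOf z)
    parentOf′-old a b rewrite ≢⇒== a | ≢⇒== b = refl

    occurs⇒≢x : ∀ {z} → Occurs ps z → z ≢ x
    occurs⇒≢x pz refl = x∉ pz

    data LeafCase (z : Fin n) : Set where
      zX : z ≡ x → LeafCase z
      zY : z ≡ y1 → LeafCase z
      zO : z ≢ x → z ≢ y1 → LeafCase z

    leafCase : ∀ z → LeafCase z
    leafCase z with z Fin.≟ x | z Fin.≟ y1
    ... | yes e | _ = zX e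
    ... | no _ | yes e = zY e
    ... | no a | no b = zO a b

    lfY : ∀ {z} → Occurs ps z → z ≢ y1 → leafOf z ≢ Y
    lfY pz ne e = ne (leafOf-injective _ y1 pz y∈ e)

    leaf-parents′ : ∀ z → Occurs ps′ z → parents′ (leafOf′ z) ≡ parentOf′ z ∷ []
    leaf-parents′ z pz with leafCase z
    ... | zX refl rewrite leafOf′-x | parentOf′-x = refl
    ... | zY refl rewrite leafOf′-old y≢x | parents′-Y | parentOf′-y = refl
    leaf-parents′ z (here e) | zO a b = ⊥-elim (a e)
    leaf-parents′ z (there pz) | zO a b rewrite leafOf′-old a | parents′-old (lfY pz b) | leaf-parents z pz | parentOf′-old a b = refl

    leaf-children′ : ∀ z → Occurs ps′ z → children′ (leafOf′ z) ≡ []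
    leaf-children′ z (here refl) rewrite leafOf′-x = refl
    leaf-children′ z (there pz) rewrite leafOf′-old (occurs⇒≢x pz) | leaf-children z pz = refl

    leafOf-injective′ : ∀ z w → Occurs ps′ z → Occurs ps′ w → leafOf′ z ≡ leafOf′ w → z ≡ w
    leafOf-injective′ z w (here refl) (here refl) e = refl
    leafOf-injective′ z w (here refl) (there pw) e rewrite leafOf′-x | leafOf′-old (occurs⇒≢x pw) = case e of λ ()
    leafOf-injective′ z w (there pz) (here refl) e rewrite leafOf′-x | leafOf′-old (occurs⇒≢x pz) = case e of λ ()
    leafOf-injective′ z w (there pz) (there pw) e rewrite leafOf′-old (occurs⇒≢x pz) | leafOf′-old (occurs⇒≢x pw) = leafOf-injective z w pz pw (f-injective e)

    leaf-labelled′ : ∀ v → children′ v ≡ [] → ∃ λ z → Occurs ps′ z × leafOf′ z ≡ v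
    leaf-labelled′ p0 ()
    leaf-labelled′ q1 _ = x , here refl , leafOf′-x
    leaf-labelled′ (ss c) e with leaf-labelled c (map≡[]⇒[] (children c) e)
    ... | z , pz , q = z , there pz , trans (leafOf′-old (occurs⇒≢x pz)) (cong f q)

    length-parents′ : ∀ c → length (parents′ (ss c)) ≡ length (parents c)
    length-parents′ c with oldVertex c
    ... | isY refl rewrite parents′-Y | leaf-parents y1 y∈ = refl
    ... | oth b1 rewrite parents′-old b1 = length-map f (parents c)

    length-children′ : ∀ c → length (children′ (ss c)) ≡ length (children c)
    length-children′ c = length-map ρ (children c)

    root-parents′ : parents′ (ss root) ≡ []
    root-parents′ rewrite parents′-old (root≢leafOf F y∈) | root-parents = refl

    root-children′ : length (children′ (ss root)) ≡ 2
    root-children′ = trans (length-children′ root) root-children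

    vertex-kind′ : ∀ v → v ≢ ss root →
          (length (children′ v) ≡ 0 × length (parents′ v) ≡ 1)
        ⊎ (length (parents′ v) ≡ 1 × length (children′ v) ≡ 2)
        ⊎ (length (children′ v) ≡ 1 × length (parents′ v) ≡ 2)
    vertex-kind′ p0 _ = inj₂ (inj₁ (refl , refl))
    vertex-kind′ q1 _ = inj₁ (refl , refl)
    vertex-kind′ (ss c) ne rewrite length-parents′ c | length-children′ c = vertex-kind c (λ e → ne (cong f e))

    tree-child′ : ∀ v → length (parents′ v) ≡ 1 → length (children′ v) ≡ 2 → ∃ λ w → w ∈ children′ v ×
        TreeChildOf parents′ children′ leafOf′ ps′ w
    tree-child′ p0 _ _ = tree-child-p0 y-occurs
      where
      tree-child-p0 : (y ≡ x ⊎ y ≡ y1) → ∃ λ w → w ∈ children′ p0 ×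
        TreeChildOf parents′ children′ leafOf′ ps′ w
      tree-child-p0 (inj₁ e) = q1 , here refl , inj₂ (x , here (sym e) , here refl , leafOf′-x)
      tree-child-p0 (inj₂ e) = f Y , there (here refl) , inj₂ (y1 , here (sym e) , there y∈ , leafOf′-old y≢x)
    tree-child′ q1 _ ()
    tree-child′ (ss c) a b with tree-child c (trans (sym (length-parents′ c)) a) (trans (sym (length-children′ c)) b)
    ... | w , wm , tree-child-w with oldVertex w
    ... | isY refl = p0 , subst (_∈ map ρ (children c)) ρ-Y (∈-map⁺ ρ wm) , inj₁ (refl , refl)
    ... | oth b1 = f w , subst (_∈ map ρ (children c)) (ρ-old b1) (∈-map⁺ ρ wm) , tree-child-old tree-child-w
      where
      tree-child-old : TreeChildOf parents children leafOf ps w → TreeChildOf parents′ children′ leafOf′ ps′ (f w)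
      tree-child-old (inj₁ (i1 , o2)) = inj₁ (trans (length-parents′ w) i1 , trans (length-children′ w) o2)
      tree-child-old (inj₂ (z , zy , zp , e)) = inj₂ (z , there zy , there zp , trans (leafOf′-old (occurs⇒≢x zp)) (cong f e))

    time′ : Fin M → ℕ
    time′ p0 = runs xt ps′
    time′ q1 = top
    time′ (ss c) = time c

    runs<top : runs xt ps′ < top
    runs<top = ≤-<-trans (runs≤length xt ps′) ps<top

    x≢headX : x ≢ headX xt ps
    x≢headX e with xsOf-head xt ps
    ... | L , eq = x∉ (subst (x ∈_) (sym eq) (here e))

    runs-suc : runs xt ps′ ≡ suc (runs xt ps)
    runs-suc = runs-new xt x y ps x≢headX

    children′-old≢[] : ∀ c → children′ (ss c) ≢ [] → children c ≢ []
    children′-old≢[] c ne e rewrite e = ne refl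

    time-leaf′ : ∀ z → Occurs ps′ z → time′ (leafOf′ z) ≡ top
    time-leaf′ z (here refl) rewrite leafOf′-x = refl
    time-leaf′ z (there pz) rewrite leafOf′-old (occurs⇒≢x pz) = time-leaf z pz

    time-internal′ : ∀ v → children′ v ≢ [] → time′ v ≤ runs xt ps′
    time-internal′ p0 _ = ≤-refl
    time-internal′ q1 ne = ⊥-elim (ne refl)
    time-internal′ (ss c) ne = ≤-trans (time-internal c (children′-old≢[] c ne)) (runs-mono xt x y ps)

    time-tree-arc′ : ∀ u v → arc′ u v ≡ true → length (parents′ v) ≤ 1 → time′ u < time′ v
    time-tree-arc′ p0 q1 _ le = runs<top
    time-tree-arc′ p0 (ss c) e le with ==⇒≡ {a = c} {b = Y} e
    ... | refl rewrite time-leaf y1 y∈ = runs<top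
    time-tree-arc′ (ss u) p0 e le with ==⇒≡ {a = u} {b = PY} e
    ... | refl rewrite runs-suc = s≤s (time-parent≤runs F y1 y∈)
    time-tree-arc′ (ss u) (ss c) e le with arc′-old⁻ {u} {c} e
    ... | a , b1 = time-tree-arc u c a (subst (_≤ 1) (length-parents′ c) le)

    time-hybrid-arc′ : ∀ u v → arc′ u v ≡ true → 2 ≤ length (parents′ v) → time′ v ≤ time′ u
    time-hybrid-arc′ u p0 e (s≤s ())
    time-hybrid-arc′ u q1 e (s≤s ())
    time-hybrid-arc′ p0 (ss c) e le with ==⇒≡ {a = c} {b = Y} e
    ... | refl rewrite length-parents′ Y | leaf-parents y1 y∈ = ⊥-elim (n≮n 1 le)
    time-hybrid-arc′ (ss u) (ss c) e le with arc′-old⁻ {u} {c} e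
    ... | a , b1 = time-hybrid-arc u c a (subst (2 ≤_) (length-parents′ c) le)

    time-hybrid-attained′ : ∀ v → 2 ≤ length (parents′ v) → ∃ λ u → arc′ u v ≡ true × time′ u ≡ time′ v
    time-hybrid-attained′ p0 (s≤s ())
    time-hybrid-attained′ q1 (s≤s ())
    time-hybrid-attained′ (ss c) le with oldVertex c
    ... | isY refl rewrite length-parents′ Y | leaf-parents y1 y∈ = ⊥-elim (n≮n 1 le)
    ... | oth b1 with time-hybrid-attained c (subst (2 ≤_) (length-parents′ c) le)
    ... | u0 , e , q = ss u0 , trans (arc′-old b1) e , q

    parent-at-runs′ : ∀ z → Occurs ps′ z → time′ (parentOf′ z) ≡ runs xt ps′ →
        z ≡ x ⊎ inLeadingRun x z ps′ ≡ true ⊎ x ∈ ys ps′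
    parent-at-runs′ z pz e with leafCase z
    ... | zX refl = inj₁ refl
    parent-at-runs′ z pz e | zY refl = parent-at-runs-y1 y-occurs
      where
      parent-at-runs-y1 : (y ≡ x ⊎ y ≡ y1) → y1 ≡ x ⊎ inLeadingRun x y1 ps′ ≡ true ⊎ x ∈ ys ps′
      parent-at-runs-y1 (inj₁ e2) = inj₂ (inj₂ (here (sym e2)))
      parent-at-runs-y1 (inj₂ e2) = inj₂ (inj₁ (∧-true⁺ (==-refl x) (∨-true⁺ˡ (≡⇒== e2))))
    parent-at-runs′ z (here e0) e | zO a b = ⊥-elim (a e0)
    parent-at-runs′ z (there pz) e | zO a b rewrite parentOf′-old a b = parent-at-runs-step F x∉ys z pz e

    head-parent-at-runs′ : ∀ z L → xsOf xt ps′ ≡ z ∷ L → nonTemporal z L ≡ false → (∃ λ w → w ∈ L × w ≢ z) →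
        time′ (parentOf′ z) ≡ runs xt ps′
    head-parent-at-runs′ z L eq nt ex with ∷-injective eq
    ... | refl , refl rewrite parentOf′-x = refl

    rank′ : Fin M → ℕ
    rank′ p0 = suc (rank PY)
    rank′ q1 = 0
    rank′ (ss c) = rank c

    rank-arc′ : ∀ u v → arc′ u v ≡ true → children′ v ≢ [] → rank′ u < rank′ v
    rank-arc′ p0 q1 _ ne = ⊥-elim (ne refl)
    rank-arc′ p0 (ss c) e ne with ==⇒≡ {a = c} {b = Y} e
    ... | refl = ⊥-elim (children′-old≢[] Y ne (leaf-children y1 y∈))
    rank-arc′ (ss u) p0 e ne with ==⇒≡ {a = u} {b = PY} e
    ... | refl = ≤-refl
    rank-arc′ (ss u) (ss c) e ne with arc′-old⁻ {u} {c} e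
    ... | a , _ = rank-arc u c a (children′-old≢[] c ne)

    hybrids-sum′ : sumFin (λ v → length (parents′ v) ∸ 1) ≡ hybrids
    hybrids-sum′ = trans (sumFin-cong (λ c → cong (_∸ 1) (length-parents′ c))) hybrids-sum

    elem-x≡false : elem x (xsOf xt ps) ≡ false
    elem-x≡false with elem x (xsOf xt ps) in eq
    ... | true = ⊥-elim (x∉ (elem⇒∈ _ eq))
    ... | false = refl

    hybrids-bound′ : hybrids + length (distinctXs xt ps′) ≤ suc (length ps′)
    hybrids-bound′ rewrite elem-x≡false | +-suc hybrids (length (distinctXs xt ps)) = s≤s hybrids-bound

    f×f : Fin m × Fin m → Fin M × Fin M
    f×f (a , b) = f a , f b

    lateArcs′ : List (Fin M × Fin M)
    lateArcs′ = map f×f lateArcs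

    lateArcs-bound′ : length lateArcs′ ≤ dSuffix xt ps′
    lateArcs-bound′ = ≤-trans (subst (_≤ dSuffix xt ps) (sym (length-map f×f lateArcs)) lateArcs-bound) (m≤n+m _ _)

    lateArcs-complete′ : ∀ u v → arc′ u v ≡ true → 2 ≤ length (parents′ v) → time′ u ≢ time′ v → (u , v) ∈ lateArcs′
    lateArcs-complete′ u p0 e (s≤s ())
    lateArcs-complete′ u q1 e (s≤s ())
    lateArcs-complete′ p0 (ss c) e le ne with ==⇒≡ {a = c} {b = Y} e
    ... | refl rewrite length-parents′ Y | leaf-parents y1 y∈ = ⊥-elim (n≮n 1 le)
    lateArcs-complete′ (ss u) (ss c) e le ne with arc′-old⁻ {u} {c} e
    ... | a , _ = ∈-map⁺ f×f (lateArcs-complete u c a (subst (2 ≤_) (length-parents′ c) le) ne)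

    arc-inner : ∀ u c → arc u c ≡ true → HasChild arc c → arc′ (f u) (f c) ≡ true
    arc-inner u c e (w , ew) = trans (arc′-old b1) e
      where
      b1 : c ≢ Y
      b1 refl = leaf-no-arc F y∈ ew

    arc′-parentOf : ∀ z → Occurs ps z → z ≢ y1 → arc′ (f (parentOf z)) (f (leafOf z)) ≡ true
    arc′-parentOf z pz a = trans (arc′-old (lfY pz a)) (parentOf-arc F z pz)

    pathVsN : Fin n → List (Fin M)
    pathVsN z = if z == y1 then p0 ∷ [] else []
    pathVsN-y : pathVsN y1 ≡ p0 ∷ []
    pathVsN-y rewrite ==-refl y1 = refl
    pathVsN-old : ∀ {z} → z ≢ y1 → pathVsN z ≡ []
    pathVsN-old a rewrite ≢⇒== a = refl

    graftRootN : Fin n → Fin M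
    graftRootN z = leafOf′ z
    graftVsN : Fin n → List (Fin M)
    graftVsN z = leafOf′ z ∷ []

    data Owner (w : Fin M) (z : Fin n) : Set where
      oY : w ≡ p0 → z ≡ y1 → Owner w z
      oF : w ≡ f (leafOf z) → Owner w z

    ownerN : ∀ {w} z → Occurs ps z → w ∈ pathVsN z ++ graftVsN z → Owner w z
    ownerN {w} z pz mm rewrite leafOf′-old (occurs⇒≢x pz) with z Fin.≟ y1
    ... | yes refl with mm
    ... | here e = oY e refl
    ... | there (here e) = oF e
    ownerN {w} z pz mm | no a with mm
    ... | here e = oF e

    Owner-unique : ∀ {w z z2} → Occurs ps z → Occurs ps z2 → Owner w z → Owner w z2 → z ≡ z2
    Owner-unique pz pz2 (oY _ a) (oY _ b) = trans a (sym b)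
    Owner-unique pz pz2 (oY refl _) (oF ())
    Owner-unique pz pz2 (oF refl) (oY () _)
    Owner-unique {z = z} {z2} pz pz2 (oF a) (oF b) = leafOf-injective z z2 pz pz2 (f-injective (trans (sym a) b))

    Owner-inner : ∀ {c z} → Occurs ps z → HasChild arc c → Owner (f c) z → ⊥
    Owner-inner pz ho (oY () _)
    Owner-inner pz (w , ew) (oF e) with f-injective e
    ... | refl = leaf-no-arc F pz ew

    graft-uniqueN : ∀ z → Occurs ps z → Unique (pathVsN z ++ graftVsN z)
    graft-uniqueN z pz rewrite leafOf′-old (occurs⇒≢x pz) with z Fin.≟ y1
    ... | yes refl = Unique-∷⁺ (λ { (here ()) }) (Unique-[-] _)
    ... | no a = Unique-[-] _

    path-to-graftN : ∀ z → Occurs ps z → ∀ u → arc u (leafOf z) ≡ true → Path arc′ (f u) (graftRootN z) (pathVsN z)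
    path-to-graftN z pz u e with arc-to-leaf F pz e
    ... | refl rewrite leafOf′-old (occurs⇒≢x pz) with z Fin.≟ y1
    ... | yes refl = cons (==-refl PY) (edge (==-refl Y))
    ... | no a = edge (arc′-parentOf z pz a)

    module Unchanged (T : BTree n) (e : applyPairs ps T ≡ leaf xt) where
      InT : Fin n → Set
      InT z = z ∈ leaves T
      occurs : ∀ {z} → InT z → Occurs ps z
      occurs mm = leaves⊆xsOf xt ps T e mm
      path-to-graft : ∀ z → InT z → ∀ u → arc u (leafOf z) ≡ true → Path arc′ (f u) (graftRootN z) (pathVsN z)
      path-to-graft z oz = path-to-graftN z (occurs oz)
      embeds-graft : ∀ z → InT z → Embeds arc′ leafOf′ (leaf z) (graftRootN z) (graftVsN z)
      embeds-graft z _ = leafE z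
      graft-unique : ∀ z → InT z → Unique (pathVsN z ++ graftVsN z)
      graft-unique z oz = graft-uniqueN z (occurs oz)
      graft-disjoint : ∀ z z2 → InT z → InT z2 → z ≢ z2 → Disjoint (pathVsN z ++ graftVsN z) (pathVsN z2 ++ graftVsN z2)
      graft-disjoint z z2 oz oz2 ne (m1 , m2) = ne (Owner-unique (occurs oz) (occurs oz2) (ownerN z (occurs oz) m1) (ownerN z2 (occurs oz2) m2))
      inner∉graft : ∀ c z → HasChild arc c → InT z → f c ∉ pathVsN z ++ graftVsN z
      inner∉graft c z ho oz mm = Owner-inner (occurs oz) ho (ownerN z (occurs oz) mm)
      module Transported = Transport arc leafOf arc′ leafOf′ f f-injective leaf graftRootN graftVsN pathVsN InT arc-inner path-to-graft embeds-graft graft-unique graft-disjoint inner∉graft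

    displays-unchanged : ∀ T → Unique (leaves T) → applyPairs ps T ≡ leaf xt → DisplaysIn arc′ leafOf′ T
    displays-unchanged T uT e with displays T uT e
    ... | v , vs , emb , uvs with Unchanged.Transported.transport T e T (λ mm → mm) uT emb uvs
    ... | vs2 , emb2 , u2 , _ = Unchanged.Transported.graftedRoot T e T v , vs2 , subst (λ T0 → Embeds arc′ leafOf′ T0 (Unchanged.Transported.graftedRoot T e T v) vs2) (graft-leaf T) emb2 , u2

    cherryVs : ∀ {g} → IsCherryTree x y1 g → List (Fin M)
    cherryVs (inj₁ _) = p0 ∷ leafOf′ x ∷ leafOf′ y1 ∷ []
    cherryVs (inj₂ _) = p0 ∷ leafOf′ y1 ∷ leafOf′ x ∷ []

    aX : arc′ p0 (leafOf′ x) ≡ true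
    aX rewrite leafOf′-x = refl
    aY : arc′ p0 (leafOf′ y1) ≡ true
    aY rewrite leafOf′-old y≢x = ==-refl Y

    cherry-embeds : ∀ {g} (cherryTree : IsCherryTree x y1 g) → Embeds arc′ leafOf′ g p0 (cherryVs cherryTree)
    cherry-embeds (inj₁ refl) = nodeE (leafE x) (leafE y1) (edge aX) (edge aY)
    cherry-embeds (inj₂ refl) = nodeE (leafE y1) (leafE x) (edge aY) (edge aX)

    data CherryVertex (w : Fin M) : Set where
      g0 : w ≡ p0 → CherryVertex w
      g1 : w ≡ q1 → CherryVertex w
      gY : w ≡ f Y → CherryVertex w

    cherryVs-vertex : ∀ {g w} (cherryTree : IsCherryTree x y1 g) → w ∈ cherryVs cherryTree → CherryVertex w
    cherryVs-vertex (inj₁ _) (here e) = g0 e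
    cherryVs-vertex (inj₁ _) (there (here e)) = g1 (trans e leafOf′-x)
    cherryVs-vertex (inj₁ _) (there (there (here e))) = gY (trans e (leafOf′-old y≢x))
    cherryVs-vertex (inj₂ _) (here e) = g0 e
    cherryVs-vertex (inj₂ _) (there (here e)) = gY (trans e (leafOf′-old y≢x))
    cherryVs-vertex (inj₂ _) (there (there (here e))) = g1 (trans e leafOf′-x)

    cherryVs-unique : ∀ {g} (cherryTree : IsCherryTree x y1 g) → Unique (cherryVs cherryTree)
    cherryVs-unique (inj₁ _) rewrite leafOf′-x | leafOf′-old y≢x = Unique-∷⁺ (λ { (here ()) ; (there (here ())) ; (there (there ())) })
      (Unique-∷⁺ (λ { (here ()) ; (there ()) }) (Unique-[-] _))
    cherryVs-unique (inj₂ _) rewrite leafOf′-x | leafOf′-old y≢x = Unique-∷⁺ (λ { (here ()) ; (there (here ())) ; (there (there ())) })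
      (Unique-∷⁺ (λ { (here ()) ; (there ()) }) (Unique-[-] _))

    module Grafted {g : BTree n} (cherryTree : IsCherryTree x y1 g) (T₂ : BTree n) (e : applyPairs ps T₂ ≡ leaf xt) where
      InT : Fin n → Set
      InT z = z ∈ leaves T₂
      occurs : ∀ {z} → InT z → Occurs ps z
      occurs mm = leaves⊆xsOf xt ps T₂ e mm

      graftRootC : Fin n → Fin M
      graftRootC z = if z == y1 then p0 else f (leafOf z)
      graftVsC : Fin n → List (Fin M)
      graftVsC z = if z == y1 then cherryVs cherryTree else f (leafOf z) ∷ []
      pathVsC : Fin n → List (Fin M)
      pathVsC z = []

      path-to-graft : ∀ z → InT z → ∀ u → arc u (leafOf z) ≡ true → Path arc′ (f u) (graftRootC z) (pathVsC z)
      path-to-graft z oz u e1 with arc-to-leaf F (occurs oz) e1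
      ... | refl with z Fin.≟ y1
      ... | yes refl = edge (==-refl PY)
      ... | no ne = edge (arc′-parentOf z (occurs oz) ne)

      embeds-graft : ∀ z → InT z → Embeds arc′ leafOf′ (graftAt y1 g z) (graftRootC z) (graftVsC z)
      embeds-graft z oz with z Fin.≟ y1
      ... | yes refl = cherry-embeds cherryTree
      ... | no ne = subst (λ v → Embeds arc′ leafOf′ (leaf z) v (v ∷ [])) (leafOf′-old (occurs⇒≢x (occurs oz))) (leafE z)

      graft-unique : ∀ z → InT z → Unique (pathVsC z ++ graftVsC z)
      graft-unique z oz with z Fin.≟ y1
      ... | yes refl = cherryVs-unique cherryTree
      ... | no ne = Unique-[-] _

      data OwnerC (w : Fin M) (z : Fin n) : Set where
        oy : z ≡ y1 → w ∈ cherryVs cherryTree → OwnerC w z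
        oo : z ≢ y1 → w ≡ f (leafOf z) → OwnerC w z

      ownerC : ∀ {w} z → w ∈ graftVsC z → OwnerC w z
      ownerC {w} z mm with z Fin.≟ y1
      ... | yes refl = oy refl mm
      ... | no ne with mm
      ... | here e2 = oo ne e2

      leaf∉cherryVs : ∀ {z} → InT z → z ≢ y1 → f (leafOf z) ∈ cherryVs cherryTree → ⊥
      leaf∉cherryVs {z} oz ne mm with cherryVs-vertex cherryTree mm
      ... | gY e2 = ne (leafOf-injective z y1 (occurs oz) y∈ (f-injective e2))

      OwnerC-unique : ∀ {w z z2} → InT z → InT z2 → OwnerC w z → OwnerC w z2 → z ≡ z2
      OwnerC-unique oz oz2 (oy a _) (oy b _) = trans a (sym b)
      OwnerC-unique oz oz2 (oy a m1) (oo b refl) = ⊥-elim (leaf∉cherryVs oz2 b m1)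
      OwnerC-unique oz oz2 (oo a refl) (oy b m2) = ⊥-elim (leaf∉cherryVs oz a m2)
      OwnerC-unique {z = z} {z2} oz oz2 (oo _ a) (oo _ b) = leafOf-injective z z2 (occurs oz) (occurs oz2) (f-injective (trans (sym a) b))

      graft-disjoint : ∀ z z2 → InT z → InT z2 → z ≢ z2 → Disjoint (pathVsC z ++ graftVsC z) (pathVsC z2 ++ graftVsC z2)
      graft-disjoint z z2 oz oz2 ne (m1 , m2) = ne (OwnerC-unique oz oz2 (ownerC z m1) (ownerC z2 m2))

      inner∉graft : ∀ c z → HasChild arc c → InT z → f c ∉ pathVsC z ++ graftVsC z
      inner∉graft c z (w , ew) oz mm with ownerC z mm
      ... | oo _ e2 with f-injective e2
      ... | refl = leaf-no-arc F (occurs oz) ew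
      inner∉graft c z (w , ew) oz mm | oy _ m2 with cherryVs-vertex cherryTree m2
      ... | gY e2 with f-injective e2
      ... | refl = leaf-no-arc F y∈ ew

      module Transported = Transport arc leafOf arc′ leafOf′ f f-injective (graftAt y1 g) graftRootC graftVsC pathVsC InT arc-inner path-to-graft embeds-graft graft-unique graft-disjoint inner∉graft

    displays-graft : ∀ T T₂ {g} (cherryTree : IsCherryTree x y1 g) → T ≡ graft (graftAt y1 g) T₂ → Unique (leaves T₂) →
      applyPairs ps T₂ ≡ leaf xt → DisplaysIn arc′ leafOf′ T
    displays-graft T T₂ cherryTree eqT u2 e2 with displays T₂ u2 e2
    ... | v , vs , emb , uvs with Grafted.Transported.transport cherryTree T₂ e2 T₂ (λ mm → mm) u2 emb uvs
    ... | vs2 , emb2 , uu , _ = Grafted.Transported.graftedRoot cherryTree T₂ e2 T₂ v , vs2 ,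
          subst (λ T0 → Embeds arc′ leafOf′ T0 (Grafted.Transported.graftedRoot cherryTree T₂ e2 T₂ v) vs2) (sym eqT) emb2 , uu

    displays-cherry : ∀ T → Unique (leaves T) → applyPairs ps′ T ≡ leaf xt → isCherry x y T ≡ true → DisplaysIn arc′ leafOf′ T
    displays-cherry T uT e ch = go y-occurs
      where
      go : (y ≡ x ⊎ y ≡ y1) → DisplaysIn arc′ leafOf′ T
      go (inj₁ e1) = ⊥-elim (Cherry-≢ (isCherry⇒Cherry T ch) uT (sym e1))
      go (inj₂ e1) = from-graft (Cherry⇒graft (isCherry⇒Cherry T (subst (λ w → isCherry x w T ≡ true) e1 ch)) uT)
        where
        from-graft : (∃ λ T₂ → ∃ λ g → deleteLeaf x T ≡ just T₂ × T ≡ graft (graftAt y1 g) T₂ × IsCherryTree x y1 g) → DisplaysIn arc′ leafOf′ T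
        from-graft (T₂ , g , d , eqT , cherryTree) = displays-graft T T₂ cherryTree eqT (deleteLeaf-Unique {x = x} {T = T} {T₂ = T₂} d uT)
          (trans (cong (applyPairs ps) (sym (pickStep-cherry x y T ch d))) e)

    displays′ : ∀ T → Unique (leaves T) → applyPairs ps′ T ≡ leaf xt → DisplaysIn arc′ leafOf′ T
    displays′ T uT e = go (isCherry x y T) refl
      where
      go : ∀ b → isCherry x y T ≡ b → DisplaysIn arc′ leafOf′ T
      go true ch = displays-cherry T uT e ch
      go false ch = displays-unchanged T uT (trans (cong (applyPairs ps) (sym (pickStep-¬cherry x y T ch))) e)

    result : Realisation ps′
    result = record
      { m = M ; arc = arc′ ; root = ss root ; parents = parents′ ; children = children′
      ; arc⇒parent = arc⇒parent′ ; parent⇒arc = parent⇒arc′ ; arc⇒child = arc⇒child′ ; child⇒arc = child⇒arc′ ; parents-unique = parents-unique′ ; children-unique = children-unique′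
      ; leafOf = leafOf′ ; parentOf = parentOf′
      ; leaf-parents = leaf-parents′ ; leaf-children = leaf-children′ ; leafOf-injective = leafOf-injective′
      ; leaf-labelled = leaf-labelled′ ; root-parents = root-parents′ ; root-children = root-children′ ; vertex-kind = vertex-kind′ ; tree-child = tree-child′
      ; time = time′ ; time-leaf = time-leaf′ ; time-internal = time-internal′ ; time-tree-arc = time-tree-arc′ ; time-hybrid-arc = time-hybrid-arc′ ; time-hybrid-attained = time-hybrid-attained′
      ; parent-at-runs = parent-at-runs′ ; head-parent-at-runs = head-parent-at-runs′ ; rank = rank′ ; rank-arc = rank-arc′
      ; hybrids = hybrids ; hybrids-sum = hybrids-sum′ ; hybrids-bound = hybrids-bound′
      ; lateArcs = lateArcs′ ; lateArcs-complete = lateArcs-complete′ ; lateArcs-bound = lateArcs-bound′ ; displays = displays′ }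

  addLeaf : ∀ {ps} (F : Realisation ps) x y y1 → x ∉ xsOf xt ps → y1 ∈ xsOf xt ps → (y ≡ x ⊎ y ≡ y1) →
    x ∉ ys ps → suc (length ps) < top → Realisation ((x , y) ∷ ps)
  addLeaf F x y y1 x∉ y∈ y-occurs x∉ys ps<top = Step.result F x y y1 x∉ y∈ y-occurs x∉ys ps<top

-- The first cherry

pattern r0 = Fin.zero
pattern lx = Fin.suc Fin.zero
pattern ly = Fin.suc (Fin.suc Fin.zero)

module Start {n : ℕ} (xt : Fin n) (top : ℕ) where
  open Realisations xt top

  OnlyXt⇒≡leaf : ∀ {ps} → OnlyXt ps → ∀ T → Unique (leaves T) → applyPairs ps T ≡ leaf xt → T ≡ leaf xt
  OnlyXt⇒≡leaf {ps} only T u e = ≡leaf T u (λ m → only (leaves⊆xsOf xt ps T e m))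

  -- Before the first pair (x , y) with a new x only x_t occurs: the network is a root with the
  -- two leaves x (at lx) and x_t (at ly).
  module Step {ps : Pairs} (only : OnlyXt ps) (x y : Fin n) (x∉ : x ∉ xsOf xt ps)
    (y-occurs : y ≡ x ⊎ y ≡ xt) (ps<top : suc (length ps) < top) where
    ps′ : Pairs
    ps′ = (x , y) ∷ ps

    xt≢x : xt ≢ x
    xt≢x e = x∉ (subst (_∈ xsOf xt ps) e (xt∈xsOf xt ps))

    arc : Fin 3 → Fin 3 → Bool
    arc r0 lx = true
    arc r0 ly = true
    arc _ _ = false

    parents : Fin 3 → List (Fin 3)
    parents r0 = []
    parents lx = r0 ∷ []
    parents ly = r0 ∷ []

    children : Fin 3 → List (Fin 3)
    children r0 = lx ∷ ly ∷ []
    children lx = []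
    children ly = []

    arc⇒parent : ∀ u v → arc u v ≡ true → u ∈ parents v
    arc⇒parent r0 lx _ = here refl
    arc⇒parent r0 ly _ = here refl
    parent⇒arc : ∀ u v → u ∈ parents v → arc u v ≡ true
    parent⇒arc u lx (here refl) = refl
    parent⇒arc u ly (here refl) = refl
    arc⇒child : ∀ u v → arc u v ≡ true → v ∈ children u
    arc⇒child r0 lx _ = here refl
    arc⇒child r0 ly _ = there (here refl)
    child⇒arc : ∀ u v → v ∈ children u → arc u v ≡ true
    child⇒arc r0 v (here refl) = refl
    child⇒arc r0 v (there (here refl)) = refl
    child⇒arc lx v ()
    child⇒arc ly v ()

    parents-unique : ∀ v → Unique (parents v)
    parents-unique r0 = []
    parents-unique lx = Unique-[-] _
    parents-unique ly = Unique-[-] _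
    children-unique : ∀ v → Unique (children v)
    children-unique r0 = Unique-∷⁺ (λ { (here ()) ; (there ()) }) (Unique-[-] _)
    children-unique lx = []
    children-unique ly = []

    leafOf : Fin n → Fin 3
    leafOf z = if z == x then lx else ly
    lf-x : leafOf x ≡ lx
    lf-x rewrite ==-refl x = refl
    lf-o : ∀ {z} → z ≢ x → leafOf z ≡ ly
    lf-o a rewrite ≢⇒== a = refl

    parentOf : Fin n → Fin 3
    parentOf z = r0

    occurs-old : ∀ {z} → Occurs ps′ z → z ≡ x ⊎ z ≡ xt
    occurs-old (here e) = inj₁ e
    occurs-old (there m) = inj₂ (only m)

    leafOf-cases : ∀ {z} → Occurs ps′ z → leafOf z ≡ lx ⊎ leafOf z ≡ ly
    leafOf-cases pz with occurs-old pz
    ... | inj₁ refl = inj₁ lf-x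
    ... | inj₂ refl = inj₂ (lf-o xt≢x)

    leaf-parents : ∀ z → Occurs ps′ z → parents (leafOf z) ≡ parentOf z ∷ []
    leaf-parents z pz with leafOf-cases pz
    ... | inj₁ e rewrite e = refl
    ... | inj₂ e rewrite e = refl

    leaf-children : ∀ z → Occurs ps′ z → children (leafOf z) ≡ []
    leaf-children z pz with leafOf-cases pz
    ... | inj₁ e rewrite e = refl
    ... | inj₂ e rewrite e = refl

    leafOf-injective : ∀ z w → Occurs ps′ z → Occurs ps′ w → leafOf z ≡ leafOf w → z ≡ w
    leafOf-injective z w pz pw e with occurs-old pz | occurs-old pw
    ... | inj₁ a | inj₁ b = trans a (sym b)
    ... | inj₂ a | inj₂ b = trans a (sym b)
    ... | inj₁ refl | inj₂ refl rewrite lf-x | lf-o xt≢x = case e of λ ()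
    ... | inj₂ refl | inj₁ refl rewrite lf-x | lf-o xt≢x = case e of λ ()

    leaf-labelled : ∀ v → children v ≡ [] → ∃ λ z → Occurs ps′ z × leafOf z ≡ v
    leaf-labelled r0 ()
    leaf-labelled lx _ = x , here refl , lf-x
    leaf-labelled ly _ = xt , there (xt∈xsOf xt ps) , lf-o xt≢x

    vertex-kind : ∀ v → v ≢ r0 →
          (length (children v) ≡ 0 × length (parents v) ≡ 1)
        ⊎ (length (parents v) ≡ 1 × length (children v) ≡ 2)
        ⊎ (length (children v) ≡ 1 × length (parents v) ≡ 2)
    vertex-kind r0 ne = ⊥-elim (ne refl)
    vertex-kind lx _ = inj₁ (refl , refl)
    vertex-kind ly _ = inj₁ (refl , refl)

    tree-child : ∀ v → length (parents v) ≡ 1 → length (children v) ≡ 2 → ∃ λ w → w ∈ children v ×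
        TreeChildOf parents children leafOf ps′ w
    tree-child r0 () _
    tree-child lx _ ()
    tree-child ly _ ()

    time : Fin 3 → ℕ
    time r0 = runs xt ps′
    time lx = top
    time ly = top

    runs<top : runs xt ps′ < top
    runs<top = ≤-<-trans (runs≤length xt ps′) ps<top

    time-leaf : ∀ z → Occurs ps′ z → time (leafOf z) ≡ top
    time-leaf z pz with leafOf-cases pz
    ... | inj₁ e rewrite e = refl
    ... | inj₂ e rewrite e = refl

    time-internal : ∀ v → children v ≢ [] → time v ≤ runs xt ps′
    time-internal r0 _ = ≤-refl
    time-internal lx ne = ⊥-elim (ne refl)
    time-internal ly ne = ⊥-elim (ne refl)

    time-tree-arc : ∀ u v → arc u v ≡ true → length (parents v) ≤ 1 → time u < time v
    time-tree-arc r0 lx _ _ = runs<top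
    time-tree-arc r0 ly _ _ = runs<top

    time-hybrid-arc : ∀ u v → arc u v ≡ true → 2 ≤ length (parents v) → time v ≤ time u
    time-hybrid-arc r0 lx _ (s≤s ())
    time-hybrid-arc r0 ly _ (s≤s ())

    time-hybrid-attained : ∀ v → 2 ≤ length (parents v) → ∃ λ u → arc u v ≡ true × time u ≡ time v
    time-hybrid-attained r0 ()
    time-hybrid-attained lx (s≤s ())
    time-hybrid-attained ly (s≤s ())

    parent-at-runs : ∀ z → Occurs ps′ z → time (parentOf z) ≡ runs xt ps′ →
        z ≡ x ⊎ inLeadingRun x z ps′ ≡ true ⊎ x ∈ ys ps′
    parent-at-runs z pz e with occurs-old pz
    ... | inj₁ a = inj₁ a
    ... | inj₂ refl = parent-at-runs-xt y-occurs
      where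
      parent-at-runs-xt : (y ≡ x ⊎ y ≡ xt) → xt ≡ x ⊎ inLeadingRun x xt ps′ ≡ true ⊎ x ∈ ys ps′
      parent-at-runs-xt (inj₁ e2) = inj₂ (inj₂ (here (sym e2)))
      parent-at-runs-xt (inj₂ e2) = inj₂ (inj₁ (∧-true⁺ (==-refl x) (∨-true⁺ˡ (≡⇒== e2))))

    head-parent-at-runs : ∀ z L → xsOf xt ps′ ≡ z ∷ L → nonTemporal z L ≡ false → (∃ λ w → w ∈ L × w ≢ z) →
        time (parentOf z) ≡ runs xt ps′
    head-parent-at-runs z L eq nt ex = refl

    rank : Fin 3 → ℕ
    rank r0 = 0
    rank _ = 1

    rank-arc : ∀ u v → arc u v ≡ true → children v ≢ [] → rank u < rank v
    rank-arc r0 lx _ ne = ⊥-elim (ne refl)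
    rank-arc r0 ly _ ne = ⊥-elim (ne refl)

    distinctXs≤1 : length (distinctXs xt ps) ≤ 1
    distinctXs≤1 = Unique-⊆⇒length≤ {ys = xt ∷ []} (distinctXs-Unique xt ps) (λ m → here (only (distinctXs⊆xsOf xt ps m)))

    elem-x≡false : elem x (xsOf xt ps) ≡ false
    elem-x≡false with elem x (xsOf xt ps) in eq
    ... | true = ⊥-elim (x∉ (elem⇒∈ _ eq))
    ... | false = refl

    hybrids-bound : 0 + length (distinctXs xt ps′) ≤ suc (length ps′)
    hybrids-bound rewrite elem-x≡false = s≤s (≤-trans distinctXs≤1 (s≤s z≤n))

    vertices-xy vertices-yx : List (Fin 3)
    vertices-xy = r0 ∷ lx ∷ ly ∷ []
    vertices-yx = r0 ∷ ly ∷ lx ∷ []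
    vertices-xy-unique : Unique vertices-xy
    vertices-xy-unique = Unique-∷⁺ (λ { (here ()) ; (there (here ())) ; (there (there ())) }) (Unique-∷⁺ (λ { (here ()) ; (there ()) }) (Unique-[-] ly))
    vertices-yx-unique : Unique vertices-yx
    vertices-yx-unique = Unique-∷⁺ (λ { (here ()) ; (there (here ())) ; (there (there ())) }) (Unique-∷⁺ (λ { (here ()) ; (there ()) }) (Unique-[-] lx))

    displays-xt : DisplaysIn arc leafOf (leaf xt)
    displays-xt = leafOf xt , leafOf xt ∷ [] , leafE xt , Unique-[-] _

    displays-cherryTree : ∀ {g} → IsCherryTree x xt g → DisplaysIn arc leafOf g
    displays-cherryTree (inj₁ refl) = r0 , _ , nodeE (leafE x) (leafE xt) (edge a1) (edge a2) , uu
      where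
      a1 : arc r0 (leafOf x) ≡ true
      a1 rewrite lf-x = refl
      a2 : arc r0 (leafOf xt) ≡ true
      a2 rewrite lf-o xt≢x = refl
      uu : Unique (r0 ∷ leafOf x ∷ leafOf xt ∷ [])
      uu rewrite lf-x | lf-o xt≢x = vertices-xy-unique
    displays-cherryTree (inj₂ refl) = r0 , _ , nodeE (leafE xt) (leafE x) (edge a2) (edge a1) , uu
      where
      a1 : arc r0 (leafOf x) ≡ true
      a1 rewrite lf-x = refl
      a2 : arc r0 (leafOf xt) ≡ true
      a2 rewrite lf-o xt≢x = refl
      uu : Unique (r0 ∷ leafOf xt ∷ leafOf x ∷ [])
      uu rewrite lf-x | lf-o xt≢x = vertices-yx-unique

    displays : ∀ T → Unique (leaves T) → applyPairs ps′ T ≡ leaf xt → DisplaysIn arc leafOf T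
    displays T uT e = go (isCherry x y T) refl
      where
      go : ∀ b → isCherry x y T ≡ b → DisplaysIn arc leafOf T
      go false ch = subst (DisplaysIn arc leafOf) (sym (OnlyXt⇒≡leaf only T uT
        (trans (cong (applyPairs ps) (sym (pickStep-¬cherry x y T ch))) e))) displays-xt
      go true ch = cherry-case y-occurs
        where
        cherry-case : (y ≡ x ⊎ y ≡ xt) → DisplaysIn arc leafOf T
        cherry-case (inj₁ e1) = ⊥-elim (Cherry-≢ (isCherry⇒Cherry T ch) uT (sym e1))
        cherry-case (inj₂ e1) = from-graft (Cherry⇒graft (isCherry⇒Cherry T (subst (λ w → isCherry x w T ≡ true) e1 ch)) uT)
          where
          from-graft : (∃ λ T₂ → ∃ λ g → deleteLeaf x T ≡ just T₂ × T ≡ graft (graftAt xt g) T₂ × IsCherryTree x xt g) → DisplaysIn arc leafOf T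
          from-graft (T₂ , g , d , eqT , cherryTree) = subst (DisplaysIn arc leafOf) (sym eqT2) (displays-cherryTree cherryTree)
            where
            T2eq : T₂ ≡ leaf xt
            T2eq = OnlyXt⇒≡leaf only T₂ (deleteLeaf-Unique {x = x} {T = T} {T₂ = T₂} d uT)
              (trans (cong (applyPairs ps) (sym (pickStep-cherry x y T ch d))) e)
            eqT2 : T ≡ g
            eqT2 = trans eqT (trans (cong (graft (graftAt xt g)) T2eq) graftAt-self)

    result : Realisation ps′
    result = record
      { m = 3 ; arc = arc ; root = r0 ; parents = parents ; children = children
      ; arc⇒parent = arc⇒parent ; parent⇒arc = parent⇒arc ; arc⇒child = arc⇒child ; child⇒arc = child⇒arc ; parents-unique = parents-unique ; children-unique = children-unique
      ; leafOf = leafOf ; parentOf = parentOf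
      ; leaf-parents = leaf-parents ; leaf-children = leaf-children ; leafOf-injective = leafOf-injective
      ; leaf-labelled = leaf-labelled ; root-parents = refl ; root-children = refl ; vertex-kind = vertex-kind ; tree-child = tree-child
      ; time = time ; time-leaf = time-leaf ; time-internal = time-internal ; time-tree-arc = time-tree-arc ; time-hybrid-arc = time-hybrid-arc ; time-hybrid-attained = time-hybrid-attained
      ; parent-at-runs = parent-at-runs ; head-parent-at-runs = head-parent-at-runs ; rank = rank ; rank-arc = rank-arc
      ; hybrids = 0 ; hybrids-sum = refl ; hybrids-bound = hybrids-bound
      ; lateArcs = [] ; lateArcs-complete = λ { r0 lx _ (s≤s ()) _ ; r0 ly _ (s≤s ()) _ } ; lateArcs-bound = z≤n ; displays = displays }

  start : ∀ {ps} → OnlyXt ps → ∀ x y → x ∉ xsOf xt ps → (y ≡ x ⊎ y ≡ xt) → suc (length ps) < top → Realisation ((x , y) ∷ ps)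
  start only x y x∉ y-occurs ps<top = Step.result only x y x∉ y-occurs ps<top

-- Non-temporal pairs

length-filterᵇ-∷ : ∀ {A : Set} (p : A → Bool) e es → length (filterᵇ p es) ≤ length (filterᵇ p (e ∷ es))
length-filterᵇ-∷ p e es with p e
... | true = n≤1+n _
... | false = ≤-refl

length-filterᵇ-∷-true : ∀ {A : Set} (p : A → Bool) e es → p e ≡ true →
  length (filterᵇ p (e ∷ es)) ≡ suc (length (filterᵇ p es))
length-filterᵇ-∷-true p e es pe rewrite pe = refl

module DSeqBound {n : ℕ} (pairs : List (Fin n × Fin n)) (xt : Fin n) where

  s : GenSeq n
  s = mkSeq pairs (xt ∷ [])

  W : List (Fin n)
  W = map proj₁ pairs ++ xt ∷ []

  indexed : List (ℕ × Fin n)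
  indexed = zip (upTo (seqLength s)) W

  At⇒indexed : ∀ {j a} → At W j a → (j , a) ∈ indexed
  At⇒indexed {j} {a} p = subst (λ N → (j , a) ∈ zip (applyUpTo id N) W) length-W (At-zip id W p)
    where
    length-W : length W ≡ seqLength s
    length-W = trans (length-++ (map proj₁ pairs)) (cong (_+ 1) (length-map proj₁ pairs))

  isNonTemporal-intro : ∀ i xi j aj k → i < j → j < k → At W j aj → aj ≢ xi → At W k xi →
    isNonTemporal s (i , xi) ≡ true
  isNonTemporal-intro i xi j aj k ij jk pj ne pk =
    any-true⁺ _ indexed (At⇒indexed pj) (any-true⁺ _ indexed (At⇒indexed pk)
      (∧-true⁺ (<⇒<ᵇ≡true ij) (∧-true⁺ (<⇒<ᵇ≡true jk) (∧-true⁺ (not-true⁺ (≢⇒== ne)) (==-refl xi)))))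

  -- pos k is the position in s of the k-th element of the suffix ps.
  dSuffix≤count : ∀ (pre ps : List (Fin n × Fin n)) (pos : ℕ → ℕ) → pairs ≡ pre ++ ps →
    (∀ k → pos k ≡ length pre + k) →
    dSuffix xt ps ≤ length (filterᵇ (isNonTemporal s) (take (length ps) (zip (applyUpTo pos (suc (length ps))) (xsOf xt ps))))
  dSuffix≤count pre [] pos eq hpos = z≤n
  dSuffix≤count pre ((x , y) ∷ ps) pos eq hpos
    with IH ← dSuffix≤count (pre ++ (x , y) ∷ []) ps (pos ∘ suc) (trans eq (sym (++-assoc pre ((x , y) ∷ []) ps)))
                (λ k → trans (hpos (suc k)) (sym (trans (cong (_+ k) (length-++ pre)) (+-assoc (length pre) 1 k))))
       | nonTemporal x (xsOf xt ps) in nt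
  ... | false = ≤-trans IH (length-filterᵇ-∷ (isNonTemporal s) _ _)
  ... | true = subst (suc (dSuffix xt ps) ≤_) (sym (length-filterᵇ-∷-true (isNonTemporal s) _ _ head-nonTemporal)) (s≤s IH)
    where
    P : ℕ
    P = length pre
    W≡ : W ≡ map proj₁ pre ++ x ∷ xsOf xt ps
    W≡ = trans (xsOf≡ xt pairs) (trans (cong (xsOf xt) eq) (xsOf-++ xt pre ((x , y) ∷ ps)))
    shift : ∀ {j a} → At (xsOf xt ps) j a → At W (P + suc j) a
    shift {j} {a} p = subst (λ L → At L (P + suc j) a) (sym W≡)
      (subst (λ c → At (map proj₁ pre ++ x ∷ xsOf xt ps) (c + suc j) a) (length-map proj₁ pre) (At-++ (map proj₁ pre) (at-suc p)))
    head-nonTemporal : isNonTemporal s (pos 0 , x) ≡ true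
    head-nonTemporal with nonTemporal⇒At (xsOf xt ps) nt
    ... | j , k , aj , jk , pj , ne , pk rewrite hpos 0 =
      isNonTemporal-intro (P + 0) x (P + suc j) aj (P + suc k) (+-monoʳ-< P (s≤s z≤n)) (+-monoʳ-< P (s≤s jk)) (shift pj) ne (shift pk)

  dSuffix≤dSeq : dSuffix xt pairs ≤ dSeq s
  dSuffix≤dSeq = subst (dSuffix xt pairs ≤_) count≡dSeq (dSuffix≤count [] pairs id refl (λ _ → refl))
    where
    count≡dSeq : length (filterᵇ (isNonTemporal s) (take (length pairs) (zip (applyUpTo id (suc (length pairs))) (xsOf xt pairs))))
        ≡ dSeq s
    count≡dSeq rewrite +-comm (length pairs) 1 | xsOf≡ xt pairs = refl

open DSeqBound using (dSuffix≤dSeq)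

-- Assembling the network

module Build {n : ℕ} (xt : Fin n) (top : ℕ) where
  open Realisations xt top
  open Reticulate xt top
  open AddLeaf xt top
  open Start xt top

  elem-false⇒∉ : ∀ {x ps} → elem x (xsOf xt ps) ≡ false → x ∉ xsOf xt ps
  elem-false⇒∉ x-elem m = true≢false (trans (sym (∈⇒elem m)) x-elem)

  reduces-skip-xx : ∀ {x ps} → ∀ T → Unique (leaves T) → applyPairs ((x , x) ∷ ps) T ≡ leaf xt → applyPairs ps T ≡ leaf xt
  reduces-skip-xx {x} {ps} T u e = trans (cong (applyPairs ps) (sym (pickStep-¬cherry x x T (¬isCherry-xx {x = x} {T = T} u)))) e

  reduces-skip-leadingRun : ∀ {x y ps} → inLeadingRun x y ps ≡ true → ∀ T → Unique (leaves T) → applyPairs ((x , y) ∷ ps) T ≡ leaf xt → applyPairs ps T ≡ leaf xt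
  reduces-skip-leadingRun {x} {y} {ps} dp T u e = go (isCherry x y T) refl
    where
    go : ∀ b → isCherry x y T ≡ b → applyPairs ps T ≡ leaf xt
    go false ch = trans (cong (applyPairs ps) (sym (pickStep-¬cherry x y T ch))) e
    go true ch with Cherry⇒graft (isCherry⇒Cherry T ch) u
    ... | T₂ , g , d , eqT , gad = trans (applyPairs-leadingRun ps (isCherry⇒Cherry T ch) u d dp) (trans (cong (applyPairs ps) (sym (pickStep-cherry x y T ch d))) e)

  build : ∀ (ps : Pairs) → TreeChildPairs ps → SecondsOccur xt ps → length ps < top → OnlyXt ps ⊎ Realisation ps
  build [] _ _ _ = inj₁ (λ { (here e) → e })
  build ((x , y) ∷ ps) (x∉ys , tcp) (y-occ , y-occs) ps<top with build ps tcp y-occs (<-trans (n<1+n _) ps<top) | elem x (xsOf xt ps) in x-elem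
  ... | inj₁ only | true with x Fin.≟ y
  ... | yes refl = inj₁ only′
    where
    only′ : OnlyXt ((x , x) ∷ ps)
    only′ (here e) = trans e (only (elem⇒∈ _ x-elem))
    only′ (there m) = only m
  ... | no ne = ⊥-elim (ne (trans (only (elem⇒∈ _ x-elem)) (sym (only (y-occ ne)))))
  build ((x , y) ∷ ps) (x∉ys , tcp) (y-occ , y-occs) ps<top | inj₁ only | false = inj₂ (start only x y (elem-false⇒∉ x-elem) y-occurs ps<top)
    where
    y-occurs : y ≡ x ⊎ y ≡ xt
    y-occurs with x Fin.≟ y
    ... | yes e = inj₁ (sym e)
    ... | no ne = inj₂ (only (y-occ ne))
  build ((x , y) ∷ ps) (x∉ys , tcp) (y-occ , y-occs) ps<top | inj₂ F | true with x Fin.≟ y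
  ... | yes refl = inj₂ (skipPair F x x (elem⇒∈ _ x-elem) x∉ys (reduces-skip-xx {x} {ps}))
  ... | no ne with inLeadingRun x y ps in dp
  ... | true = inj₂ (skipPair F x y (elem⇒∈ _ x-elem) x∉ys (reduces-skip-leadingRun {x} {y} {ps} dp))
  ... | false = inj₂ (reticulate F x y (elem⇒∈ _ x-elem) (y-occ ne) ne dp x∉ys ps<top)
  build ((x , y) ∷ ps) (x∉ys , tcp) (y-occ , y-occs) ps<top | inj₂ F | false with x Fin.≟ y
  ... | yes e = inj₂ (addLeaf F x y xt (elem-false⇒∉ x-elem) (xt∈xsOf xt ps) (inj₁ (sym e)) x∉ys ps<top)
  ... | no ne = inj₂ (addLeaf F x y y (elem-false⇒∉ x-elem) (y-occ ne) (inj₂ refl) x∉ys ps<top)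

fromℕ : ℕ → ℚ
fromℕ n = mkℚ (ℤ.+ n) 0 (Coprime.sym (1-coprimeTo n))

fromℕ-pos : ∀ n → 0ℚ ℚ.< fromℕ (suc n)
fromℕ-pos n = *<* (ℤ.+<+ (s≤s z≤n))

fromℕ-mono-< : ∀ {a b} → a < b → fromℕ a ℚ.< fromℕ b
fromℕ-mono-< {a} {b} p = *<* (subst₂ ℤ._<_ (sym (ℤP.*-identityʳ (ℤ.+ a))) (sym (ℤP.*-identityʳ (ℤ.+ b))) (ℤ.+<+ p))

fromℕ-mono-≤ : ∀ {a b} → a ≤ b → fromℕ a ℚ.≤ fromℕ b
fromℕ-mono-≤ {a} {b} p = *≤* (subst₂ ℤ._≤_ (sym (ℤP.*-identityʳ (ℤ.+ a))) (sym (ℤP.*-identityʳ (ℤ.+ b))) (ℤ.+≤+ p))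

toEmb : ∀ {n} {N : Network n} {T v vs} → Embeds (Network.arc N) (Network.leafOf N) T v vs → Emb N T v vs
toEmb (leafE x) = leafE x
toEmb (nodeE a b p q) = nodeE (toEmb a) (toEmb b) p q

SemiTemporalDisplay : ∀ {n} → List (BTree n) → ℕ → ℕ → Set
SemiTemporalDisplay {n} Ts r d =
  ∃ λ (N : Network n) → IsTreeChild N × All (Displays N) Ts ×
    Σ (Fin (Network.m N) → ℚ) λ t → IsSemiTemporal N t × reticulationNumber N ≤ r × dNet N t ≤ d

SemiTemporalDisplay-mono : ∀ {n} {Ts : List (BTree n)} {r r′ d d′} → r ≤ r′ → d ≤ d′ →
  SemiTemporalDisplay Ts r d → SemiTemporalDisplay Ts r′ d′
SemiTemporalDisplay-mono r≤ d≤ (N , tc , ds , t , st , rN≤ , dN≤) = N , tc , ds , t , st , ≤-trans rN≤ r≤ , ≤-trans dN≤ d≤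

ReducesTo : ∀ {n} → Pairs → Fin n → BTree n → Set
ReducesTo ps xt T = ∃ λ z → applyPairs ps T ≡ leaf z × z ∈ xt ∷ []

module ToNetwork {n : ℕ} (xt : Fin n) (top : ℕ) {ps : Pairs} (F : Realisations.Realisation xt top ps)
  (all-occur : ∀ z → z ∈ xsOf xt ps) where
  open Realisations xt top
  open Realisation F

  indeg≡ : ∀ v → indeg arc v ≡ length (parents v)
  indeg≡ v = length-filterᵇ-allFin (λ u → arc u v) (parents v) (parents-unique v) (λ u e → arc⇒parent u v e) (λ u mm → parent⇒arc u v mm)

  outdeg≡ : ∀ v → outdeg arc v ≡ length (children v)
  outdeg≡ v = length-filterᵇ-allFin (λ w → arc v w) (children v) (children-unique v) (λ w e → arc⇒child v w e) (λ w mm → child⇒arc v w mm)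

  arc⇒children≢[] : ∀ {u w} → arc u w ≡ true → children u ≢ []
  arc⇒children≢[] {u} {w} e eq with subst (w ∈_) eq (arc⇒child u w e)
  ... | ()

  Path-rank< : ∀ {u v is} → Path arc u v is → children v ≢ [] → rank u < rank v
  Path-rank< (edge e) ne = rank-arc _ _ e ne
  Path-rank< (cons e p) ne = <-trans (rank-arc _ _ e (arc⇒children≢[] (proj₂ (Path-source p)))) (Path-rank< p ne)

  acyclic : Acyclic arc
  acyclic v is p = <-irrefl refl (Path-rank< p (arc⇒children≢[] (proj₂ (Path-source p))))

  degree-kind : ∀ v → (length (children v) ≡ 0 × length (parents v) ≡ 1)
      ⊎ (length (parents v) ≡ 1 × length (children v) ≡ 2)
      ⊎ (length (children v) ≡ 1 × length (parents v) ≡ 2) →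
      (outdeg arc v ≡ 0 × indeg arc v ≡ 1)
    ⊎ (indeg arc v ≡ 1 × 2 ≤ outdeg arc v)
    ⊎ (outdeg arc v ≡ 1 × 2 ≤ indeg arc v)
  degree-kind v (inj₁ (a , b)) = inj₁ (trans (outdeg≡ v) a , trans (indeg≡ v) b)
  degree-kind v (inj₂ (inj₁ (a , b))) = inj₂ (inj₁ (trans (indeg≡ v) a , ≤-reflexive (sym (trans (outdeg≡ v) b))))
  degree-kind v (inj₂ (inj₂ (a , b))) = inj₂ (inj₂ (trans (outdeg≡ v) a , ≤-reflexive (sym (trans (indeg≡ v) b))))

  N : Network n
  N = record
    { m = m ; arc = arc ; root = root ; leafOf = leafOf ; acyclic = acyclic
    ; root-indeg = trans (indeg≡ root) (cong length root-parents)
    ; root-outdeg = λ e → case trans (sym e) (trans (outdeg≡ root) root-children) of λ ()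
    ; vertex-kind = λ v ne → degree-kind v (vertex-kind v ne)
    ; leafOf-injective = λ x y → leafOf-injective x y (all-occur x) (all-occur y)
    ; leafOf-leaf = λ x → trans (outdeg≡ (leafOf x)) (cong length (leaf-children x (all-occur x)))
    ; leaf-labelled = λ v e → Product.map₂ proj₂ (leaf-labelled v (length≡0⇒[] (trans (sym (outdeg≡ v)) e)))
    }
    where
    length≡0⇒[] : ∀ {A : Set} {L : List A} → length L ≡ 0 → L ≡ []
    length≡0⇒[] {L = []} _ = refl

  treeChild : IsTreeChild N
  treeChild v (ne , i1 , o2) with vertex-kind v ne
  ... | inj₁ (o0 , _) = case subst (2 ≤_) (trans (outdeg≡ v) o0) o2 of λ ()
  ... | inj₂ (inj₂ (_ , i2)) = case trans (sym i1) (trans (indeg≡ v) i2) of λ ()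
  ... | inj₂ (inj₁ (li , lo)) with tree-child v li lo
  ... | w , wm , tree-child-w = w , child⇒arc v w wm , not-reticulation tree-child-w
    where
    not-reticulation : TreeChildOf parents children leafOf ps w → ¬ IsReticulation N w
    not-reticulation (inj₁ (a , _)) (_ , _ , r2) = n≮n 1 (subst (2 ≤_) (trans (indeg≡ w) a) r2)
    not-reticulation (inj₂ (z , _ , pz , refl)) (_ , _ , r2) =
      n≮n 1 (subst (2 ≤_) (trans (indeg≡ (leafOf z)) (cong length (leaf-parents z pz))) r2)

  -- Labels are shifted by one because a semi-temporal labelling is positive.
  labelling : Fin m → ℚ
  labelling v = fromℕ (suc (time v))

  tree-arc⇒parents≤1 : ∀ u v → arc u v ≡ true → ¬ IsReticulation N v → length (parents v) ≤ 1
  tree-arc⇒parents≤1 u v e nr with v Fin.≟ root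
  ... | yes refl with subst (u ∈_) root-parents (arc⇒parent u root e)
  ... | ()
  tree-arc⇒parents≤1 u v e nr | no ne with vertex-kind v ne
  ... | inj₁ (_ , a) = ≤-reflexive a
  ... | inj₂ (inj₁ (a , _)) = ≤-reflexive a
  ... | inj₂ (inj₂ (a , b)) = ⊥-elim (nr (ne , trans (outdeg≡ v) a , ≤-reflexive (sym (trans (indeg≡ v) b))))

  semiTemporal : IsSemiTemporal N labelling
  semiTemporal =
    (λ v → fromℕ-pos (time v)) ,
    (λ u v e nr → fromℕ-mono-< (s≤s (time-tree-arc u v e (tree-arc⇒parents≤1 u v e nr)))) ,
    (λ v (_ , _ , i2) → let i2′ = subst (2 ≤_) (indeg≡ v) i2 in
      (λ u e → fromℕ-mono-≤ (s≤s (time-hybrid-arc u v e i2′))) ,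
      Product.map₂ (Product.map₂ (cong (fromℕ ∘ suc))) (time-hybrid-attained v i2′))

  reticulationNumber≤hybrids : reticulationNumber N ≤ hybrids
  reticulationNumber≤hybrids = begin
    reticulationNumber N                                ≡⟨ sum-map-allFin excess ⟩
    sumFin excess                                       ≤⟨ sumFin-mono-≤ excess≤ ⟩
    sumFin (λ v → length (parents v) ∸ 1)               ≡⟨ hybrids-sum ⟩
    hybrids                                             ∎
    where
    open ≤-Reasoning
    excess : Fin m → ℕ
    excess v = if v == root then 0 else indeg arc v ∸ 1
    excess≤ : ∀ v → excess v ≤ length (parents v) ∸ 1
    excess≤ v with v == root
    ... | true = z≤n
    ... | false = ≤-reflexive (cong (_∸ 1) (indeg≡ v))

  hybrids≤weight : hybrids ≤ suc (length ps) ∸ n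
  hybrids≤weight = m+n≤o⇒m≤o∸n hybrids (≤-trans (+-monoʳ-≤ hybrids n≤distinct) hybrids-bound)
    where
    n≤distinct : n ≤ length (distinctXs xt ps)
    n≤distinct = subst (_≤ length (distinctXs xt ps)) (length-tabulate id)
      (Unique-⊆⇒length≤ (allFin⁺ n) (λ {z} _ → xsOf⊆distinctXs xt ps (all-occur z)))

  dNet≤lateArcs : dNet N labelling ≤ length lateArcs
  dNet≤lateArcs = length-filterᵇ≤ (cartesianProduct (allFin m) (allFin m)) _ lateArcs
    (cartesianProduct⁺ (allFin⁺ m) (allFin⁺ m)) late
    where
    late : ∀ p → p ∈ cartesianProduct (allFin m) (allFin m) →
      (arc (proj₁ p) (proj₂ p) ∧ isReticulationᵇ N (proj₂ p) ∧ not (does (labelling (proj₁ p) ℚP.≟ labelling (proj₂ p)))) ≡ true →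
      p ∈ lateArcs
    late (u , v) _ e = lateArcs-complete u v (∧-true⁻ˡ e) hybrid differ
      where
      e′ : (isReticulationᵇ N v ∧ not (does (labelling u ℚP.≟ labelling v))) ≡ true
      e′ = ∧-true⁻ʳ {a = arc u v} e
      indeg>1 : (1 <ᵇ indeg arc v) ≡ true
      indeg>1 = ∧-true⁻ʳ {a = does (outdeg arc v ℕ.≟ 1)}
        (∧-true⁻ʳ {a = not (v == root)} (∧-true⁻ˡ {a = isReticulationᵇ N v} e′))
      hybrid : 2 ≤ length (parents v)
      hybrid = subst (2 ≤_) (indeg≡ v) (<ᵇ⇒< 1 (indeg arc v) (Equivalence.from T-≡ indeg>1))
      differ : time u ≢ time v
      differ q = true≢false (trans (sym (dec-true (labelling u ℚP.≟ labelling v) (cong (fromℕ ∘ suc) q)))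
        (not-true⁻ (∧-true⁻ʳ {a = isReticulationᵇ N v} e′)))

  displaysAll : ∀ {Ts : List (BTree n)} → All IsPhyloTree Ts → All (ReducesTo ps xt) Ts → All (Displays N) Ts
  displaysAll [] [] = []
  displaysAll {T ∷ _} (u ∷ us) ((_ , e , here refl) ∷ es) with displays T u e
  ... | v , vs , emb , uv = (v , vs , toEmb emb , uv) ∷ displaysAll us es

  display : ∀ {Ts : List (BTree n)} → All IsPhyloTree Ts → All (ReducesTo ps xt) Ts →
    SemiTemporalDisplay Ts (suc (length ps) ∸ n) (dSuffix xt ps)
  display uTs rTs = N , treeChild , displaysAll uTs rTs , labelling , semiTemporal ,
    ≤-trans reticulationNumber≤hybrids hybrids≤weight , ≤-trans dNet≤lateArcs lateArcs-bound

module SingleLeaf {n : ℕ} (xt : Fin n) (only-xt : ∀ (z : Fin n) → z ≡ xt) where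

  N : Network n
  N = record
    { m = 1 ; arc = λ _ _ → false ; root = Fin.zero ; leafOf = λ _ → Fin.zero
    ; acyclic = λ { _ _ (edge ()) ; _ _ (cons () _) }
    ; root-indeg = refl ; root-outdeg = λ ()
    ; vertex-kind = λ { Fin.zero ne → ⊥-elim (ne refl) }
    ; leafOf-injective = λ x y _ → trans (only-xt x) (sym (only-xt y))
    ; leafOf-leaf = λ _ → refl ; leaf-labelled = λ { Fin.zero _ → xt , refl } }

  semiTemporal : IsSemiTemporal N (λ _ → fromℕ 1)
  semiTemporal = (λ _ → fromℕ-pos 0) , (λ { _ _ () _ }) , λ { Fin.zero (ne , _) → ⊥-elim (ne refl) }

  displaysAll : ∀ {Ts : List (BTree n)} → All IsPhyloTree Ts → All (Displays N) Ts
  displaysAll [] = []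
  displaysAll {T ∷ _} (u ∷ us) =
    subst (Displays N) (sym (≡leaf T u (λ {z} _ → only-xt z))) (Fin.zero , Fin.zero ∷ [] , leafE xt , Unique-[-] _)
      ∷ displaysAll us

  display : ∀ {Ts : List (BTree n)} → All IsPhyloTree Ts → SemiTemporalDisplay Ts 0 0
  display uTs = N , (λ { Fin.zero (ne , _) → ⊥-elim (ne refl) }) , displaysAll uTs ,
    (λ _ → fromℕ 1) , semiTemporal , z≤n , z≤n

mainTheorem9 : ∀ {n : ℕ} (T : List (BTree n)) → All IsPhyloTree T →
  (s : GenSeq n) → IsFullTreeChildSeqFor s T →
  ∃ λ (N : Network n) → IsTreeChild N × All (Displays N) T ×
    Σ (Fin (Network.m N) → ℚ) λ t → IsSemiTemporal N t ×
      reticulationNumber N ≤ weight s × dNet N t ≤ dSeq s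
mainTheorem9 T uT (mkSeq pairs []) (((() , _) , _) , _)
mainTheorem9 T uT (mkSeq pairs (_ ∷ _ ∷ _)) (_ , (() , _))
mainTheorem9 {n} T uT (mkSeq pairs (xt ∷ [])) (((_ , full) , reduces) , (_ , tree-child)) =
  SemiTemporalDisplay-mono (≤-reflexive (cong (_∸ n) (+-comm 1 (length pairs)))) (dSuffix≤dSeq pairs xt)
    (realise (Build.build xt top pairs tcp (secondsOccur xt [] pairs occurs (λ _ ()) tcp) (n<1+n _)))
  where
  top : ℕ
  top = suc (length pairs)
  tcp : TreeChildPairs pairs
  tcp = treeChildPairs pairs tree-child
  occurs : ∀ z → z ∈ xsOf xt pairs
  occurs z = subst (z ∈_) (xsOf≡ xt pairs) (full z)
  realise : Realisations.OnlyXt xt top pairs ⊎ Realisations.Realisation xt top pairs →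
    SemiTemporalDisplay T (suc (length pairs) ∸ n) (dSuffix xt pairs)
  realise (inj₁ only) = SemiTemporalDisplay-mono z≤n z≤n (SingleLeaf.display xt (only ∘ occurs) uT)
  realise (inj₂ F) = ToNetwork.display xt top F occurs uT reduces
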